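{- For every $n\geqslant 1$, $$Q_n(x,y,z,p,q,r,s,t)=t^{n}\sum_{i+2j+3k=2n+1}\gamma_{n,i,j,k}\left(\frac{x+y+z}{t}\right)^i\left(\frac{xyp+xzq+yzr}{t}\right)^j\left(\frac{xyzpqrs}{t}\right)^{k},$$ the sum over nonnegative integers $i,j,k$.
   Context: A Stirling permutation of order $n$ is a word $\sigma=\sigma_1\cdots\sigma_{2n}$ on the multiset $\{1,1,2,2,\ldots,n,n\}$ such that whenever $\sigma_i=\sigma_j$ with $i<j$, $\sigma_s>\sigma_i$ for all $i<s<j$; $\mathcal{Q}_n$ is the set of these. Convention: $\sigma_0=\sigma_{2n+1}=0$. Each statistic below counts the values $v\in[n]$ with the stated property (positions $i<j$ denote the two occurrences of $v$ where relevant): $\mathrm{asc}$: $v=\sigma_i$ with $\sigma_{i-1}<\sigma_i$; $\mathrm{plat}$: $v=\sigma_i$ with $\sigma_i=\sigma_{i+1}$; $\mathrm{des}$: $v=\sigma_i$ with $\sigma_i>\sigma_{i+1}$; $\mathrm{lap}$: $v=\sigma_i$ with $\sigma_{i-1}<\sigma_i=\sigma_{i+1}$; $\mathrm{rpd}$: $v=\sigma_i$ with $\sigma_{i-1}=\sigma_i>\sigma_{i+1}$; $\mathrm{eud}$: $\sigma_{i-1}<\sigma_i$ and $\sigma_j>\sigma_{j+1}$; $\mathrm{apd}$: $v=\sigma_i$ with $\sigma_{i-1}<\sigma_i=\sigma_{i+1}>\sigma_{i+2}$; $\mathrm{vv}$: both occurrences are valleys, $\sigma_{i-1}>\sigma_i<\sigma_{i+1}$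 and $\sigma_{j-1}>\sigma_j<\sigma_{j+1}$. Define $Q_n(x,y,z,p,q,r,s,t)=\sum_{\sigma\in\mathcal{Q}_n}x^{\mathrm{asc}(\sigma)}y^{\mathrm{plat}(\sigma)}z^{\mathrm{des}(\sigma)}p^{\mathrm{lap}(\sigma)}q^{\mathrm{eud}(\sigma)}r^{\mathrm{rpd}(\sigma)}s^{\mathrm{apd}(\sigma)}t^{\mathrm{vv}(\sigma)}$. The integers $\gamma_{n,i,j,k}$ ($n\geqslant1$; $i,j,k\geqslant0$) are defined by $\gamma_{1,0,0,1}=1$, $\gamma_{1,i,j,k}=0$ otherwise, and for $n\geqslant2$: $\gamma_{n,i,j,k}=3(i+1)\gamma_{n-1,i+1,j,k-1}+2(j+1)\gamma_{n-1,i-1,j+1,k-1}+k\gamma_{n-1,i,j-1,k}$, where terms with a negative index are $0$. (They are the coefficients in $\sum_{\sigma\in\mathcal{Q}_n}x^{\mathrm{asc}}y^{\mathrm{plat}}z^{\mathrm{des}}=\sum_{i+2j+3k=2n+1}\gamma_{n,i,j,k}(x+y+z)^i(xy+yz+zx)^j(xyz)^k$.) -}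

module Defs where

open import Data.Nat as ℕ using (ℕ; zero; suc; _+_; _*_; _∸_; _≡ᵇ_; _<ᵇ_)
open import Data.Bool using (Bool; true; false; _∧_; _∨_; not; if_then_else_)
open import Data.List using (List; []; _∷_; _++_; map; concatMap; length; foldr)
open import Data.Bool.ListAction using (all; any)
open import Data.Rational as ℚ using (ℚ; 0ℚ; 1ℚ)
open import Data.Integer using (+_)
open import Relation.Nullary.Decidable using (does)
open import Relation.Unary using (Decidable)
open import Data.Bool.Properties using (T?)
open import Data.Bool using (T)
open import Data.Product using (_×_; _,_)

range : ℕ → ℕ → List ℕ
range a b = go a (suc b ∸ a)
  where
  go : ℕ → ℕ → List ℕ
  go x zero    = []
  go x (suc k) = x ∷ go (suc x) k

bfilter : {A : Set} → (A → Bool) → List A → List A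
bfilter p []       = []
bfilter p (x ∷ xs) = if p x then x ∷ bfilter p xs else bfilter p xs

bcount : {A : Set} → (A → Bool) → List A → ℕ
bcount p xs = length (bfilter p xs)

at : List ℕ → ℕ → ℕ
at []       _       = 0
at (x ∷ xs) zero    = x
at (x ∷ xs) (suc i) = at xs i

words : ℕ → ℕ → List (List ℕ)
words n zero    = [] ∷ []
words n (suc L) = concatMap (λ a → map (a ∷_) (words n L)) (range 1 n)

occ : ℕ → List ℕ → ℕ
occ v w = bcount (λ a → a ≡ᵇ v) w

isMultisetPerm : ℕ → List ℕ → Bool
isMultisetPerm n w = all (λ v → occ v w ≡ᵇ 2) (range 1 n)

-- Stirling condition: whenever σ_i = σ_j with i < j, σ_s > σ_i for all i < s < j
-- (positions 1-based, σ_i = at w (i ∸ 1))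
stirlingCond : List ℕ → Bool
stirlingCond w =
  all (λ i → all (λ j →
        if (i <ᵇ j) ∧ (at w (i ∸ 1) ≡ᵇ at w (j ∸ 1))
        then all (λ s → at w (i ∸ 1) <ᵇ at w (s ∸ 1)) (range (suc i) (j ∸ 1))
        else true)
      (range 1 (length w)))
    (range 1 (length w))

Stirling : ℕ → List (List ℕ)
Stirling n = bfilter (λ w → isMultisetPerm n w ∧ stirlingCond w) (words n (2 * n))

-- Statistics.  For σ ∈ 𝒬_n, the padded word  0 σ_1 ... σ_{2n} 0  is
-- accessed by  σ[ i ] = at (0 ∷ σ ++ 0 ∷ []) i , so σ[0] = σ[2n+1] = 0
-- (and positions beyond are also read as 0).

σ[_]_ : List ℕ → ℕ → ℕ
σ[ w ] i = at (0 ∷ w ++ 0 ∷ []) i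

positions : List ℕ → List ℕ
positions w = range 1 (length w)

countValuesAt : ℕ → (List ℕ → ℕ → Bool) → List ℕ → ℕ
countValuesAt n P w =
  bcount (λ v → any (λ i → (σ[ w ] i ≡ᵇ v) ∧ P w i) (positions w)) (range 1 n)

occPos : List ℕ → ℕ → List ℕ
occPos w v = bfilter (λ i → σ[ w ] i ≡ᵇ v) (positions w)

countValuesPair : ℕ → (List ℕ → ℕ → ℕ → Bool) → List ℕ → ℕ
countValuesPair n P w = bcount test (range 1 n)
  where
  test : ℕ → Bool
  test v with occPos w v
  ... | i ∷ j ∷ [] = P w i j
  ... | _          = false

asc plat des lap rpd apd eud vv : ℕ → List ℕ → ℕ
asc n = countValuesAt n (λ w i → σ[ w ] (i ∸ 1) <ᵇ σ[ w ] i)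
plat n = countValuesAt n (λ w i → σ[ w ] i ≡ᵇ σ[ w ] (suc i))
des n = countValuesAt n (λ w i → σ[ w ] (suc i) <ᵇ σ[ w ] i)
lap n = countValuesAt n (λ w i → (σ[ w ] (i ∸ 1) <ᵇ σ[ w ] i) ∧ (σ[ w ] i ≡ᵇ σ[ w ] (suc i)))
rpd n = countValuesAt n (λ w i → (σ[ w ] (i ∸ 1) ≡ᵇ σ[ w ] i) ∧ (σ[ w ] (suc i) <ᵇ σ[ w ] i))
apd n = countValuesAt n (λ w i → (σ[ w ] (i ∸ 1) <ᵇ σ[ w ] i) ∧ (σ[ w ] i ≡ᵇ σ[ w ] (suc i))
                                 ∧ (σ[ w ] (suc (suc i)) <ᵇ σ[ w ] (suc i)))
eud n = countValuesPair n (λ w i j → (σ[ w ] (i ∸ 1) <ᵇ σ[ w ] i) ∧ (σ[ w ] (suc j) <ᵇ σ[ w ] j))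
vv n = countValuesPair n (λ w i j →
         (σ[ w ] i <ᵇ σ[ w ] (i ∸ 1)) ∧ (σ[ w ] i <ᵇ σ[ w ] (suc i))
       ∧ (σ[ w ] j <ᵇ σ[ w ] (j ∸ 1)) ∧ (σ[ w ] j <ᵇ σ[ w ] (suc j)))

infixr 8 _^_
_^_ : ℚ → ℕ → ℚ
q ^ zero  = 1ℚ
q ^ suc k = q ℚ.* (q ^ k)

ℕ→ℚ : ℕ → ℚ
ℕ→ℚ m = (+ m) ℚ./ 1

ℚsum : List ℚ → ℚ
ℚsum = foldr ℚ._+_ 0ℚ

Qpoly : ℕ → (x y z p q r s t : ℚ) → ℚ
Qpoly n x y z p q r s t =
  ℚsum (map (λ σ → x ^ asc n σ ℚ.* y ^ plat n σ ℚ.* z ^ des n σ ℚ.* p ^ lap n σ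
                 ℚ.* q ^ eud n σ ℚ.* r ^ rpd n σ ℚ.* s ^ apd n σ ℚ.* t ^ vv n σ)
            (Stirling n))

-- helpers implementing "terms with a negative index are 0"
-- pred? f m = f (m - 1) if m ≥ 1, and 0 otherwise
pred? : (ℕ → ℕ) → ℕ → ℕ
pred? f zero    = 0
pred? f (suc m) = f m

γ : ℕ → ℕ → ℕ → ℕ → ℕ
γ zero _ _ _ = 0
γ (suc zero) zero zero (suc zero) = 1
γ (suc zero) _ _ _ = 0
γ (suc (suc m)) i j k =
    pred? (λ k' → 3 * (i + 1) * γ (suc m) (suc i) j k') k
  + pred? (λ i' → pred? (λ k' → 2 * (j + 1) * γ (suc m) i' (suc j) k') k) i
  + pred? (λ j' → k * γ (suc m) i j' k) j

triples : ℕ → List (ℕ × ℕ × ℕ)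
triples N =
  concatMap (λ i → concatMap (λ j → concatMap (λ k →
      if (i + 2 * j + 3 * k) ≡ᵇ N then (i , j , k) ∷ [] else [])
    (range 0 N)) (range 0 N)) (range 0 N)

module Submission where

-- A Stirling permutation of order n + 1 arises in exactly one way by inserting the plateau
-- (n+1)(n+1) into one of the 2n + 1 gaps of a Stirling permutation of order n.  Give each value v
-- of σ its type (L , M , R): whether its first occurrence is an ascent, whether its two occurrences
-- are adjacent, and whether its second occurrence is a descent.  Each of the eight statistics
-- counts the values whose type has a certain property, so the weight of σ is ∏ᵥ u (type v) for a
-- weight u on types.
--
-- Every gap is owned by exactly one neighbouring position: an ascent owns the gap before it, any
-- other position the gap after it.  Inserting into a gap owned by an occurrence of v clears the
-- corresponding true bit of the type of v, leaves all other types alone and adds a value of type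
-- (1 , 1 , 1).  So summing over the gaps applies to ∏ᵥ u (type v) the derivation ∂ determined by
-- ∂u (l , m , r) = (sum of u over the types with one true bit cleared) · u (1 , 1 , 1).  On
-- e₀ = u (0,0,0), e₁ = Σ u (one bit), e₂ = Σ u (two bits), e₃ = u (1,1,1) it acts by e₀ ↦ 0,
-- e₁ ↦ 3 e₀ e₃, e₂ ↦ 2 e₁ e₃, e₃ ↦ e₂ e₃, which is the recurrence defining γ.  The derivation is
-- realised as the ε-part of the weight over the dual numbers R[ε], so the induction runs over all
-- commutative semirings R at once.  For the weight of the theorem, e₀, e₁, e₂, e₃ evaluate to t,
-- x + y + z, xyp + xzq + yzr and xyzpqrs.

module Preliminaries where

  open import Defs
  open import Data.Nat as ℕ using (ℕ; zero; suc; _+_; _∸_; _≡ᵇ_; _<ᵇ_; _<_; _≤_; z≤n; s≤s)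
  import Data.Nat.Properties as ℕₚ
  open import Data.Bool using (Bool; true; false; T; not; if_then_else_; _∧_; _∨_)
  open import Data.Bool.ListAction using (all; any)
  open import Data.List using (List; []; _∷_; _++_; map; concatMap)
  open import Data.List.Membership.Propositional using (_∈_; find)
  open import Data.List.Membership.Propositional.Properties using (∈-concatMap⁺; ∈-concatMap⁻; ∈-map⁻)
  open import Data.List.Relation.Unary.Any as Any using (here; there)
  open import Data.List.Relation.Unary.All as All using (All; []; _∷_)
  open import Data.List.Relation.Unary.Unique.Propositional using (Unique; []; _∷_)
  import Data.List.Relation.Unary.Unique.Propositional.Properties as Uniqueₚ
  open import Data.Product using (_×_; _,_; proj₁; ∃)
  open import Data.Sum using (_⊎_; inj₁; inj₂)
  open import Data.Empty using (⊥; ⊥-elim)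
  open import Relation.Nullary using (¬_; yes; no)
  open import Relation.Binary.PropositionalEquality

  ≡ᵇ-refl : ∀ a → (a ≡ᵇ a) ≡ true
  ≡ᵇ-refl zero    = refl
  ≡ᵇ-refl (suc a) = ≡ᵇ-refl a

  ≡⇒≡ᵇ-true : ∀ {a b} → a ≡ b → (a ≡ᵇ b) ≡ true
  ≡⇒≡ᵇ-true {a} refl = ≡ᵇ-refl a

  ≡ᵇ-true⇒≡ : ∀ a b → (a ≡ᵇ b) ≡ true → a ≡ b
  ≡ᵇ-true⇒≡ a b e = ℕₚ.≡ᵇ⇒≡ a b (subst T (sym e) _)

  ≢⇒≡ᵇ-false : ∀ a b → ¬ a ≡ b → (a ≡ᵇ b) ≡ false
  ≢⇒≡ᵇ-false a b a≢b with a ≡ᵇ b in eq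
  ... | false = refl
  ... | true  = ⊥-elim (a≢b (≡ᵇ-true⇒≡ a b eq))

  ≡ᵇ-false⇒≢ : ∀ a b → (a ≡ᵇ b) ≡ false → ¬ a ≡ b
  ≡ᵇ-false⇒≢ a .a e refl with () ← trans (sym e) (≡ᵇ-refl a)

  ≡ᵇ-sym : ∀ a b → (a ≡ᵇ b) ≡ (b ≡ᵇ a)
  ≡ᵇ-sym zero    zero    = refl
  ≡ᵇ-sym zero    (suc b) = refl
  ≡ᵇ-sym (suc a) zero    = refl
  ≡ᵇ-sym (suc a) (suc b) = ≡ᵇ-sym a b

  <ᵇ-true⇒< : ∀ a b → (a <ᵇ b) ≡ true → a < b
  <ᵇ-true⇒< a b e = ℕₚ.<ᵇ⇒< a b (subst T (sym e) _)

  <ᵇ-false⇒≥ : ∀ a b → (a <ᵇ b) ≡ false → b ≤ a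
  <ᵇ-false⇒≥ a b e = ℕₚ.≮⇒≥ (λ a<b → subst T e (ℕₚ.<⇒<ᵇ a<b))

  <⇒<ᵇ-true : ∀ {a b} → a < b → (a <ᵇ b) ≡ true
  <⇒<ᵇ-true {a} {b} a<b with a <ᵇ b in eq
  ... | true  = refl
  ... | false = ⊥-elim (ℕₚ.<⇒≱ a<b (<ᵇ-false⇒≥ a b eq))

  ≥⇒<ᵇ-false : ∀ {a b} → b ≤ a → (a <ᵇ b) ≡ false
  ≥⇒<ᵇ-false {a} {b} b≤a with a <ᵇ b in eq
  ... | false = refl
  ... | true  = ⊥-elim (ℕₚ.<⇒≱ (<ᵇ-true⇒< a b eq) b≤a)

  <ᵇ-flip : ∀ {a b} → ¬ a ≡ b → (b <ᵇ a) ≡ not (a <ᵇ b)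
  <ᵇ-flip {a} {b} a≢b with a <ᵇ b in eq
  ... | true  = ≥⇒<ᵇ-false (ℕₚ.<⇒≤ (<ᵇ-true⇒< a b eq))
  ... | false = <⇒<ᵇ-true (ℕₚ.≤∧≢⇒< (<ᵇ-false⇒≥ a b eq) (λ e → a≢b (sym e)))

  ≤⇒<ᵇ≡not≡ᵇ : ∀ {a b} → a ≤ b → (a <ᵇ b) ≡ not (a ≡ᵇ b)
  ≤⇒<ᵇ≡not≡ᵇ {a} {b} a≤b with a ≡ᵇ b in eq
  ... | true  = ≥⇒<ᵇ-false (ℕₚ.≤-reflexive (sym (≡ᵇ-true⇒≡ a b eq)))
  ... | false = <⇒<ᵇ-true (ℕₚ.≤∧≢⇒< a≤b (≡ᵇ-false⇒≢ a b eq))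

  ∧-true⁻ : ∀ a b → a ∧ b ≡ true → a ≡ true × b ≡ true
  ∧-true⁻ true true _ = refl , refl

  ∧-true⁺ : ∀ {a b} → a ≡ true → b ≡ true → a ∧ b ≡ true
  ∧-true⁺ refl refl = refl

  ∨-true⁻ : ∀ a b → a ∨ b ≡ true → a ≡ true ⊎ b ≡ true
  ∨-true⁻ true  b _ = inj₁ refl
  ∨-true⁻ false b e = inj₂ e

  ∨-true⁺ : ∀ a b → a ≡ true ⊎ b ≡ true → a ∨ b ≡ true
  ∨-true⁺ true  b _        = refl
  ∨-true⁺ false b (inj₂ e) = e

  if-true⇒then : ∀ {c x : Bool} → c ≡ true → (if c then x else true) ≡ true → x ≡ true
  if-true⇒then refl h = h

  any-true⁻ : ∀ {A : Set} (f : A → Bool) xs → any f xs ≡ true → ∃ λ x → x ∈ xs × f x ≡ true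
  any-true⁻ f (x ∷ xs) e with f x in eq
  ... | true  = x , here refl , eq
  ... | false with any-true⁻ f xs e
  ... | y , y∈xs , fy = y , there y∈xs , fy

  any-true⁺ : ∀ {A : Set} (f : A → Bool) {xs x} → x ∈ xs → f x ≡ true → any f xs ≡ true
  any-true⁺ f {x ∷ xs} (here refl) fx rewrite fx = refl
  any-true⁺ f {y ∷ xs} (there x∈xs) fx with f y
  ... | true  = refl
  ... | false = any-true⁺ f x∈xs fx

  all-true⁺ : ∀ {A : Set} (f : A → Bool) xs → (∀ x → x ∈ xs → f x ≡ true) → all f xs ≡ true
  all-true⁺ f []       h = refl
  all-true⁺ f (x ∷ xs) h rewrite h x (here refl) = all-true⁺ f xs (λ y y∈xs → h y (there y∈xs))

  all-true⁻ : ∀ {A : Set} (f : A → Bool) xs → all f xs ≡ true → ∀ x → x ∈ xs → f x ≡ true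
  all-true⁻ f (y ∷ xs) e x x∈ with f y in eq
  all-true⁻ f (y ∷ xs) e x (here refl)  | true = eq
  all-true⁻ f (y ∷ xs) e x (there x∈xs) | true = all-true⁻ f xs e x x∈xs

  seq : ℕ → ℕ → List ℕ
  seq x zero    = []
  seq x (suc k) = x ∷ seq (suc x) k

  satisfies-seq⇒≡seq : (f : ℕ → ℕ → List ℕ) → (∀ x → f x 0 ≡ []) →
                       (∀ x k → f x (suc k) ≡ x ∷ f (suc x) k) → ∀ x k → f x k ≡ seq x k
  satisfies-seq⇒≡seq f f0 fs x zero    = f0 x
  satisfies-seq⇒≡seq f f0 fs x (suc k) = trans (fs x k) (cong (x ∷_) (satisfies-seq⇒≡seq f f0 fs (suc x) k))

  -- The local function of range is not in scope; unification finds it as the _ below.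
  range≡seq : ∀ a b → range a b ≡ seq a (suc b ∸ a)
  range≡seq a b with suc b ∸ a | satisfies-seq⇒≡seq _ (λ _ → refl) (λ _ _ → refl)
  ... | zero  | _   = refl
  ... | suc k | go≡ with suc a
  ...   | a+1 = cong (a ∷_) (go≡ a+1 k)

  seq-map-suc : ∀ x k → seq (suc x) k ≡ map suc (seq x k)
  seq-map-suc x zero    = refl
  seq-map-suc x (suc k) = cong (suc x ∷_) (seq-map-suc (suc x) k)

  seq-∷ʳ : ∀ x k → seq x (suc k) ≡ seq x k ++ (x + k) ∷ []
  seq-∷ʳ x zero    = cong (_∷ []) (sym (ℕₚ.+-identityʳ x))
  seq-∷ʳ x (suc k) = cong (x ∷_) (trans (seq-∷ʳ (suc x) k) (cong (λ y → seq (suc x) k ++ y ∷ []) (sym (ℕₚ.+-suc x k))))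

  ∈-seq⁻ : ∀ x k {y} → y ∈ seq x k → x ≤ y × y < x + k
  ∈-seq⁻ x (suc k) (here refl) = ℕₚ.≤-refl , ℕₚ.m<m+n x (s≤s z≤n)
  ∈-seq⁻ x (suc k) {y} (there y∈) with ∈-seq⁻ (suc x) k y∈
  ... | x<y , y<x+k = ℕₚ.<⇒≤ x<y , subst (y <_) (sym (ℕₚ.+-suc x k)) y<x+k

  ∈-seq⁺ : ∀ x k y → x ≤ y → y < x + k → y ∈ seq x k
  ∈-seq⁺ x zero    y x≤y y<x+0 = ⊥-elim (ℕₚ.<⇒≱ y<x+0 (subst (_≤ y) (sym (ℕₚ.+-identityʳ x)) x≤y))
  ∈-seq⁺ x (suc k) y x≤y y<x+k with x ℕ.≟ y
  ... | yes refl = here refl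
  ... | no  x≢y  = there (∈-seq⁺ (suc x) k y (ℕₚ.≤∧≢⇒< x≤y x≢y) (subst (y <_) (ℕₚ.+-suc x k) y<x+k))

  seq-unique : ∀ x k → Unique (seq x k)
  seq-unique x zero    = []
  seq-unique x (suc k) =
    All.tabulate (λ y∈ x≡y → ℕₚ.<-irrefl x≡y (proj₁ (∈-seq⁻ (suc x) k y∈))) ∷ seq-unique (suc x) k

  ∈-range⁻ : ∀ a b {s} → s ∈ range a b → a ≤ s × s ≤ b
  ∈-range⁻ a b {s} s∈ with ∈-seq⁻ a (suc b ∸ a) (subst (s ∈_) (range≡seq a b) s∈)
  ... | a≤s , s<a+[b+1-a] with a ℕ.≤? suc b
  ...   | yes a≤b+1 = a≤s , ℕₚ.≤-pred (subst (s <_) (ℕₚ.m+[n∸m]≡n a≤b+1) s<a+[b+1-a])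
  ...   | no  a≰b+1 = ⊥-elim (ℕₚ.<⇒≱ s<a+[b+1-a]
                        (subst (_≤ s) (sym (trans (cong (a +_) (ℕₚ.m≤n⇒m∸n≡0 (ℕₚ.<⇒≤ (ℕₚ.≰⇒> a≰b+1))))
                                                  (ℕₚ.+-identityʳ a))) a≤s))

  ∈-range⁺ : ∀ a b s → a ≤ s → s ≤ b → s ∈ range a b
  ∈-range⁺ a b s a≤s s≤b = subst (s ∈_) (sym (range≡seq a b))
    (∈-seq⁺ a (suc b ∸ a) s a≤s (subst (s <_) (sym (ℕₚ.m+[n∸m]≡n (ℕₚ.≤-trans a≤s (ℕₚ.m≤n⇒m≤1+n s≤b)))) (s≤s s≤b)))

  range-unique : ∀ a b → Unique (range a b)
  range-unique a b = subst Unique (sym (range≡seq a b)) (seq-unique a _)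

  range1-∷ʳ : ∀ n → range 1 (suc n) ≡ range 1 n ++ suc n ∷ []
  range1-∷ʳ n = trans (range≡seq 1 (suc n)) (trans (seq-∷ʳ 1 n) (cong (_++ suc n ∷ []) (sym (range≡seq 1 n))))

  ∈-bfilter⁺ : ∀ {A : Set} (f : A → Bool) {xs x} → x ∈ xs → f x ≡ true → x ∈ bfilter f xs
  ∈-bfilter⁺ f {y ∷ xs} (here refl) fx rewrite fx = here refl
  ∈-bfilter⁺ f {y ∷ xs} (there x∈xs) fx with f y
  ... | true  = there (∈-bfilter⁺ f x∈xs fx)
  ... | false = ∈-bfilter⁺ f x∈xs fx

  ∈-bfilter⁻ : ∀ {A : Set} (f : A → Bool) xs {x} → x ∈ bfilter f xs → x ∈ xs × f x ≡ true
  ∈-bfilter⁻ f (y ∷ xs) x∈ with f y in eq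
  ∈-bfilter⁻ f (y ∷ xs) (here refl) | true = here refl , eq
  ∈-bfilter⁻ f (y ∷ xs) (there x∈)  | true = let x∈xs , fx = ∈-bfilter⁻ f xs x∈ in there x∈xs , fx
  ∈-bfilter⁻ f (y ∷ xs) x∈          | false = let x∈xs , fx = ∈-bfilter⁻ f xs x∈ in there x∈xs , fx

  bfilter-unique : ∀ {A : Set} (f : A → Bool) {xs} → Unique xs → Unique (bfilter f xs)
  bfilter-unique f [] = []
  bfilter-unique f {y ∷ xs} (y∉ ∷ u) with f y
  ... | true  = All.tabulate (λ x∈ → All.lookup y∉ (proj₁ (∈-bfilter⁻ f xs x∈))) ∷ bfilter-unique f u
  ... | false = bfilter-unique f u

  bfilter-map : ∀ {A B : Set} (g : B → Bool) (h : A → B) xs → bfilter g (map h xs) ≡ map h (bfilter (λ x → g (h x)) xs)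
  bfilter-map g h [] = refl
  bfilter-map g h (x ∷ xs) with g (h x)
  ... | true  = cong (h x ∷_) (bfilter-map g h xs)
  ... | false = bfilter-map g h xs

  bfilter-cong : ∀ {A : Set} {f g : A → Bool} xs → (∀ x → f x ≡ g x) → bfilter f xs ≡ bfilter g xs
  bfilter-cong [] h = refl
  bfilter-cong {g = g} (x ∷ xs) h rewrite h x with g x
  ... | true  = cong (x ∷_) (bfilter-cong xs h)
  ... | false = bfilter-cong xs h

  bfilter-seq-sorted : ∀ (f : ℕ → Bool) x k {a rest} → bfilter f (seq x k) ≡ a ∷ rest → All (a <_) rest
  bfilter-seq-sorted f x (suc k) e with f x
  bfilter-seq-sorted f x (suc k) refl | true =
    All.tabulate (λ m → proj₁ (∈-seq⁻ (suc x) k (proj₁ (∈-bfilter⁻ f (seq (suc x) k) m))))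
  ... | false = bfilter-seq-sorted f (suc x) k e

  ∈-concatMap⁻′ : ∀ {A B : Set} (f : A → List B) xs {y} → y ∈ concatMap f xs → ∃ λ x → x ∈ xs × y ∈ f x
  ∈-concatMap⁻′ f xs y∈ = find (∈-concatMap⁻ f {xs = xs} y∈)

  ∈-concatMap⁺′ : ∀ {A B : Set} (f : A → List B) {xs x y} → x ∈ xs → y ∈ f x → y ∈ concatMap f xs
  ∈-concatMap⁺′ f {xs} x∈ y∈ = ∈-concatMap⁺ f {xs = xs} (Any.map (λ { refl → y∈ }) x∈)

  concatMap-unique : ∀ {A B : Set} (f : A → List B) xs → Unique xs → (∀ a → a ∈ xs → Unique (f a)) →
    (∀ a b → a ∈ xs → b ∈ xs → ¬ a ≡ b → ∀ {z} → z ∈ f a → z ∈ f b → ⊥) → Unique (concatMap f xs)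
  concatMap-unique f []       _          _ _ = []
  concatMap-unique f (x ∷ xs) (x∉ ∷ u) uf disj =
    Uniqueₚ.++⁺ (uf x (here refl))
      (concatMap-unique f xs u (λ a a∈ → uf a (there a∈)) (λ a b a∈ b∈ → disj a b (there a∈) (there b∈)))
      separate
    where
    separate : ∀ {z} → z ∈ f x × z ∈ concatMap f xs → ⊥
    separate (z∈fx , z∈rest) with ∈-concatMap⁻′ f xs z∈rest
    ... | b , b∈xs , z∈fb = disj x b (here refl) (there b∈xs) (All.lookup x∉ b∈xs) z∈fx z∈fb

  map-unique : ∀ {A B : Set} (f : A → B) {xs} → (∀ a b → a ∈ xs → b ∈ xs → f a ≡ f b → a ≡ b) →
               Unique xs → Unique (map f xs)
  map-unique f inj [] = []
  map-unique f {x ∷ xs} inj (x∉ ∷ u) =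
    All.tabulate fx∉ ∷ map-unique f (λ a b a∈ b∈ → inj a b (there a∈) (there b∈)) u
    where
    fx∉ : ∀ {z} → z ∈ map f xs → ¬ f x ≡ z
    fx∉ z∈ fx≡z with ∈-map⁻ f z∈
    ... | b , b∈ , refl = All.lookup x∉ b∈ (inj x b (here refl) (there b∈) fx≡z)

  private
    seq-step : ∀ x k {i} → suc x ≤ i → i < suc x + k → x ≤ i × i < x + suc k
    seq-step x k {i} x<i i<x+1+k = ℕₚ.<⇒≤ x<i , subst (i <_) (sym (ℕₚ.+-suc x k)) i<x+1+k

  bfilter-seq-none : ∀ (f : ℕ → Bool) x k → (∀ i → x ≤ i → i < x + k → f i ≡ false) → bfilter f (seq x k) ≡ []
  bfilter-seq-none f x zero    h = refl
  bfilter-seq-none f x (suc k) h rewrite h x ℕₚ.≤-refl (ℕₚ.m<m+n x (s≤s z≤n)) =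
    bfilter-seq-none f (suc x) k (λ i x<i i< → let a , b = seq-step x k x<i i< in h i a b)

  bfilter-seq-single : ∀ (f : ℕ → Bool) a x k → (∀ i → x ≤ i → i < x + k → f i ≡ true → i ≡ a) →
                       f a ≡ true → x ≤ a → a < x + k → bfilter f (seq x k) ≡ a ∷ []
  bfilter-seq-single f a x zero    h fa x≤a a<x+0 = ⊥-elim (ℕₚ.<⇒≱ a<x+0 (subst (_≤ a) (sym (ℕₚ.+-identityʳ x)) x≤a))
  bfilter-seq-single f a x (suc k) h fa x≤a a<x+k with x ℕ.≟ a
  ... | yes refl rewrite fa = cong (x ∷_) (bfilter-seq-none f (suc x) k rest-false)
    where
    rest-false : ∀ i → suc x ≤ i → i < suc x + k → f i ≡ false
    rest-false i x<i i< with f i in eq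
    ... | false = refl
    ... | true  = let a , b = seq-step x k x<i i< in ⊥-elim (ℕₚ.<-irrefl (sym (h i a b eq)) x<i)
  ... | no x≢a with f x in eq
  ...   | true  = ⊥-elim (x≢a (h x ℕₚ.≤-refl (ℕₚ.m<m+n x (s≤s z≤n)) eq))
  ...   | false = bfilter-seq-single f a (suc x) k (λ i x<i i< → let a , b = seq-step x k x<i i< in h i a b)
                    fa (ℕₚ.≤∧≢⇒< x≤a x≢a) (subst (a <_) (ℕₚ.+-suc x k) a<x+k)

  bfilter-seq-pair : ∀ (f : ℕ → Bool) p q x k → p < q → (∀ i → x ≤ i → i < x + k → f i ≡ true → i ≡ p ⊎ i ≡ q) →
                     f p ≡ true → f q ≡ true → x ≤ p → q < x + k → bfilter f (seq x k) ≡ p ∷ q ∷ []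
  bfilter-seq-pair f p q x zero    p<q h fp fq x≤p q<x+0 =
    ⊥-elim (ℕₚ.<⇒≱ q<x+0 (subst (_≤ q) (sym (ℕₚ.+-identityʳ x)) (ℕₚ.≤-trans x≤p (ℕₚ.<⇒≤ p<q))))
  bfilter-seq-pair f p q x (suc k) p<q h fp fq x≤p q<x+k with x ℕ.≟ p
  ... | yes refl rewrite fp =
    cong (x ∷_) (bfilter-seq-single f q (suc x) k only-q fq p<q (subst (q <_) (ℕₚ.+-suc x k) q<x+k))
    where
    only-q : ∀ i → suc x ≤ i → i < suc x + k → f i ≡ true → i ≡ q
    only-q i x<i i< fi with (let a , b = seq-step x k x<i i< in h i a b fi)
    ... | inj₁ refl = ⊥-elim (ℕₚ.<-irrefl refl x<i)
    ... | inj₂ i≡q  = i≡q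
  ... | no x≢p with f x in eq
  ...   | true  = ⊥-elim (neither (h x ℕₚ.≤-refl (ℕₚ.m<m+n x (s≤s z≤n)) eq))
    where
    neither : ¬ (x ≡ p ⊎ x ≡ q)
    neither (inj₁ x≡p)  = x≢p x≡p
    neither (inj₂ refl) = ℕₚ.<⇒≱ p<q x≤p
  ...   | false = bfilter-seq-pair f p q (suc x) k p<q (λ i x<i i< → let a , b = seq-step x k x<i i< in h i a b)
                    fp fq (ℕₚ.≤∧≢⇒< x≤p x≢p) (subst (q <_) (ℕₚ.+-suc x k) q<x+k)

module CommutativeSemirings where

  open Preliminaries
  open import Defs using (bfilter)
  open import Algebra.Bundles using (CommutativeSemiring)
  open import Algebra.Structures using (IsCommutativeSemiring; IsCommutativeMonoid)
  open import Algebra.Structures.Biased using (isCommutativeMonoidˡ; isCommutativeSemiringˡ)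
  open import Algebra.Definitions using (Associative; Commutative; LeftIdentity)
  import Algebra.Definitions.RawSemiring as RawSemiringDefinitions
  import Algebra.Properties.Semiring.Mult as SemiringMult
  import Algebra.Properties.Semiring.Exp as SemiringExp
  import Algebra.Properties.CommutativeSemiring.Exp as CommutativeSemiringExp
  import Algebra.Properties.CommutativeMonoid.Mult as CommutativeMonoidMult
  open import Data.Nat as ℕ using (ℕ; zero; suc)
  import Data.Nat.Properties as ℕₚ
  open import Data.Bool using (Bool; true; false; if_then_else_)
  open import Data.List using (List; []; _∷_; _++_; map; concatMap; foldr)
  open import Data.List.Membership.Propositional using (_∈_; _∉_)
  open import Data.List.Relation.Unary.Any using (here; there)
  open import Data.List.Relation.Unary.All as All using ([]; _∷_)
  open import Data.List.Relation.Unary.Unique.Propositional using (Unique; []; _∷_)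
  open import Data.List.Relation.Binary.Permutation.Propositional using (_↭_; ↭⇒↭ₛ)
  import Data.List.Relation.Binary.Permutation.Propositional.Properties as ↭ₚ
  open import Data.List.Relation.Binary.Permutation.Setoid.Properties using (foldr-commMonoid)
  open import Data.Product using (_×_; _,_; proj₁; proj₂)
  open import Data.Empty using (⊥-elim)
  open import Level using (0ℓ)
  open import Relation.Binary.PropositionalEquality

  record ≡-CommutativeSemiring : Set₁ where
    infixl 6 _+_
    infixl 7 _*_
    field
      Carrier               : Set
      _+_ _*_               : Carrier → Carrier → Carrier
      0# 1#                 : Carrier
      isCommutativeSemiring : IsCommutativeSemiring _≡_ _+_ _*_ 0# 1#

    commutativeSemiring : CommutativeSemiring 0ℓ 0ℓ
    commutativeSemiring = record { isCommutativeSemiring = isCommutativeSemiring }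

    open CommutativeSemiring commutativeSemiring public
      using ( +-assoc; +-comm; +-identityˡ; +-identityʳ; *-assoc; *-comm; *-identityˡ; *-identityʳ
            ; zeroˡ; zeroʳ; distribˡ; distribʳ; semiring; rawSemiring
            ; +-isCommutativeMonoid; +-commutativeMonoid; *-commutativeMonoid )

  isCommutativeMonoid-≡ : ∀ {A : Set} {_∙_ : A → A → A} {ε : A} →
    Associative _≡_ _∙_ → Commutative _≡_ _∙_ → LeftIdentity _≡_ ε _∙_ → IsCommutativeMonoid _≡_ _∙_ ε
  isCommutativeMonoid-≡ {_∙_ = _∙_} assoc comm identityˡ = isCommutativeMonoidˡ record
    { isSemigroup = record { isMagma = record { isEquivalence = isEquivalence ; ∙-cong = cong₂ _∙_ }
                           ; assoc = assoc }
    ; identityˡ = identityˡ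
    ; comm = comm }

  ℕ-semiring : ≡-CommutativeSemiring
  ℕ-semiring = record { isCommutativeSemiring = ℕₚ.+-*-isCommutativeSemiring }

  ∑ℕ : ∀ {A : Set} → List A → (A → ℕ) → ℕ
  ∑ℕ xs f = foldr ℕ._+_ 0 (map f xs)

  module SemiringSums (R : ≡-CommutativeSemiring) where

    open ≡-CommutativeSemiring R public
    open RawSemiringDefinitions rawSemiring public using (_^_) renaming (_×_ to _·_)
    open SemiringMult semiring public using (×-homo-+; ×-assocˡ; ×-comm-*; ×-assoc-*)
    open SemiringExp semiring public using (^-homo-*)
    open CommutativeSemiringExp commutativeSemiring public using (^-distrib-*)
    open CommutativeMonoidMult +-commutativeMonoid public using (×-distrib-+)
    open ≡-Reasoning

    ·-zeroʳ : ∀ n → n · 0# ≡ 0#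
    ·-zeroʳ zero    = refl
    ·-zeroʳ (suc n) = trans (+-identityˡ _) (·-zeroʳ n)

    ∑ : ∀ {A : Set} → List A → (A → Carrier) → Carrier
    ∑ xs f = foldr _+_ 0# (map f xs)

    ∏ : ∀ {A : Set} → List A → (A → Carrier) → Carrier
    ∏ xs f = foldr _*_ 1# (map f xs)

    +-middle-swap : ∀ a b c d → (a + b) + (c + d) ≡ (a + c) + (b + d)
    +-middle-swap a b c d = begin
      (a + b) + (c + d) ≡⟨ +-assoc a b (c + d) ⟩
      a + (b + (c + d)) ≡⟨ cong (a +_) (sym (+-assoc b c d)) ⟩
      a + ((b + c) + d) ≡⟨ cong (λ z → a + (z + d)) (+-comm b c) ⟩
      a + ((c + b) + d) ≡⟨ cong (a +_) (+-assoc c b d) ⟩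
      a + (c + (b + d)) ≡⟨ sym (+-assoc a c (b + d)) ⟩
      (a + c) + (b + d) ∎

    *-middle-swap : ∀ a b c d → (a * b) * (c * d) ≡ (a * c) * (b * d)
    *-middle-swap a b c d = begin
      (a * b) * (c * d) ≡⟨ *-assoc a b (c * d) ⟩
      a * (b * (c * d)) ≡⟨ cong (a *_) (sym (*-assoc b c d)) ⟩
      a * ((b * c) * d) ≡⟨ cong (λ z → a * (z * d)) (*-comm b c) ⟩
      a * ((c * b) * d) ≡⟨ cong (a *_) (*-assoc c b d) ⟩
      a * (c * (b * d)) ≡⟨ sym (*-assoc a c (b * d)) ⟩
      (a * c) * (b * d) ∎

    *-left-swap : ∀ a b c → a * (b * c) ≡ b * (a * c)
    *-left-swap a b c = trans (sym (*-assoc a b c)) (trans (cong (_* c) (*-comm a b)) (*-assoc b a c))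

    ∑-++ : ∀ {A : Set} (xs ys : List A) f → ∑ (xs ++ ys) f ≡ ∑ xs f + ∑ ys f
    ∑-++ []       ys f = sym (+-identityˡ _)
    ∑-++ (x ∷ xs) ys f = trans (cong (f x +_) (∑-++ xs ys f)) (sym (+-assoc _ _ _))

    ∏-++ : ∀ {A : Set} (xs ys : List A) f → ∏ (xs ++ ys) f ≡ ∏ xs f * ∏ ys f
    ∏-++ []       ys f = sym (*-identityˡ _)
    ∏-++ (x ∷ xs) ys f = trans (cong (f x *_) (∏-++ xs ys f)) (sym (*-assoc _ _ _))

    ∑-cong : ∀ {A : Set} (xs : List A) {f g} → (∀ x → x ∈ xs → f x ≡ g x) → ∑ xs f ≡ ∑ xs g
    ∑-cong []       h = refl
    ∑-cong (x ∷ xs) h = cong₂ _+_ (h x (here refl)) (∑-cong xs (λ y y∈ → h y (there y∈)))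

    ∏-cong : ∀ {A : Set} (xs : List A) {f g} → (∀ x → x ∈ xs → f x ≡ g x) → ∏ xs f ≡ ∏ xs g
    ∏-cong []       h = refl
    ∏-cong (x ∷ xs) h = cong₂ _*_ (h x (here refl)) (∏-cong xs (λ y y∈ → h y (there y∈)))

    ∑-distrib-+ : ∀ {A : Set} (xs : List A) f g → ∑ xs (λ x → f x + g x) ≡ ∑ xs f + ∑ xs g
    ∑-distrib-+ []       f g = sym (+-identityˡ _)
    ∑-distrib-+ (x ∷ xs) f g = trans (cong (f x + g x +_) (∑-distrib-+ xs f g)) (+-middle-swap _ _ _ _)

    ∏-distrib-* : ∀ {A : Set} (xs : List A) f g → ∏ xs (λ x → f x * g x) ≡ ∏ xs f * ∏ xs g
    ∏-distrib-* []       f g = sym (*-identityˡ _)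
    ∏-distrib-* (x ∷ xs) f g = trans (cong (f x * g x *_) (∏-distrib-* xs f g)) (*-middle-swap _ _ _ _)

    *-distribˡ-∑ : ∀ {A : Set} (xs : List A) a f → a * ∑ xs f ≡ ∑ xs (λ x → a * f x)
    *-distribˡ-∑ []       a f = zeroʳ a
    *-distribˡ-∑ (x ∷ xs) a f = trans (distribˡ a _ _) (cong (a * f x +_) (*-distribˡ-∑ xs a f))

    ∑-zero : ∀ {A : Set} (xs : List A) f → (∀ x → x ∈ xs → f x ≡ 0#) → ∑ xs f ≡ 0#
    ∑-zero []       f h = refl
    ∑-zero (x ∷ xs) f h = trans (cong₂ _+_ (h x (here refl)) (∑-zero xs f (λ y y∈ → h y (there y∈)))) (+-identityˡ 0#)

    ∑-map : ∀ {A B : Set} (g : A → B) (xs : List A) f → ∑ (map g xs) f ≡ ∑ xs (λ x → f (g x))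
    ∑-map g []       f = refl
    ∑-map g (x ∷ xs) f = cong (f (g x) +_) (∑-map g xs f)

    ∑-concatMap : ∀ {A B : Set} (g : A → List B) (xs : List A) f → ∑ (concatMap g xs) f ≡ ∑ xs (λ x → ∑ (g x) f)
    ∑-concatMap g []       f = refl
    ∑-concatMap g (x ∷ xs) f = trans (∑-++ (g x) (concatMap g xs) f) (cong (∑ (g x) f +_) (∑-concatMap g xs f))

    ∑-comm : ∀ {A B : Set} (xs : List A) (ys : List B) (f : A → B → Carrier) →
             ∑ xs (λ x → ∑ ys (λ y → f x y)) ≡ ∑ ys (λ y → ∑ xs (λ x → f x y))
    ∑-comm []       ys f = sym (∑-zero ys (λ _ → 0#) (λ _ _ → refl))
    ∑-comm (x ∷ xs) ys f = trans (cong (∑ ys (λ y → f x y) +_) (∑-comm xs ys f))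
      (sym (∑-distrib-+ ys (λ y → f x y) (λ y → ∑ xs (λ x′ → f x′ y))))

    ∑-↭ : ∀ {A : Set} {xs ys : List A} f → xs ↭ ys → ∑ xs f ≡ ∑ ys f
    ∑-↭ f xs↭ys = foldr-commMonoid (setoid Carrier) +-isCommutativeMonoid (↭⇒↭ₛ (↭ₚ.map⁺ f xs↭ys))

    ∑-bfilter : ∀ {A : Set} (b : A → Bool) (xs : List A) f → ∑ xs (λ x → if b x then f x else 0#) ≡ ∑ (bfilter b xs) f
    ∑-bfilter b []       f = refl
    ∑-bfilter b (x ∷ xs) f with b x
    ... | true  = cong (f x +_) (∑-bfilter b xs f)
    ... | false = trans (+-identityˡ _) (∑-bfilter b xs f)

    ∑-if-× : ∀ {A : Set} (xs : List A) (b : A → Bool) (c : A → ℕ) v →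
      ∑ xs (λ x → if b x then c x · v else 0#) ≡ ∑ℕ xs (λ x → if b x then c x else 0) · v
    ∑-if-× []       b c v = refl
    ∑-if-× (x ∷ xs) b c v with b x
    ... | true  = trans (cong (c x · v +_) (∑-if-× xs b c v)) (sym (×-homo-+ v (c x) _))
    ... | false = trans (+-identityˡ _) (∑-if-× xs b c v)

    module Keyed {K : Set} (_==_ : K → K → Bool)
                 (==⇒≡ : ∀ a b → (a == b) ≡ true → a ≡ b) (==-refl : ∀ a → (a == a) ≡ true) where

      ∑-pick : ∀ (ks : List K) a (f : K → Carrier) → Unique ks → a ∈ ks →
               ∑ ks (λ k → if a == k then f k else 0#) ≡ f a
      ∑-pick (k ∷ ks) a f (k∉ ∷ u) (here refl) rewrite ==-refl a =
        trans (cong (f a +_) (∑-zero ks _ others)) (+-identityʳ _)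
        where
        others : ∀ k′ → k′ ∈ ks → (if a == k′ then f k′ else 0#) ≡ 0#
        others k′ k′∈ with a == k′ in eq
        ... | false = refl
        ... | true  = ⊥-elim (All.lookup k∉ k′∈ (==⇒≡ a k′ eq))
      ∑-pick (k ∷ ks) a f (k∉ ∷ u) (there a∈) with a == k in eq
      ... | true  = ⊥-elim (All.lookup k∉ a∈ (sym (==⇒≡ a k eq)))
      ... | false = trans (+-identityˡ _) (∑-pick ks a f u a∈)

      ∑-groupBy : ∀ {A : Set} (xs : List A) (ks : List K) (key : A → K) (h : A → Carrier) →
                  Unique ks → (∀ x → x ∈ xs → key x ∈ ks) →
                  ∑ xs h ≡ ∑ ks (λ k → ∑ xs (λ x → if key x == k then h x else 0#))
      ∑-groupBy xs ks key h u keys∈ = begin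
        ∑ xs h
          ≡⟨ ∑-cong xs (λ x x∈ → sym (∑-pick ks (key x) (λ _ → h x) u (keys∈ x x∈))) ⟩
        ∑ xs (λ x → ∑ ks (λ k → if key x == k then h x else 0#))
          ≡⟨ ∑-comm xs ks _ ⟩
        ∑ ks (λ k → ∑ xs (λ x → if key x == k then h x else 0#)) ∎

      ∏-except : K → List K → (K → Carrier) → Carrier
      ∏-except a ks f = ∏ ks (λ k → if k == a then 1# else f k)

      ∏-update-∉ : ∀ (ks : List K) a x (f : K → Carrier) → a ∉ ks →
                   ∏ ks (λ k → if k == a then x else f k) ≡ ∏ ks f
      ∏-update-∉ ks a x f a∉ = ∏-cong ks unchanged
        where
        unchanged : ∀ k → k ∈ ks → (if k == a then x else f k) ≡ f k
        unchanged k k∈ with k == a in eq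
        ... | false = refl
        ... | true  = ⊥-elim (a∉ (subst (_∈ ks) (==⇒≡ k a eq) k∈))

      ∏-update : ∀ (ks : List K) a x (f : K → Carrier) → Unique ks → a ∈ ks →
                 ∏ ks (λ k → if k == a then x else f k) ≡ x * ∏-except a ks f
      ∏-update (k ∷ ks) a x f (k∉ ∷ u) (here refl) rewrite ==-refl a = begin
        x * ∏ ks (λ k → if k == a then x else f k)   ≡⟨ cong (x *_) (∏-update-∉ ks a x f a∉) ⟩
        x * ∏ ks f                                   ≡⟨ cong (x *_) (sym (∏-update-∉ ks a 1# f a∉)) ⟩
        x * ∏-except a ks f                          ≡⟨ cong (x *_) (sym (*-identityˡ _)) ⟩
        x * (1# * ∏-except a ks f)                   ∎
        where
        a∉ : a ∉ ks
        a∉ a∈ = All.lookup k∉ a∈ refl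
      ∏-update (k ∷ ks) a x f (k∉ ∷ u) (there a∈) with k == a in eq
      ... | true  = ⊥-elim (All.lookup k∉ a∈ (==⇒≡ k a eq))
      ... | false = trans (cong (f k *_) (∏-update ks a x f u a∈)) (*-left-swap _ _ _)

  module DualNumbers (R : ≡-CommutativeSemiring) where

    open SemiringSums R

    -- Elements a + b ε with ε² = 0.
    Dual : ≡-CommutativeSemiring
    Dual = record
      { Carrier = Carrier × Carrier
      ; _+_ = λ (a , a′) (b , b′) → (a + b , a′ + b′)
      ; _*_ = λ (a , a′) (b , b′) → (a * b , a * b′ + a′ * b)
      ; 0# = (0# , 0#)
      ; 1# = (1# , 0#)
      ; isCommutativeSemiring = isCommutativeSemiringˡ record
        { +-isCommutativeMonoid = isCommutativeMonoid-≡
            (λ _ _ _ → cong₂ _,_ (+-assoc _ _ _) (+-assoc _ _ _))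
            (λ _ _ → cong₂ _,_ (+-comm _ _) (+-comm _ _))
            (λ _ → cong₂ _,_ (+-identityˡ _) (+-identityˡ _))
        ; *-isCommutativeMonoid = isCommutativeMonoid-≡
            (λ (a , a′) (b , b′) (c , c′) → cong₂ _,_ (*-assoc a b c) (ε-part-assoc a a′ b b′ c c′))
            (λ _ _ → cong₂ _,_ (*-comm _ _) (trans (+-comm _ _) (cong₂ _+_ (*-comm _ _) (*-comm _ _))))
            (λ _ → cong₂ _,_ (*-identityˡ _) (trans (cong₂ _+_ (*-identityˡ _) (zeroˡ _)) (+-identityʳ _)))
        ; distribʳ = λ _ _ _ → cong₂ _,_ (distribʳ _ _ _)
            (trans (cong₂ _+_ (distribʳ _ _ _) (distribʳ _ _ _)) (+-middle-swap _ _ _ _))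
        ; zeroˡ = λ _ → cong₂ _,_ (zeroˡ _) (trans (cong₂ _+_ (zeroˡ _) (zeroˡ _)) (+-identityˡ _))
        }
      }
      where
      open ≡-Reasoning
      ε-part-assoc : ∀ a a′ b b′ c c′ → (a * b) * c′ + (a * b′ + a′ * b) * c ≡ a * (b * c′ + b′ * c) + a′ * (b * c)
      ε-part-assoc a a′ b b′ c c′ = begin
        (a * b) * c′ + (a * b′ + a′ * b) * c         ≡⟨ cong ((a * b) * c′ +_) (distribʳ c _ _) ⟩
        (a * b) * c′ + ((a * b′) * c + (a′ * b) * c) ≡⟨ sym (+-assoc _ _ _) ⟩
        ((a * b) * c′ + (a * b′) * c) + (a′ * b) * c ≡⟨ cong₂ _+_ (cong₂ _+_ (*-assoc a b c′) (*-assoc a b′ c)) (*-assoc a′ b c) ⟩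
        (a * (b * c′) + a * (b′ * c)) + a′ * (b * c) ≡⟨ cong (_+ a′ * (b * c)) (sym (distribˡ a _ _)) ⟩
        a * (b * c′ + b′ * c) + a′ * (b * c)         ∎

    private module D = SemiringSums Dual
    open ≡-Reasoning

    proj₁-∑ : ∀ {A : Set} (xs : List A) f → proj₁ (D.∑ xs f) ≡ ∑ xs (λ x → proj₁ (f x))
    proj₁-∑ []       f = refl
    proj₁-∑ (x ∷ xs) f = cong (proj₁ (f x) +_) (proj₁-∑ xs f)

    proj₂-∑ : ∀ {A : Set} (xs : List A) f → proj₂ (D.∑ xs f) ≡ ∑ xs (λ x → proj₂ (f x))
    proj₂-∑ []       f = refl
    proj₂-∑ (x ∷ xs) f = cong (proj₂ (f x) +_) (proj₂-∑ xs f)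

    proj₁-∏ : ∀ {A : Set} (xs : List A) f → proj₁ (D.∏ xs f) ≡ ∏ xs (λ x → proj₁ (f x))
    proj₁-∏ []       f = refl
    proj₁-∏ (x ∷ xs) f = cong (proj₁ (f x) *_) (proj₁-∏ xs f)

    proj₁-· : ∀ n x → proj₁ (n D.· x) ≡ n · proj₁ x
    proj₁-· zero    x = refl
    proj₁-· (suc n) x = cong (proj₁ x +_) (proj₁-· n x)

    proj₂-· : ∀ n x → proj₂ (n D.· x) ≡ n · proj₂ x
    proj₂-· zero    x = refl
    proj₂-· (suc n) x = cong (proj₂ x +_) (proj₂-· n x)

    proj₁-^ : ∀ x k → proj₁ (x D.^ k) ≡ proj₁ x ^ k
    proj₁-^ x zero    = refl
    proj₁-^ x (suc k) = cong (proj₁ x *_) (proj₁-^ x k)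

    proj₂-^ : ∀ x k → proj₂ (x D.^ k) ≡ k · (proj₁ x ^ (k ℕ.∸ 1) * proj₂ x)
    proj₂-^ x zero = refl
    proj₂-^ (a , b) (suc zero) = begin
      a * 0# + b * 1#   ≡⟨ cong₂ _+_ (zeroʳ a) (*-identityʳ b) ⟩
      0# + b            ≡⟨ +-identityˡ b ⟩
      b                 ≡⟨ sym (*-identityˡ b) ⟩
      1# * b            ≡⟨ sym (+-identityʳ _) ⟩
      1# * b + 0#       ∎
    proj₂-^ (a , b) (suc (suc k)) = begin
      a * proj₂ ((a , b) D.^ suc k) + b * proj₁ ((a , b) D.^ suc k)
        ≡⟨ cong₂ _+_ (cong (a *_) (proj₂-^ (a , b) (suc k))) (cong (b *_) (proj₁-^ (a , b) (suc k))) ⟩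
      a * (suc k · (a ^ k * b)) + b * a ^ suc k
        ≡⟨ cong₂ _+_ (×-comm-* (suc k) a _) (*-comm b _) ⟩
      suc k · (a * (a ^ k * b)) + a ^ suc k * b
        ≡⟨ cong (λ z → suc k · z + a ^ suc k * b) (sym (*-assoc a _ b)) ⟩
      suc k · (a ^ suc k * b) + a ^ suc k * b
        ≡⟨ +-comm _ _ ⟩
      suc (suc k) · (a ^ suc k * b) ∎

    module Leibniz {K : Set} (_==_ : K → K → Bool)
                   (==⇒≡ : ∀ a b → (a == b) ≡ true → a ≡ b) (==-refl : ∀ a → (a == a) ≡ true) where

      open Keyed _==_ ==⇒≡ ==-refl

      proj₂-∏ : ∀ (ks : List K) f → Unique ks →
                proj₂ (D.∏ ks f) ≡ ∑ ks (λ k → proj₂ (f k) * ∏-except k ks (λ k′ → proj₁ (f k′)))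
      proj₂-∏ []       f u = refl
      proj₂-∏ (k ∷ ks) f (k∉ ∷ u) = begin
        a k * proj₂ (D.∏ ks f) + b k * proj₁ (D.∏ ks f)
          ≡⟨ cong₂ _+_ (cong (a k *_) (proj₂-∏ ks f u)) (cong (b k *_) (proj₁-∏ ks f)) ⟩
        a k * ∑ ks (λ k′ → b k′ * ∏-except k′ ks a) + b k * ∏ ks a
          ≡⟨ +-comm _ _ ⟩
        b k * ∏ ks a + a k * ∑ ks (λ k′ → b k′ * ∏-except k′ ks a)
          ≡⟨ cong₂ _+_ (cong (b k *_) head) (trans (*-distribˡ-∑ ks (a k) _) (∑-cong ks tail)) ⟩
        b k * ∏-except k (k ∷ ks) a + ∑ ks (λ k′ → b k′ * ∏-except k′ (k ∷ ks) a) ∎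
        where
        a b : K → Carrier
        a k′ = proj₁ (f k′)
        b k′ = proj₂ (f k′)
        k∉ks : k ∉ ks
        k∉ks k∈ = All.lookup k∉ k∈ refl
        head : ∏ ks a ≡ ∏-except k (k ∷ ks) a
        head rewrite ==-refl k = trans (sym (∏-update-∉ ks k 1# a k∉ks)) (sym (*-identityˡ _))
        tail : ∀ k′ → k′ ∈ ks → a k * (b k′ * ∏-except k′ ks a) ≡ b k′ * ∏-except k′ (k ∷ ks) a
        tail k′ k′∈ with k == k′ in eq
        ... | true  = ⊥-elim (k∉ks (subst (_∈ ks) (sym (==⇒≡ k k′ eq)) k′∈))
        ... | false = *-left-swap _ _ _

module StirlingWords where

  open Preliminaries
  open import Defs
  open import Data.Nat as ℕ using (ℕ; zero; suc; _+_; _*_; _<_; _≤_; z≤n; s≤s)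
  import Data.Nat.Properties as ℕₚ
  open import Data.List using (List; []; _∷_; map; concatMap; length)
  open import Data.List.Membership.Propositional using (_∈_)
  open import Data.List.Membership.Propositional.Properties using (∈-map⁻)
  open import Data.List.Relation.Unary.Any using (here)
  open import Data.Product using (_,_; proj₂; ∃)
  open import Data.Sum using (_⊎_; inj₁; inj₂)
  open import Data.Empty using (⊥-elim)
  open import Relation.Nullary using (¬_; yes; no)
  open import Relation.Binary.PropositionalEquality
  open import Relation.Binary.Definitions using (tri<; tri≈; tri>)

  σ[]-suc : ∀ w k → σ[ w ] (suc k) ≡ at w k
  σ[]-suc []      zero    = refl
  σ[]-suc []      (suc k) = refl
  σ[]-suc (x ∷ w) zero    = refl
  σ[]-suc (x ∷ w) (suc k) = σ[]-suc w k

  at-beyond : ∀ w k → length w ≤ k → at w k ≡ 0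
  at-beyond []      k       _         = refl
  at-beyond (x ∷ w) (suc k) (s≤s w≤k) = at-beyond w k w≤k

  σ[]-beyond : ∀ w k → length w < k → σ[ w ] k ≡ 0
  σ[]-beyond w (suc k) (s≤s w≤k) = trans (σ[]-suc w k) (at-beyond w k w≤k)

  -- Gap g of σ is the gap after its g-th letter; gap 0 is in front of the first letter.
  insertPair : ℕ → List ℕ → ℕ → List ℕ
  insertPair N σ       zero    = N ∷ N ∷ σ
  insertPair N []      (suc g) = N ∷ N ∷ []
  insertPair N (a ∷ σ) (suc g) = a ∷ insertPair N σ g

  length-insertPair : ∀ N σ g → g ≤ length σ → length (insertPair N σ g) ≡ suc (suc (length σ))
  length-insertPair N σ       zero    _         = refl
  length-insertPair N (a ∷ σ) (suc g) (s≤s g≤) = cong suc (length-insertPair N σ g g≤)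

  module _ (N : ℕ) where

    private
      at-below : ∀ σ g k → k < g → g ≤ length σ → at (insertPair N σ g) k ≡ at σ k
      at-below (a ∷ σ) (suc g) zero    _         _        = refl
      at-below (a ∷ σ) (suc g) (suc k) (s≤s k<g) (s≤s g≤) = at-below σ g k k<g g≤

      at-first : ∀ σ g → g ≤ length σ → at (insertPair N σ g) g ≡ N
      at-first σ       zero    _        = refl
      at-first (a ∷ σ) (suc g) (s≤s g≤) = at-first σ g g≤

      at-second : ∀ σ g → g ≤ length σ → at (insertPair N σ g) (suc g) ≡ N
      at-second σ       zero    _        = refl
      at-second (a ∷ σ) (suc g) (s≤s g≤) = at-second σ g g≤

      at-above : ∀ σ g k → g ≤ k → g ≤ length σ → at (insertPair N σ g) (suc (suc k)) ≡ at σ k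
      at-above σ       zero    k       _         _        = refl
      at-above (a ∷ σ) (suc g) (suc k) (s≤s g≤k) (s≤s g≤) = at-above σ g k g≤k g≤

    insertPair-below : ∀ σ g i → i ≤ g → g ≤ length σ → σ[ insertPair N σ g ] i ≡ σ[ σ ] i
    insertPair-below σ g zero    _   _  = refl
    insertPair-below σ g (suc k) i≤g g≤ =
      trans (σ[]-suc (insertPair N σ g) k) (trans (at-below σ g k i≤g g≤) (sym (σ[]-suc σ k)))

    insertPair-first : ∀ σ g → g ≤ length σ → σ[ insertPair N σ g ] (suc g) ≡ N
    insertPair-first σ g g≤ = trans (σ[]-suc (insertPair N σ g) g) (at-first σ g g≤)

    insertPair-second : ∀ σ g → g ≤ length σ → σ[ insertPair N σ g ] (suc (suc g)) ≡ N
    insertPair-second σ g g≤ = trans (σ[]-suc (insertPair N σ g) (suc g)) (at-second σ g g≤)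

    insertPair-above : ∀ σ g i → g < i → g ≤ length σ → σ[ insertPair N σ g ] (suc (suc i)) ≡ σ[ σ ] i
    insertPair-above σ g (suc k) (s≤s g≤k) g≤ =
      trans (σ[]-suc (insertPair N σ g) (suc (suc k))) (trans (at-above σ g k g≤k g≤) (sym (σ[]-suc σ k)))

  data GapView (g : ℕ) : ℕ → Set where
    below  : ∀ {k} → k ≤ g → GapView g k
    first  : GapView g (suc g)
    second : GapView g (suc (suc g))
    above  : ∀ i → g < i → GapView g (suc (suc i))

  gapView : ∀ g k → GapView g k
  gapView zero    zero                = below z≤n
  gapView zero    (suc zero)          = first
  gapView zero    (suc (suc zero))    = second
  gapView zero    (suc (suc (suc k))) = above (suc k) (s≤s z≤n)
  gapView (suc g) zero                = below z≤n
  gapView (suc g) (suc k) with gapView g k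
  ... | below k≤g = below (s≤s k≤g)
  ... | first     = first
  ... | second    = second
  ... | above i g<i = above (suc i) (s≤s g<i)

  -- The position that position i of σ moves to when a pair is inserted after g.
  shift : ℕ → ℕ → ℕ
  shift g i with i ℕ.≤? g
  ... | yes _ = i
  ... | no  _ = suc (suc i)

  shift-below : ∀ g i → i ≤ g → shift g i ≡ i
  shift-below g i i≤g with i ℕ.≤? g
  ... | yes _   = refl
  ... | no  i≰g = ⊥-elim (i≰g i≤g)

  shift-above : ∀ g i → g < i → shift g i ≡ suc (suc i)
  shift-above g i g<i with i ℕ.≤? g
  ... | yes i≤g = ⊥-elim (ℕₚ.<⇒≱ g<i i≤g)
  ... | no  _   = refl

  insertPair-shift : ∀ N σ g i → g ≤ length σ → σ[ insertPair N σ g ] (shift g i) ≡ σ[ σ ] i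
  insertPair-shift N σ g i g≤ with i ℕ.≤? g
  ... | yes i≤g = insertPair-below N σ g i i≤g g≤
  ... | no  i≰g = insertPair-above N σ g i (ℕₚ.≰⇒> i≰g) g≤

  shift-mono : ∀ g {a b} → a < b → shift g a < shift g b
  shift-mono g {a} {b} a<b with a ℕ.≤? g | b ℕ.≤? g
  ... | yes _   | yes _   = a<b
  ... | yes _   | no  _   = ℕₚ.<-trans a<b (ℕₚ.<-trans (ℕₚ.n<1+n _) (ℕₚ.n<1+n _))
  ... | no  a≰g | yes b≤g = ⊥-elim (a≰g (ℕₚ.≤-trans (ℕₚ.<⇒≤ a<b) b≤g))
  ... | no  _   | no  _   = s≤s (s≤s a<b)

  shift-monoˡ-≤ : ∀ g {a b} → a ≤ b → shift g a ≤ shift g b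
  shift-monoˡ-≤ g a≤b with ℕₚ.m≤n⇒m<n∨m≡n a≤b
  ... | inj₁ a<b  = ℕₚ.<⇒≤ (shift-mono g a<b)
  ... | inj₂ refl = ℕₚ.≤-refl

  shift-cancel-< : ∀ g {a b} → shift g a < shift g b → a < b
  shift-cancel-< g {a} {b} sa<sb with a ℕ.<? b
  ... | yes a<b = a<b
  ... | no  a≮b = ⊥-elim (ℕₚ.<⇒≱ sa<sb (shift-monoˡ-≤ g (ℕₚ.≮⇒≥ a≮b)))

  shift-injective : ∀ g {a b} → shift g a ≡ shift g b → a ≡ b
  shift-injective g {a} {b} sa≡sb with ℕₚ.<-cmp a b
  ... | tri< a<b _ _ = ⊥-elim (ℕₚ.<-irrefl sa≡sb (shift-mono g a<b))
  ... | tri≈ _ a≡b _ = a≡b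
  ... | tri> _ _ b<a = ⊥-elim (ℕₚ.<-irrefl (sym sa≡sb) (shift-mono g b<a))

  shift-inflationary : ∀ g a → a ≤ shift g a
  shift-inflationary g a with a ℕ.≤? g
  ... | yes _ = ℕₚ.≤-refl
  ... | no  _ = ℕₚ.≤-trans (ℕₚ.n≤1+n a) (ℕₚ.n≤1+n (suc a))

  shift-≤-2+ : ∀ g a → shift g a ≤ suc (suc a)
  shift-≤-2+ g a with a ℕ.≤? g
  ... | yes _ = ℕₚ.≤-trans (ℕₚ.n≤1+n a) (ℕₚ.n≤1+n (suc a))
  ... | no  _ = ℕₚ.≤-refl

  shift-surjective : ∀ g i → ¬ i ≡ suc g → ¬ i ≡ suc (suc g) → ∃ λ k → shift g k ≡ i
  shift-surjective g i i≢first i≢second with gapView g i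
  ... | below i≤g   = i , shift-below g i i≤g
  ... | first       = ⊥-elim (i≢first refl)
  ... | second      = ⊥-elim (i≢second refl)
  ... | above k g<k = k , shift-above g k g<k

  shift-≢-first : ∀ g k → ¬ shift g k ≡ suc g
  shift-≢-first g k e with ℕₚ.≤-<-connex k g
  ... | inj₁ k≤g = ℕₚ.<⇒≱ (ℕₚ.n<1+n g) (subst (_≤ g) (trans (sym (shift-below g k k≤g)) e) k≤g)
  ... | inj₂ g<k = ℕₚ.<⇒≱ g<k (ℕₚ.≤-trans (ℕₚ.n≤1+n k) (ℕₚ.≤-reflexive (ℕₚ.suc-injective (trans (sym (shift-above g k g<k)) e))))

  shift-≢-second : ∀ g k → ¬ shift g k ≡ suc (suc g)
  shift-≢-second g k e with ℕₚ.≤-<-connex k g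
  ... | inj₁ k≤g = ℕₚ.<⇒≱ (ℕₚ.≤-trans (ℕₚ.n<1+n g) (ℕₚ.n≤1+n (suc g))) (subst (_≤ g) (trans (sym (shift-below g k k≤g)) e) k≤g)
  ... | inj₂ g<k = ℕₚ.<-irrefl (sym (ℕₚ.suc-injective (ℕₚ.suc-injective (trans (sym (shift-above g k g<k)) e)))) g<k

  record Occurrences (w : List ℕ) (v : ℕ) : Set where
    field
      i j      : ℕ
      1≤i      : 1 ≤ i
      i<j      : i < j
      j≤length : j ≤ length w
      σi≡v     : σ[ w ] i ≡ v
      σj≡v     : σ[ w ] j ≡ v
      only     : ∀ k → σ[ w ] k ≡ v → k ≡ i ⊎ k ≡ j
      between  : ∀ k → i < k → k < j → v < σ[ w ] k

  record IsStirling (n : ℕ) (w : List ℕ) : Set where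
    field
      length≡     : length w ≡ 2 * n
      bounded     : ∀ k → σ[ w ] k ≤ n
      positive    : ∀ k → 1 ≤ k → k ≤ length w → 1 ≤ σ[ w ] k
      occurrences : ∀ v → 1 ≤ v → v ≤ n → Occurrences w v

  byInsertion : ℕ → List (List ℕ)
  byInsertion zero    = [] ∷ []
  byInsertion (suc n) = concatMap (λ τ → map (insertPair (suc n) τ) (seq 0 (suc (2 * n)))) (byInsertion n)

  2+2*n≡2*[1+n] : ∀ n → suc (suc (2 * n)) ≡ 2 * suc n
  2+2*n≡2*[1+n] n = cong suc (sym (ℕₚ.+-suc n (n + 0)))

  isStirling-[] : IsStirling 0 []
  isStirling-[] = record
    { length≡     = refl
    ; bounded     = λ { zero → z≤n ; (suc zero) → z≤n ; (suc (suc k)) → z≤n }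
    ; positive    = λ { zero () _ ; (suc k) _ () }
    ; occurrences = λ { zero () _ ; (suc v) _ () }
    }

  module InsertPair (n : ℕ) (σ : List ℕ) (S : IsStirling n σ) (g : ℕ) (g≤2n : g ≤ 2 * n) where
    open IsStirling S

    N : ℕ
    N = suc n

    σ′ : List ℕ
    σ′ = insertPair N σ g

    g≤length : g ≤ length σ
    g≤length = subst (g ≤_) (sym length≡) g≤2n

    length-σ′ : length σ′ ≡ suc (suc (length σ))
    length-σ′ = length-insertPair N σ g g≤length

    bounded′ : ∀ k → σ[ σ′ ] k ≤ N
    bounded′ k with gapView g k
    ... | below k≤g   = subst (_≤ N) (sym (insertPair-below N σ g k k≤g g≤length)) (ℕₚ.m≤n⇒m≤1+n (bounded k))
    ... | first       = ℕₚ.≤-reflexive (insertPair-first N σ g g≤length)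
    ... | second      = ℕₚ.≤-reflexive (insertPair-second N σ g g≤length)
    ... | above i g<i = subst (_≤ N) (sym (insertPair-above N σ g i g<i g≤length)) (ℕₚ.m≤n⇒m≤1+n (bounded i))

    positive′ : ∀ k → 1 ≤ k → k ≤ length σ′ → 1 ≤ σ[ σ′ ] k
    positive′ k 1≤k k≤ with gapView g k
    ... | below k≤g   = subst (1 ≤_) (sym (insertPair-below N σ g k k≤g g≤length)) (positive k 1≤k (ℕₚ.≤-trans k≤g g≤length))
    ... | first       = subst (1 ≤_) (sym (insertPair-first N σ g g≤length)) (s≤s z≤n)
    ... | second      = subst (1 ≤_) (sym (insertPair-second N σ g g≤length)) (s≤s z≤n)
    ... | above i g<i = subst (1 ≤_) (sym (insertPair-above N σ g i g<i g≤length))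
                          (positive i (ℕₚ.≤-trans (s≤s z≤n) g<i) (ℕₚ.≤-pred (ℕₚ.≤-pred (subst (suc (suc i) ≤_) length-σ′ k≤))))

    occurrences-old : ∀ v → 1 ≤ v → v ≤ n → Occurrences σ′ v
    occurrences-old v 1≤v v≤n = record
      { i        = shift g i
      ; j        = shift g j
      ; 1≤i      = ℕₚ.≤-trans 1≤i (shift-inflationary g i)
      ; i<j      = shift-mono g i<j
      ; j≤length = ℕₚ.≤-trans (shift-≤-2+ g j) (subst (suc (suc j) ≤_) (sym length-σ′) (s≤s (s≤s j≤length)))
      ; σi≡v     = trans (insertPair-shift N σ g i g≤length) σi≡v
      ; σj≡v     = trans (insertPair-shift N σ g j g≤length) σj≡v
      ; only     = only′
      ; between  = between′
      }
      where
      open Occurrences (occurrences v 1≤v v≤n)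
      N≢v : ¬ N ≡ v
      N≢v e = ℕₚ.<⇒≱ (s≤s v≤n) (ℕₚ.≤-reflexive e)
      only′ : ∀ k → σ[ σ′ ] k ≡ v → k ≡ shift g i ⊎ k ≡ shift g j
      only′ k e with gapView g k
      ... | below k≤g with only k (trans (sym (insertPair-below N σ g k k≤g g≤length)) e)
      ...   | inj₁ refl = inj₁ (sym (shift-below g k k≤g))
      ...   | inj₂ refl = inj₂ (sym (shift-below g k k≤g))
      only′ k e | first  = ⊥-elim (N≢v (trans (sym (insertPair-first N σ g g≤length)) e))
      only′ k e | second = ⊥-elim (N≢v (trans (sym (insertPair-second N σ g g≤length)) e))
      only′ k e | above m g<m with only m (trans (sym (insertPair-above N σ g m g<m g≤length)) e)
      ...   | inj₁ refl = inj₁ (sym (shift-above g m g<m))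
      ...   | inj₂ refl = inj₂ (sym (shift-above g m g<m))
      between′ : ∀ k → shift g i < k → k < shift g j → v < σ[ σ′ ] k
      between′ k si<k k<sj with gapView g k
      ... | below k≤g = subst (v <_) (sym (insertPair-below N σ g k k≤g g≤length)) (between k i<k k<j)
        where
        i<k : i < k
        i<k = ℕₚ.≤-trans (s≤s (shift-inflationary g i)) si<k
        k<j : k < j
        k<j with ℕₚ.≤-<-connex j g
        ... | inj₁ j≤g = subst (k <_) (shift-below g j j≤g) k<sj
        ... | inj₂ g<j = ℕₚ.≤-trans (s≤s k≤g) g<j
      ... | first  = subst (v <_) (sym (insertPair-first N σ g g≤length)) (s≤s v≤n)
      ... | second = subst (v <_) (sym (insertPair-second N σ g g≤length)) (s≤s v≤n)
      ... | above m g<m = subst (v <_) (sym (insertPair-above N σ g m g<m g≤length)) (between m i<m m<j)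
        where
        i<m : i < m
        i<m with ℕₚ.≤-<-connex i g
        ... | inj₁ i≤g = ℕₚ.≤-trans (s≤s i≤g) g<m
        ... | inj₂ g<i = ℕₚ.≤-pred (ℕₚ.≤-pred (subst (_< suc (suc m)) (shift-above g i g<i) si<k))
        m<j : m < j
        m<j with ℕₚ.≤-<-connex j g
        ... | inj₁ j≤g = ⊥-elim (ℕₚ.<⇒≱ (ℕₚ.<-trans g<m (ℕₚ.<-trans (ℕₚ.n<1+n m)
                           (ℕₚ.<-trans (ℕₚ.n<1+n (suc m)) (subst (suc (suc m) <_) (shift-below g j j≤g) k<sj)))) j≤g)
        ... | inj₂ g<j = ℕₚ.≤-pred (ℕₚ.≤-pred (subst (suc (suc m) <_) (shift-above g j g<j) k<sj))

    occurrences-new : Occurrences σ′ N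
    occurrences-new = record
      { i        = suc g
      ; j        = suc (suc g)
      ; 1≤i      = s≤s z≤n
      ; i<j      = ℕₚ.≤-refl
      ; j≤length = subst (suc (suc g) ≤_) (sym length-σ′) (s≤s (s≤s g≤length))
      ; σi≡v     = insertPair-first N σ g g≤length
      ; σj≡v     = insertPair-second N σ g g≤length
      ; only     = only′
      ; between  = λ k g+1<k k<g+2 → ⊥-elim (ℕₚ.<⇒≱ k<g+2 g+1<k)
      }
      where
      only′ : ∀ k → σ[ σ′ ] k ≡ N → k ≡ suc g ⊎ k ≡ suc (suc g)
      only′ k e with gapView g k
      ... | below k≤g   = ⊥-elim (ℕₚ.<⇒≱ (s≤s (bounded k)) (ℕₚ.≤-reflexive (trans (sym e) (insertPair-below N σ g k k≤g g≤length))))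
      ... | first       = inj₁ refl
      ... | second      = inj₂ refl
      ... | above m g<m = ⊥-elim (ℕₚ.<⇒≱ (s≤s (bounded m)) (ℕₚ.≤-reflexive (trans (sym e) (insertPair-above N σ g m g<m g≤length))))

    isStirling : IsStirling N σ′
    isStirling = record
      { length≡     = trans length-σ′ (trans (cong (λ l → suc (suc l)) length≡) (2+2*n≡2*[1+n] n))
      ; bounded     = bounded′
      ; positive    = positive′
      ; occurrences = occurrences′
      }
      where
      occurrences′ : ∀ v → 1 ≤ v → v ≤ N → Occurrences σ′ v
      occurrences′ v 1≤v v≤N with v ℕ.≟ N
      ... | yes refl = occurrences-new
      ... | no  v≢N  = occurrences-old v 1≤v (ℕₚ.≤-pred (ℕₚ.≤∧≢⇒< v≤N v≢N))

  byInsertion⇒isStirling : ∀ n σ → σ ∈ byInsertion n → IsStirling n σ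
  byInsertion⇒isStirling zero .[] (here refl) = isStirling-[]
  byInsertion⇒isStirling (suc n) σ σ∈ with ∈-concatMap⁻′ (λ τ → map (insertPair (suc n) τ) (seq 0 (suc (2 * n)))) (byInsertion n) σ∈
  ... | τ , τ∈ , σ∈τs with ∈-map⁻ (insertPair (suc n) τ) σ∈τs
  ... | g , g∈ , refl =
    InsertPair.isStirling n τ (byInsertion⇒isStirling n τ τ∈) g (ℕₚ.≤-pred (proj₂ (∈-seq⁻ 0 (suc (2 * n)) g∈)))

module ValueTypes where

  open Preliminaries
  open StirlingWords
  open import Defs
  open import Data.Nat as ℕ using (ℕ; suc; _∸_; _≡ᵇ_; _<ᵇ_; _<_; _≤_; z≤n; s≤s)
  import Data.Nat.Properties as ℕₚ
  open import Data.Bool using (Bool; true; false; not; _∧_; _∨_)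
  import Data.Bool.Properties as Boolₚ
  open import Data.Bool.ListAction using (any)
  open import Data.List using (List; []; _∷_; length)
  open import Data.List.Membership.Propositional using (_∈_)
  open import Data.Product using (Σ; _×_; _,_; proj₁)
  open import Data.Sum using (inj₁; inj₂)
  open import Data.Empty using (⊥-elim)
  open import Function.Bundles using (mk⇔)
  open import Relation.Nullary using (¬_; yes; no)
  open import Relation.Binary.PropositionalEquality

  positions≡seq : ∀ w → positions w ≡ seq 1 (length w)
  positions≡seq w = range≡seq 1 (length w)

  ascAt platAt desAt lapAt rpdAt apdAt : List ℕ → ℕ → Bool
  ascAt  w i = σ[ w ] (i ∸ 1) <ᵇ σ[ w ] i
  platAt w i = σ[ w ] i ≡ᵇ σ[ w ] (suc i)
  desAt  w i = σ[ w ] (suc i) <ᵇ σ[ w ] i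
  lapAt  w i = (σ[ w ] (i ∸ 1) <ᵇ σ[ w ] i) ∧ (σ[ w ] i ≡ᵇ σ[ w ] (suc i))
  rpdAt  w i = (σ[ w ] (i ∸ 1) ≡ᵇ σ[ w ] i) ∧ (σ[ w ] (suc i) <ᵇ σ[ w ] i)
  apdAt  w i = (σ[ w ] (i ∸ 1) <ᵇ σ[ w ] i) ∧ (σ[ w ] i ≡ᵇ σ[ w ] (suc i)) ∧ (σ[ w ] (suc (suc i)) <ᵇ σ[ w ] (suc i))

  eudAt vvAt : List ℕ → ℕ → ℕ → Bool
  eudAt w i j = (σ[ w ] (i ∸ 1) <ᵇ σ[ w ] i) ∧ (σ[ w ] (suc j) <ᵇ σ[ w ] j)
  vvAt  w i j = (σ[ w ] i <ᵇ σ[ w ] (i ∸ 1)) ∧ (σ[ w ] i <ᵇ σ[ w ] (suc i))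
              ∧ (σ[ w ] j <ᵇ σ[ w ] (j ∸ 1)) ∧ (σ[ w ] j <ᵇ σ[ w ] (suc j))

  hasAt : (List ℕ → ℕ → Bool) → List ℕ → ℕ → Bool
  hasAt P w v = any (λ i → (σ[ w ] i ≡ᵇ v) ∧ P w i) (positions w)

  -- The per-value test of countValuesPair is local to it; it is extracted, unfolded, as the
  -- first component of a pair whose second component is refl.
  private
    pairTestOf : ∀ n P w → Σ (ℕ → Bool) (λ t → countValuesPair n P w ≡ bcount t (range 1 n))
    pairTestOf n P w = _ , refl

  pairTest : ℕ → (List ℕ → ℕ → ℕ → Bool) → List ℕ → ℕ → Bool
  pairTest n P w = proj₁ (pairTestOf n P w)

  pairTest-occPos : ∀ n P w v i j → occPos w v ≡ i ∷ j ∷ [] → pairTest n P w v ≡ P w i j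
  pairTest-occPos n P w v i j e rewrite e = refl

  -- The type (L , M , R) of a value records whether its first occurrence is an ascent,
  -- whether its two occurrences form a plateau, and whether its second occurrence is a descent.
  Type : Set
  Type = Bool × Bool × Bool

  type : List ℕ → ℕ → Type
  type w v = hasAt ascAt w v , hasAt platAt w v , hasAt desAt w v

  module NeighbourIdentities (v a b c d e f : ℕ) (a≢v : ¬ a ≡ v) (v≤b : v ≤ b) (v≤c : v ≤ c) (d≢v : ¬ d ≡ v)
                             (b≡v⇒c≡v : b ≡ v → c ≡ v) (c≡v⇒b≡v : c ≡ v → b ≡ v) (b≡v⇒e≡d : b ≡ v → e ≡ d) where

    private
      c≡ᵇv≡v≡ᵇb : (c ≡ᵇ v) ≡ (v ≡ᵇ b)
      c≡ᵇv≡v≡ᵇb = Boolₚ.⇔→≡ {z = true} (mk⇔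
        (λ e → trans (≡ᵇ-sym v b) (≡⇒≡ᵇ-true (c≡v⇒b≡v (≡ᵇ-true⇒≡ c v e))))
        (λ e → ≡⇒≡ᵇ-true (b≡v⇒c≡v (sym (≡ᵇ-true⇒≡ v b e)))))

    asc-identity : (a <ᵇ v) ∨ (c <ᵇ v) ≡ (a <ᵇ v)
    asc-identity rewrite ≥⇒<ᵇ-false v≤c = Boolₚ.∨-identityʳ _

    plat-identity : (v ≡ᵇ b) ∨ (v ≡ᵇ d) ≡ (v ≡ᵇ b)
    plat-identity rewrite ≢⇒≡ᵇ-false v d (λ e → d≢v (sym e)) = Boolₚ.∨-identityʳ _

    des-identity : (b <ᵇ v) ∨ (d <ᵇ v) ≡ (d <ᵇ v)
    des-identity rewrite ≥⇒<ᵇ-false v≤b = refl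

    lap-identity : ((a <ᵇ v) ∧ (v ≡ᵇ b)) ∨ ((c <ᵇ v) ∧ (v ≡ᵇ d)) ≡ (a <ᵇ v) ∧ (v ≡ᵇ b)
    lap-identity rewrite ≥⇒<ᵇ-false v≤c = Boolₚ.∨-identityʳ _

    rpd-identity : ((a ≡ᵇ v) ∧ (b <ᵇ v)) ∨ ((c ≡ᵇ v) ∧ (d <ᵇ v)) ≡ (v ≡ᵇ b) ∧ (d <ᵇ v)
    rpd-identity rewrite ≢⇒≡ᵇ-false a v a≢v | c≡ᵇv≡v≡ᵇb = refl

    apd-identity : ((a <ᵇ v) ∧ (v ≡ᵇ b) ∧ (e <ᵇ b)) ∨ ((c <ᵇ v) ∧ (v ≡ᵇ d) ∧ (f <ᵇ d))
                 ≡ (a <ᵇ v) ∧ ((v ≡ᵇ b) ∧ (d <ᵇ v))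
    apd-identity rewrite ≥⇒<ᵇ-false v≤c | Boolₚ.∨-identityʳ ((a <ᵇ v) ∧ (v ≡ᵇ b) ∧ (e <ᵇ b))
      = cong ((a <ᵇ v) ∧_) plateau-descent
      where
      plateau-descent : (v ≡ᵇ b) ∧ (e <ᵇ b) ≡ (v ≡ᵇ b) ∧ (d <ᵇ v)
      plateau-descent with v ≡ᵇ b in eq
      ... | false = refl
      ... | true with ≡ᵇ-true⇒≡ v b eq
      ...   | refl rewrite b≡v⇒e≡d refl = refl

    vv-identity : (v <ᵇ a) ∧ (v <ᵇ b) ∧ (v <ᵇ c) ∧ (v <ᵇ d) ≡ not (a <ᵇ v) ∧ not (v ≡ᵇ b) ∧ not (d <ᵇ v)
    vv-identity rewrite <ᵇ-flip a≢v | ≤⇒<ᵇ≡not≡ᵇ v≤b | ≤⇒<ᵇ≡not≡ᵇ v≤c | ≡ᵇ-sym v c | c≡ᵇv≡v≡ᵇb | <ᵇ-flip d≢v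
      with v ≡ᵇ b
    ... | true  = trans (Boolₚ.∧-zeroʳ _) (sym (Boolₚ.∧-zeroʳ _))
    ... | false = refl

  module ValueType (w : List ℕ) (v : ℕ) (O : Occurrences w v) where
    open Occurrences O public

    private
      s : ℕ → ℕ
      s k = σ[ w ] k

      i∈positions : i ∈ positions w
      i∈positions = subst (i ∈_) (sym (positions≡seq w))
        (∈-seq⁺ 1 (length w) i 1≤i (s≤s (ℕₚ.≤-trans (ℕₚ.<⇒≤ i<j) j≤length)))

      j∈positions : j ∈ positions w
      j∈positions = subst (j ∈_) (sym (positions≡seq w))
        (∈-seq⁺ 1 (length w) j (ℕₚ.≤-trans 1≤i (ℕₚ.<⇒≤ i<j)) (s≤s j≤length))

    hasAt-occurrences : ∀ (Q : ℕ → Bool) → any (λ k → (s k ≡ᵇ v) ∧ Q k) (positions w) ≡ Q i ∨ Q j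
    hasAt-occurrences Q = Boolₚ.⇔→≡ {z = true} (mk⇔ to from)
      where
      to : any (λ k → (s k ≡ᵇ v) ∧ Q k) (positions w) ≡ true → Q i ∨ Q j ≡ true
      to e with any-true⁻ _ (positions w) e
      ... | k , _ , sk∧Qk with ∧-true⁻ (s k ≡ᵇ v) (Q k) sk∧Qk
      ... | sk≡v , Qk with only k (≡ᵇ-true⇒≡ _ _ sk≡v)
      ... | inj₁ refl = ∨-true⁺ (Q k) (Q j) (inj₁ Qk)
      ... | inj₂ refl = ∨-true⁺ (Q i) (Q k) (inj₂ Qk)
      from : Q i ∨ Q j ≡ true → any (λ k → (s k ≡ᵇ v) ∧ Q k) (positions w) ≡ true
      from e with ∨-true⁻ (Q i) (Q j) e
      ... | inj₁ Qi = any-true⁺ (λ k → (s k ≡ᵇ v) ∧ Q k) i∈positions (∧-true⁺ (≡⇒≡ᵇ-true σi≡v) Qi)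
      ... | inj₂ Qj = any-true⁺ (λ k → (s k ≡ᵇ v) ∧ Q k) j∈positions (∧-true⁺ (≡⇒≡ᵇ-true σj≡v) Qj)

    occPos≡ : occPos w v ≡ i ∷ j ∷ []
    occPos≡ = trans (cong (bfilter (λ k → s k ≡ᵇ v)) (positions≡seq w))
      (bfilter-seq-pair (λ k → s k ≡ᵇ v) i j 1 (length w) i<j (λ k _ _ e → only k (≡ᵇ-true⇒≡ _ _ e))
        (≡⇒≡ᵇ-true σi≡v) (≡⇒≡ᵇ-true σj≡v) 1≤i (s≤s j≤length))

    -- The neighbours of the two occurrences: a v b … c v d, and e follows b.
    a b c d e : ℕ
    a = s (i ∸ 1)
    b = s (suc i)
    c = s (j ∸ 1)
    d = s (suc j)
    e = s (suc (suc i))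

    private
      i-1<i : i ∸ 1 < i
      i-1<i = ℕₚ.∸-monoʳ-< {o = 0} (s≤s z≤n) 1≤i

      1+[j-1]≡j : suc (j ∸ 1) ≡ j
      1+[j-1]≡j = ℕₚ.m+[n∸m]≡n {1} {j} (ℕₚ.≤-trans (s≤s z≤n) i<j)

      a≢v : ¬ a ≡ v
      a≢v a≡v with only (i ∸ 1) a≡v
      ... | inj₁ e′ = ℕₚ.<-irrefl e′ i-1<i
      ... | inj₂ e′ = ℕₚ.<-irrefl e′ (ℕₚ.<-trans i-1<i i<j)

      d≢v : ¬ d ≡ v
      d≢v d≡v with only (suc j) d≡v
      ... | inj₁ e′ = ℕₚ.<⇒≱ i<j (ℕₚ.≤-trans (ℕₚ.n≤1+n j) (ℕₚ.≤-reflexive e′))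
      ... | inj₂ e′ = ℕₚ.<-irrefl (sym e′) ℕₚ.≤-refl

      v≤b : v ≤ b
      v≤b with suc i ℕ.≟ j
      ... | yes e′ = ℕₚ.≤-reflexive (sym (trans (cong s e′) σj≡v))
      ... | no  ne = ℕₚ.<⇒≤ (between (suc i) ℕₚ.≤-refl (ℕₚ.≤∧≢⇒< i<j ne))

      v≤c : v ≤ c
      v≤c with i ℕ.≟ j ∸ 1
      ... | yes e′ = ℕₚ.≤-reflexive (sym (trans (cong s (sym e′)) σi≡v))
      ... | no  ne = ℕₚ.<⇒≤ (between (j ∸ 1) (ℕₚ.≤∧≢⇒< (ℕₚ.≤-pred (subst (suc i ≤_) (sym 1+[j-1]≡j) i<j)) ne)
                                          (subst (j ∸ 1 <_) 1+[j-1]≡j ℕₚ.≤-refl))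

    b≡v⇒plateau : b ≡ v → j ≡ suc i
    b≡v⇒plateau b≡v with only (suc i) b≡v
    ... | inj₁ e′ = ⊥-elim (ℕₚ.<-irrefl (sym e′) ℕₚ.≤-refl)
    ... | inj₂ e′ = sym e′

    private
      c≡v⇒plateau : c ≡ v → j ≡ suc i
      c≡v⇒plateau c≡v with only (j ∸ 1) c≡v
      ... | inj₁ e′ = trans (sym 1+[j-1]≡j) (cong suc e′)
      ... | inj₂ e′ = ⊥-elim (ℕₚ.<-irrefl e′ (subst (j ∸ 1 <_) 1+[j-1]≡j ℕₚ.≤-refl))

    open NeighbourIdentities v a b c d e (s (suc (suc j))) a≢v v≤b v≤c d≢v
           (λ b≡v → trans (cong (λ k → s (k ∸ 1)) (b≡v⇒plateau b≡v)) σi≡v)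
           (λ c≡v → trans (cong s (sym (c≡v⇒plateau c≡v))) σj≡v)
           (λ b≡v → sym (cong (λ k → s (suc k)) (b≡v⇒plateau b≡v)))

    L M R : Bool
    L = a <ᵇ v
    M = v ≡ᵇ b
    R = d <ᵇ v

    c<ᵇv≡false : (c <ᵇ v) ≡ false
    c<ᵇv≡false = ≥⇒<ᵇ-false v≤c

    v<ᵇb≡not-M : (v <ᵇ b) ≡ not M
    v<ᵇb≡not-M = ≤⇒<ᵇ≡not≡ᵇ v≤b

    v<ᵇd≡not-R : (v <ᵇ d) ≡ not R
    v<ᵇd≡not-R = <ᵇ-flip d≢v

    private
      hasAt-split : ∀ P → hasAt P w v ≡ P w i ∨ P w j
      hasAt-split P = hasAt-occurrences (P w)

    asc≡L : hasAt ascAt w v ≡ L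
    asc≡L rewrite hasAt-split ascAt | σi≡v | σj≡v = asc-identity

    plat≡M : hasAt platAt w v ≡ M
    plat≡M rewrite hasAt-split platAt | σi≡v | σj≡v = plat-identity

    des≡R : hasAt desAt w v ≡ R
    des≡R rewrite hasAt-split desAt | σi≡v | σj≡v = des-identity

    lap≡L∧M : hasAt lapAt w v ≡ L ∧ M
    lap≡L∧M rewrite hasAt-split lapAt | σi≡v | σj≡v = lap-identity

    rpd≡M∧R : hasAt rpdAt w v ≡ M ∧ R
    rpd≡M∧R rewrite hasAt-split rpdAt | σi≡v | σj≡v = rpd-identity

    apd≡L∧M∧R : hasAt apdAt w v ≡ L ∧ (M ∧ R)
    apd≡L∧M∧R rewrite hasAt-split apdAt | σi≡v | σj≡v = apd-identity

    eud≡L∧R : ∀ n → pairTest n eudAt w v ≡ L ∧ R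
    eud≡L∧R n rewrite pairTest-occPos n eudAt w v i j occPos≡ | σi≡v | σj≡v = refl

    vv≡none : ∀ n → pairTest n vvAt w v ≡ not L ∧ not M ∧ not R
    vv≡none n rewrite pairTest-occPos n vvAt w v i j occPos≡ | σi≡v | σj≡v = vv-identity

    type≡ : type w v ≡ (L , M , R)
    type≡ = cong₂ _,_ asc≡L (cong₂ _,_ plat≡M des≡R)

module TypesUnderInsertion where

  open Preliminaries
  open StirlingWords
  open ValueTypes
  open import Defs using (σ[_]_)
  open import Data.Nat as ℕ using (ℕ; suc; _*_; _∸_; _≡ᵇ_; _<ᵇ_; _<_; _≤_; s≤s)
  import Data.Nat.Properties as ℕₚ
  open import Data.Bool using (Bool; true; false; if_then_else_)
  open import Data.List using (List; length)
  open import Data.Product using (_,_)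
  open import Data.Sum using (inj₁; inj₂)
  open import Relation.Nullary using (¬_; yes; no)
  open import Relation.Binary.PropositionalEquality

  clearIf : Bool → Bool → Bool
  clearIf hit x = if hit then false else x

  clearIf-false : ∀ {hit} x → hit ≡ false → clearIf hit x ≡ x
  clearIf-false x refl = refl

  clearIf-test : ∀ (test : ℕ → Bool) {N} → test N ≡ false →
                 ∀ hit {x} y → x ≡ (if hit then N else y) → test x ≡ clearIf hit (test y)
  clearIf-test test testN≡false false y refl = refl
  clearIf-test test testN≡false true  y refl = testN≡false

  clearIf-redundant : ∀ hit x → (hit ≡ true → x ≡ false) → clearIf hit x ≡ x
  clearIf-redundant false x _ = refl
  clearIf-redundant true  x h = sym (h refl)

  module NeighboursOfShift (N : ℕ) (σ : List ℕ) (g : ℕ) (g≤length : g ≤ length σ) where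

    private
      σ′ = insertPair N σ g

    left-of-shift : ∀ p → 1 ≤ p → σ[ σ′ ] (shift g p ∸ 1) ≡ (if p ≡ᵇ suc g then N else σ[ σ ] (p ∸ 1))
    left-of-shift p 1≤p with ℕₚ.≤-<-connex p g
    ... | inj₁ p≤g rewrite shift-below g p p≤g | ≢⇒≡ᵇ-false p (suc g) (λ e → ℕₚ.<⇒≱ (ℕₚ.n<1+n g) (subst (_≤ g) e p≤g)) =
          insertPair-below N σ g (p ∸ 1) (ℕₚ.≤-trans (ℕₚ.m∸n≤m p 1) p≤g) g≤length
    ... | inj₂ g<p rewrite shift-above g p g<p with p ℕ.≟ suc g
    ...   | yes refl rewrite ≡ᵇ-refl g = insertPair-second N σ g g≤length
    ...   | no  p≢g+1 rewrite ≢⇒≡ᵇ-false p (suc g) p≢g+1 = shifted p 1≤p g<p p≢g+1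
      where
      shifted : ∀ p → 1 ≤ p → g < p → ¬ p ≡ suc g → σ[ σ′ ] (suc p) ≡ σ[ σ ] (p ∸ 1)
      shifted (suc p′) _ g<p p≢g+1 =
        insertPair-above N σ g p′ (ℕₚ.≤∧≢⇒< (ℕₚ.≤-pred g<p) (λ e → p≢g+1 (cong suc (sym e)))) g≤length

    right-of-shift : ∀ p → σ[ σ′ ] (suc (shift g p)) ≡ (if p ≡ᵇ g then N else σ[ σ ] (suc p))
    right-of-shift p with ℕₚ.≤-<-connex p g
    ... | inj₂ g<p rewrite shift-above g p g<p | ≢⇒≡ᵇ-false p g (λ e → ℕₚ.<-irrefl (sym e) g<p) =
          insertPair-above N σ g (suc p) (ℕₚ.≤-trans g<p (ℕₚ.n≤1+n p)) g≤length
    ... | inj₁ p≤g rewrite shift-below g p p≤g with p ℕ.≟ g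
    ...   | yes refl rewrite ≡ᵇ-refl p = insertPair-first N σ p g≤length
    ...   | no  p≢g  rewrite ≢⇒≡ᵇ-false p g p≢g = insertPair-below N σ g (suc p) (ℕₚ.≤∧≢⇒< p≤g p≢g) g≤length

  module Insertion (n : ℕ) (σ : List ℕ) (S : IsStirling n σ) where
    open IsStirling S

    N : ℕ
    N = suc n

    module AtGap (g : ℕ) (g≤2n : g ≤ 2 * n) where
      open InsertPair n σ S g g≤2n using (σ′; g≤length; occurrences-old; occurrences-new)
      open NeighboursOfShift N σ g g≤length

      type-old : ∀ w (1≤w : 1 ≤ w) (w≤n : w ≤ n) → let open ValueType σ w (occurrences w 1≤w w≤n) in
                 type σ′ w ≡ (clearIf (i ≡ᵇ suc g) L , clearIf (i ≡ᵇ g) M , clearIf (j ≡ᵇ g) R)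
      type-old w 1≤w w≤n = trans W′.type≡ (cong₂ _,_ L′ (cong₂ _,_ M′ R′))
        where
        open ValueType σ w (occurrences w 1≤w w≤n)
        module W′ = ValueType σ′ w (occurrences-old w 1≤w w≤n)
        N<ᵇw : (N <ᵇ w) ≡ false
        N<ᵇw = ≥⇒<ᵇ-false (ℕₚ.m≤n⇒m≤1+n w≤n)
        w≡ᵇN : (w ≡ᵇ N) ≡ false
        w≡ᵇN = ≢⇒≡ᵇ-false w N (λ e → ℕₚ.<-irrefl e (s≤s w≤n))
        L′ : W′.L ≡ clearIf (i ≡ᵇ suc g) L
        L′ = clearIf-test (_<ᵇ w) N<ᵇw (i ≡ᵇ suc g) _ (left-of-shift i 1≤i)
        M′ : W′.M ≡ clearIf (i ≡ᵇ g) M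
        M′ = clearIf-test (w ≡ᵇ_) w≡ᵇN (i ≡ᵇ g) _ (right-of-shift i)
        R′ : W′.R ≡ clearIf (j ≡ᵇ g) R
        R′ = clearIf-test (_<ᵇ w) N<ᵇw (j ≡ᵇ g) _ (right-of-shift j)

      type-new : type σ′ N ≡ (true , true , true)
      type-new = trans N′.type≡ (cong₂ _,_ L′ (cong₂ _,_ (≡⇒≡ᵇ-true (sym (insertPair-second N σ g g≤length))) R′))
        where
        module N′ = ValueType σ′ N occurrences-new
        L′ : (σ[ σ′ ] (suc g ∸ 1) <ᵇ N) ≡ true
        L′ = <⇒<ᵇ-true (s≤s (subst (_≤ n) (sym (insertPair-below N σ g g ℕₚ.≤-refl g≤length)) (bounded g)))
        R′ : (σ[ σ′ ] (suc (suc (suc g))) <ᵇ N) ≡ true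
        R′ = <⇒<ᵇ-true (s≤s (subst (_≤ n) (sym (insertPair-above N σ g (suc g) ℕₚ.≤-refl g≤length)) (bounded (suc g))))

    module ValueGaps (v : ℕ) (1≤v : 1 ≤ v) (v≤n : v ≤ n) where
      open ValueType σ v (occurrences v 1≤v v≤n) public

      j≤2n : j ≤ 2 * n
      j≤2n = subst (j ≤_) length≡ j≤length

      i≤2n : i ≤ 2 * n
      i≤2n = ℕₚ.≤-trans (ℕₚ.<⇒≤ i<j) j≤2n

      i-1≤2n : i ∸ 1 ≤ 2 * n
      i-1≤2n = ℕₚ.≤-trans (ℕₚ.m∸n≤m i 1) i≤2n

      private
        1+[i-1]≡i : suc (i ∸ 1) ≡ i
        1+[i-1]≡i = ℕₚ.m+[n∸m]≡n {1} {i} 1≤i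

        i-1<i : i ∸ 1 < i
        i-1<i = subst (i ∸ 1 <_) 1+[i-1]≡i ℕₚ.≤-refl

        module Other (w : ℕ) (1≤w : 1 ≤ w) (w≤n : w ≤ n) (w≢v : ¬ w ≡ v) where
          module W = ValueType σ w (occurrences w 1≤w w≤n)

          ≢-position : ∀ k l → σ[ σ ] k ≡ w → σ[ σ ] l ≡ v → ¬ k ≡ l
          ≢-position k l σk≡w σl≡v refl = w≢v (trans (sym σk≡w) σl≡v)

          before : L ≡ true → (clearIf (W.i ≡ᵇ suc (i ∸ 1)) W.L , clearIf (W.i ≡ᵇ (i ∸ 1)) W.M , clearIf (W.j ≡ᵇ (i ∸ 1)) W.R)
                            ≡ (W.L , W.M , W.R)
          before L≡true = cong₂ _,_
            (clearIf-false _ (trans (cong (W.i ≡ᵇ_) 1+[i-1]≡i) (≢⇒≡ᵇ-false _ _ (≢-position W.i i W.σi≡v σi≡v))))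
            (cong₂ _,_ (clearIf-redundant _ _ no-plateau) (clearIf-redundant _ _ no-descent))
            where
            next-is-v : ∀ {k} → (k ≡ᵇ (i ∸ 1)) ≡ true → σ[ σ ] (suc k) ≡ v
            next-is-v {k} e = trans (cong (λ l → σ[ σ ] (suc l)) (≡ᵇ-true⇒≡ k (i ∸ 1) e)) (trans (cong (σ[ σ ]_) 1+[i-1]≡i) σi≡v)
            no-plateau : (W.i ≡ᵇ (i ∸ 1)) ≡ true → W.M ≡ false
            no-plateau e = ≢⇒≡ᵇ-false w _ (λ w≡next → w≢v (trans w≡next (next-is-v e)))
            no-descent : (W.j ≡ᵇ (i ∸ 1)) ≡ true → W.R ≡ false
            no-descent e = ≥⇒<ᵇ-false (ℕₚ.<⇒≤ (subst (w <_) (sym (next-is-v e)) w<v))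
              where
              w<v : w < v
              w<v = subst (_< v) (trans (cong (σ[ σ ]_) (sym (≡ᵇ-true⇒≡ W.j (i ∸ 1) e))) W.σj≡v) (<ᵇ-true⇒< a v L≡true)

          inside : M ≡ true → (clearIf (W.i ≡ᵇ suc i) W.L , clearIf (W.i ≡ᵇ i) W.M , clearIf (W.j ≡ᵇ i) W.R)
                            ≡ (W.L , W.M , W.R)
          inside M≡true = cong₂ _,_ (clearIf-false _ (≢⇒≡ᵇ-false _ _ Wi≢i+1))
            (cong₂ _,_ (clearIf-false _ (≢⇒≡ᵇ-false _ _ (≢-position W.i i W.σi≡v σi≡v)))
                       (clearIf-false _ (≢⇒≡ᵇ-false _ _ (≢-position W.j i W.σj≡v σi≡v))))
            where
            Wi≢i+1 : ¬ W.i ≡ suc i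
            Wi≢i+1 = ≢-position W.i (suc i) W.σi≡v (sym (≡ᵇ-true⇒≡ v b M≡true))

          after : R ≡ true → (clearIf (W.i ≡ᵇ suc j) W.L , clearIf (W.i ≡ᵇ j) W.M , clearIf (W.j ≡ᵇ j) W.R)
                           ≡ (W.L , W.M , W.R)
          after R≡true = cong₂ _,_ (clearIf-redundant _ _ no-ascent)
            (cong₂ _,_ (clearIf-false _ (≢⇒≡ᵇ-false _ _ (≢-position W.i j W.σi≡v σj≡v)))
                       (clearIf-false _ (≢⇒≡ᵇ-false _ _ (≢-position W.j j W.σj≡v σj≡v))))
            where
            no-ascent : (W.i ≡ᵇ suc j) ≡ true → W.L ≡ false
            no-ascent e = ≥⇒<ᵇ-false (ℕₚ.<⇒≤ (subst (w <_) (sym prev-is-v) w<v))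
              where
              Wi≡j+1 = ≡ᵇ-true⇒≡ W.i (suc j) e
              prev-is-v : σ[ σ ] (W.i ∸ 1) ≡ v
              prev-is-v = trans (cong (λ l → σ[ σ ] (l ∸ 1)) Wi≡j+1) σj≡v
              w<v : w < v
              w<v = subst (_< v) (trans (cong (σ[ σ ]_) (sym Wi≡j+1)) W.σi≡v) (<ᵇ-true⇒< d v R≡true)

      InsertionEffect : ℕ → Type → Set
      InsertionEffect g t = ∀ w → 1 ≤ w → w ≤ n → type (insertPair N σ g) w ≡ (if w ≡ᵇ v then t else type σ w)

      insert-before : L ≡ true → InsertionEffect (i ∸ 1) (false , M , R)
      insert-before L≡true w 1≤w w≤n with w ≡ᵇ v in eq
      ... | false = trans (AtGap.type-old (i ∸ 1) i-1≤2n w 1≤w w≤n)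
                      (trans (Other.before w 1≤w w≤n (≡ᵇ-false⇒≢ w v eq) L≡true) (sym (ValueType.type≡ σ w (occurrences w 1≤w w≤n))))
      ... | true with ≡ᵇ-true⇒≡ w v eq
      ...   | refl = trans (AtGap.type-old (i ∸ 1) i-1≤2n v 1≤v v≤n)
                       (cong₂ _,_ (cong (λ h → clearIf h L) (≡⇒≡ᵇ-true (sym 1+[i-1]≡i)))
                         (cong₂ _,_ (clearIf-false _ (≢⇒≡ᵇ-false _ _ (λ e → ℕₚ.<-irrefl (sym e) i-1<i)))
                                    (clearIf-false _ (≢⇒≡ᵇ-false _ _ (λ e → ℕₚ.<-irrefl (sym e) (ℕₚ.<-trans i-1<i i<j))))))

      insert-inside : M ≡ true → InsertionEffect i (L , false , R)
      insert-inside M≡true w 1≤w w≤n with w ≡ᵇ v in eq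
      ... | false = trans (AtGap.type-old i i≤2n w 1≤w w≤n)
                      (trans (Other.inside w 1≤w w≤n (≡ᵇ-false⇒≢ w v eq) M≡true) (sym (ValueType.type≡ σ w (occurrences w 1≤w w≤n))))
      ... | true with ≡ᵇ-true⇒≡ w v eq
      ...   | refl = trans (AtGap.type-old i i≤2n v 1≤v v≤n)
                       (cong₂ _,_ (clearIf-false _ (≢⇒≡ᵇ-false i (suc i) (λ e → ℕₚ.<-irrefl e ℕₚ.≤-refl)))
                         (cong₂ _,_ (cong (λ h → clearIf h M) (≡ᵇ-refl i))
                                    (clearIf-false _ (≢⇒≡ᵇ-false _ _ (λ e → ℕₚ.<-irrefl (sym e) i<j)))))

      insert-after : R ≡ true → InsertionEffect j (L , M , false)
      insert-after R≡true w 1≤w w≤n with w ≡ᵇ v in eq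
      ... | false = trans (AtGap.type-old j j≤2n w 1≤w w≤n)
                      (trans (Other.after w 1≤w w≤n (≡ᵇ-false⇒≢ w v eq) R≡true) (sym (ValueType.type≡ σ w (occurrences w 1≤w w≤n))))
      ... | true with ≡ᵇ-true⇒≡ w v eq
      ...   | refl = trans (AtGap.type-old j j≤2n v 1≤v v≤n)
                       (cong₂ _,_ (clearIf-false _ (≢⇒≡ᵇ-false _ _ (λ e → ℕₚ.<-irrefl e (ℕₚ.<-trans i<j ℕₚ.≤-refl))))
                         (cong₂ _,_ (clearIf-false _ (≢⇒≡ᵇ-false _ _ (λ e → ℕₚ.<-irrefl e i<j)))
                                    (cong (λ h → clearIf h R) (≡ᵇ-refl j))))

module GapSums where

  open Preliminaries
  open CommutativeSemirings
  open StirlingWords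
  open ValueTypes
  open TypesUnderInsertion
  open import Defs using (σ[_]_; range; bfilter)
  open import Data.Nat as ℕ using (ℕ; zero; suc; _∸_; _≡ᵇ_; _<ᵇ_; _≤_)
  import Data.Nat.Properties as ℕₚ
  open import Data.Bool using (Bool; true; false; not; if_then_else_)
  import Data.Bool.Properties as Boolₚ
  open import Data.List using (List; []; _∷_; _++_; length)
  open import Data.List.Membership.Propositional using (_∈_)
  open import Data.Product using (_×_; _,_; proj₁; proj₂)
  open import Relation.Binary.PropositionalEquality

  module GapOwnership (R : ≡-CommutativeSemiring) where
    open SemiringSums R

    when : Bool → Carrier → Carrier
    when b x = if b then x else 0#

    when-not : ∀ b x → when b x + when (not b) x ≡ x
    when-not true  x = +-identityʳ x
    when-not false x = +-identityˡ x

    when-* : ∀ b x y → when b x * y ≡ when b (x * y)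
    when-* true  x y = refl
    when-* false x y = zeroˡ y

    when-cong : ∀ b {x y} → (b ≡ true → x ≡ y) → when b x ≡ when b y
    when-cong true  h = h refl
    when-cong false h = refl

    module _ (s : ℕ → ℕ) (F : ℕ → Carrier) where

      -- Gap g lies between positions g and g + 1; it belongs to position g + 1 if that
      -- position is an ascent, and to position g otherwise.
      ownedGaps : ℕ → Carrier
      ownedGaps i = when (s (i ∸ 1) <ᵇ s i) (F (i ∸ 1)) + when (not (s i <ᵇ s (suc i))) (F i)

      private
        telescope : ∀ L k x → x ℕ.+ k ≡ L → s (suc L) ≡ 0 →
          ∑ (seq x (suc k)) ownedGaps ≡ when (s (x ∸ 1) <ᵇ s x) (F (x ∸ 1)) + ∑ (seq x (suc k)) F
        telescope L zero x x+0≡L sL≡0 rewrite ℕₚ.+-identityʳ x | x+0≡L | sL≡0 =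
          +-assoc _ _ _
        telescope L (suc k) x x+k≡L sL≡0 = begin
          (A + when (not b) (F x)) + ∑ (seq (suc x) (suc k)) ownedGaps
            ≡⟨ cong ((A + when (not b) (F x)) +_) (telescope L k (suc x) (trans (sym (ℕₚ.+-suc x k)) x+k≡L) sL≡0) ⟩
          (A + when (not b) (F x)) + (when b (F x) + ∑ (seq (suc x) (suc k)) F)
            ≡⟨ +-assoc _ _ _ ⟩
          A + (when (not b) (F x) + (when b (F x) + ∑ (seq (suc x) (suc k)) F))
            ≡⟨ cong (A +_) (sym (+-assoc _ _ _)) ⟩
          A + ((when (not b) (F x) + when b (F x)) + ∑ (seq (suc x) (suc k)) F)
            ≡⟨ cong (λ z → A + (z + ∑ (seq (suc x) (suc k)) F)) (trans (+-comm _ _) (when-not b (F x))) ⟩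
          A + (F x + ∑ (seq (suc x) (suc k)) F) ∎
          where
          open ≡-Reasoning
          A = when (s (x ∸ 1) <ᵇ s x) (F (x ∸ 1))
          b = s x <ᵇ s (suc x)

      ∑-gaps≡∑-ownedGaps : ∀ L → 1 ≤ L → s 0 ≡ 0 → 1 ≤ s 1 → s (suc L) ≡ 0 →
                           ∑ (seq 0 (suc L)) F ≡ ∑ (seq 1 L) ownedGaps
      ∑-gaps≡∑-ownedGaps (suc k) _ s0≡0 1≤s1 sL≡0 = sym (trans (telescope (suc k) k 1 refl sL≡0)
        (cong (λ b → when b (F 0) + ∑ (seq 1 (suc k)) F) (trans (cong (_<ᵇ s 1) s0≡0) (<⇒<ᵇ-true 1≤s1))))

  module Derivation (R : ≡-CommutativeSemiring) where
    open SemiringSums R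
    open GapOwnership R

    -- Inserting the new maximum next to an occurrence of a value clears one true bit of its
    -- type, and the new value has type (true , true , true).
    ∂ : (Type → Carrier) → Type → Carrier
    ∂ u (l , m , r) = (when l (u (false , m , r)) + when m (u (l , false , r)) + when r (u (l , m , false)))
                      * u (true , true , true)


  module InsertionSum (n : ℕ) (σ : List ℕ) (S : IsStirling n σ) (𝓡 : ≡-CommutativeSemiring)
                      (u : Type → ≡-CommutativeSemiring.Carrier 𝓡) where
    open SemiringSums 𝓡
    open GapOwnership 𝓡
    open Derivation 𝓡
    open Keyed _≡ᵇ_ ≡ᵇ-true⇒≡ ≡ᵇ-refl
    open IsStirling S
    open Insertion n σ S
    open ≡-Reasoning

    private
      s : ℕ → ℕ
      s k = σ[ σ ] k

    weightAfter : ℕ → Carrier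
    weightAfter g = ∏ (range 1 (suc n)) (λ w → u (type (insertPair N σ g) w))

    weightWithout : ℕ → Carrier
    weightWithout v = ∏-except v (range 1 n) (λ w → u (type σ w))

    private
      u⊤ : Carrier
      u⊤ = u (true , true , true)

      in-range : ∀ {w} → w ∈ range 1 n → 1 ≤ w × w ≤ n
      in-range = ∈-range⁻ 1 n

      weightAfter-split : ∀ g → g ≤ 2 ℕ.* n → weightAfter g ≡ ∏ (range 1 n) (λ w → u (type (insertPair N σ g) w)) * u⊤
      weightAfter-split g g≤2n = begin
        ∏ (range 1 (suc n)) f                   ≡⟨ cong (λ ws → ∏ ws f) (range1-∷ʳ n) ⟩
        ∏ (range 1 n ++ suc n ∷ []) f           ≡⟨ ∏-++ (range 1 n) (suc n ∷ []) f ⟩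
        ∏ (range 1 n) f * (f (suc n) * 1#)      ≡⟨ cong (λ t → ∏ (range 1 n) f * (u t * 1#)) (AtGap.type-new g g≤2n) ⟩
        ∏ (range 1 n) f * (u⊤ * 1#)             ≡⟨ cong (∏ (range 1 n) f *_) (*-identityʳ u⊤) ⟩
        ∏ (range 1 n) f * u⊤                    ∎
        where
        f : ℕ → Carrier
        f w = u (type (insertPair N σ g) w)

    module OwnedByValue (v : ℕ) (1≤v : 1 ≤ v) (v≤n : v ≤ n) where
      open ValueGaps v 1≤v v≤n

      weightAfter-effect : ∀ g → g ≤ 2 ℕ.* n → ∀ t → InsertionEffect g t → weightAfter g ≡ u t * weightWithout v * u⊤
      weightAfter-effect g g≤2n t effect = trans (weightAfter-split g g≤2n) (cong (_* u⊤)
        (trans (∏-cong (range 1 n) (λ w w∈ → trans (cong u (effect w (proj₁ (in-range w∈)) (proj₂ (in-range w∈))))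
                                                   (Boolₚ.if-float u (w ≡ᵇ v))))
               (∏-update (range 1 n) v (u t) (λ w → u (type σ w)) (range-unique 1 n) (∈-range⁺ 1 n v 1≤v v≤n))))

      private
        owned-at-i : ownedGaps s weightAfter i ≡ when L (weightAfter (i ∸ 1)) + when M (weightAfter i)
        owned-at-i = cong₂ _+_
          (cong (λ x → when (s (i ∸ 1) <ᵇ x) (weightAfter (i ∸ 1))) σi≡v)
          (cong (λ b → when b (weightAfter i))
                (trans (cong (λ x → not (x <ᵇ s (suc i))) σi≡v) (trans (cong not v<ᵇb≡not-M) (Boolₚ.not-involutive M))))

        owned-at-j : ownedGaps s weightAfter j ≡ 0# + when R (weightAfter j)
        owned-at-j = cong₂ _+_
          (cong (λ b → when b (weightAfter (j ∸ 1))) (trans (cong (s (j ∸ 1) <ᵇ_) σj≡v) c<ᵇv≡false))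
          (cong (λ b → when b (weightAfter j))
                (trans (cong (λ x → not (x <ᵇ s (suc j))) σj≡v) (trans (cong not v<ᵇd≡not-R) (Boolₚ.not-involutive R))))

        rearrange : ∀ b x → when b x * u⊤ * weightWithout v ≡ when b (x * weightWithout v * u⊤)
        rearrange b x = trans (cong (_* weightWithout v) (when-* b x u⊤)) (trans (when-* b (x * u⊤) (weightWithout v))
          (cong (when b) (trans (*-assoc x u⊤ _) (trans (cong (x *_) (*-comm u⊤ _)) (sym (*-assoc x _ u⊤))))))

      ∑-owned : ∑ (seq 1 (length σ)) (λ k → if s k ≡ᵇ v then ownedGaps s weightAfter k else 0#)
              ≡ ∂ u (type σ v) * weightWithout v
      ∑-owned = begin
        ∑ (seq 1 (length σ)) (λ k → if s k ≡ᵇ v then ownedGaps s weightAfter k else 0#)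
          ≡⟨ ∑-bfilter (λ k → s k ≡ᵇ v) (seq 1 (length σ)) (ownedGaps s weightAfter) ⟩
        ∑ (bfilter (λ k → s k ≡ᵇ v) (seq 1 (length σ))) (ownedGaps s weightAfter)
          ≡⟨ cong (λ ks → ∑ ks (ownedGaps s weightAfter)) (trans (cong (bfilter _) (sym (positions≡seq σ))) occPos≡) ⟩
        ownedGaps s weightAfter i + (ownedGaps s weightAfter j + 0#)
          ≡⟨ cong₂ _+_ owned-at-i (trans (+-identityʳ _) (trans owned-at-j (+-identityˡ _))) ⟩
        (when L (weightAfter (i ∸ 1)) + when M (weightAfter i)) + when R (weightAfter j)
          ≡⟨ cong₂ _+_ (cong₂ _+_ (when-cong L (λ L≡true → weightAfter-effect (i ∸ 1) i-1≤2n _ (insert-before L≡true)))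
                                  (when-cong M (λ M≡true → weightAfter-effect i i≤2n _ (insert-inside M≡true))))
                       (when-cong R (λ R≡true → weightAfter-effect j j≤2n _ (insert-after R≡true))) ⟩
        (when L (uL * weightWithout v * u⊤) + when M (uM * weightWithout v * u⊤)) + when R (uR * weightWithout v * u⊤)
          ≡⟨ sym (cong₂ _+_ (cong₂ _+_ (rearrange L uL) (rearrange M uM)) (rearrange R uR)) ⟩
        (when L uL * u⊤ * weightWithout v + when M uM * u⊤ * weightWithout v) + when R uR * u⊤ * weightWithout v
          ≡⟨ sym (trans (distribʳ (weightWithout v) _ _) (cong (_+ when R uR * u⊤ * weightWithout v) (distribʳ (weightWithout v) _ _))) ⟩
        ((when L uL * u⊤ + when M uM * u⊤) + when R uR * u⊤) * weightWithout v
          ≡⟨ cong (_* weightWithout v) (sym (trans (distribʳ u⊤ _ _) (cong (_+ when R uR * u⊤) (distribʳ u⊤ _ _)))) ⟩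
        ∂ u (L , M , R) * weightWithout v
          ≡⟨ cong (λ t → ∂ u t * weightWithout v) (sym type≡) ⟩
        ∂ u (type σ v) * weightWithout v ∎
        where
        uL uM uR : Carrier
        uL = u (false , M , R)
        uM = u (L , false , R)
        uR = u (L , M , false)

    ∑-insertions : 1 ≤ n → ∑ (seq 0 (suc (2 ℕ.* n))) weightAfter ≡ ∑ (range 1 n) (λ v → ∂ u (type σ v) * weightWithout v)
    ∑-insertions 1≤n = begin
      ∑ (seq 0 (suc (2 ℕ.* n))) weightAfter
        ≡⟨ cong (λ l → ∑ (seq 0 (suc l)) weightAfter) (sym length≡) ⟩
      ∑ (seq 0 (suc (length σ))) weightAfter
        ≡⟨ ∑-gaps≡∑-ownedGaps s weightAfter (length σ) 1≤length refl (positive 1 ℕₚ.≤-refl 1≤length)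
                                            (σ[]-beyond σ (suc (length σ)) ℕₚ.≤-refl) ⟩
      ∑ (seq 1 (length σ)) (ownedGaps s weightAfter)
        ≡⟨ ∑-groupBy (seq 1 (length σ)) (range 1 n) s (ownedGaps s weightAfter) (range-unique 1 n) value∈range ⟩
      ∑ (range 1 n) (λ v → ∑ (seq 1 (length σ)) (λ k → if s k ≡ᵇ v then ownedGaps s weightAfter k else 0#))
        ≡⟨ ∑-cong (range 1 n) (λ v v∈ → OwnedByValue.∑-owned v (proj₁ (in-range v∈)) (proj₂ (in-range v∈))) ⟩
      ∑ (range 1 n) (λ v → ∂ u (type σ v) * weightWithout v) ∎
      where
      1≤length : 1 ≤ length σ
      1≤length = subst (1 ≤_) (sym length≡) (ℕₚ.≤-trans 1≤n (ℕₚ.m≤m+n n (n ℕ.+ 0)))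
      value∈range : ∀ k → k ∈ seq 1 (length σ) → s k ∈ range 1 n
      value∈range k k∈ = let 1≤k , k≤ = ∈-seq⁻ 1 (length σ) k∈ in
        ∈-range⁺ 1 n (s k) (positive k 1≤k (ℕₚ.≤-pred k≤)) (bounded k)

module DerivationPolynomials where

  open Preliminaries
  open CommutativeSemirings
  open StirlingWords
  open ValueTypes
  open GapSums
  open import Defs using (range)
  open import Data.Nat as ℕ using (ℕ; zero; suc; _∸_; _≡ᵇ_; z≤n; s≤s)
  import Data.Nat.Properties as ℕₚ
  open import Data.Bool using (true; false)
  open import Data.List using (List; []; _∷_; _++_; map; concatMap)
  open import Data.Product using (_×_; _,_; proj₁; proj₂)
  import Algebra.Solver.CommutativeMonoid as CommutativeMonoidSolver
  open import Relation.Binary.PropositionalEquality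

  -- c , i , j , k , m stands for c e₁ⁱ e₂ʲ e₃ᵏ e₀ᵐ.
  Term : Set
  Term = ℕ × ℕ × ℕ × ℕ × ℕ

  ∂₁ ∂₂ ∂₃ ∂-term : Term → List Term
  ∂₁ (c , zero  , j , k , m) = []
  ∂₁ (c , suc i , j , k , m) = (3 ℕ.* suc i ℕ.* c , i , j , suc k , suc m) ∷ []
  ∂₂ (c , i , zero  , k , m) = []
  ∂₂ (c , i , suc j , k , m) = (2 ℕ.* suc j ℕ.* c , suc i , j , suc k , m) ∷ []
  ∂₃ (c , i , j , zero  , m) = []
  ∂₃ (c , i , j , suc k , m) = (suc k ℕ.* c , i , suc j , suc k , m) ∷ []
  ∂-term t = ∂₁ t ++ (∂₂ t ++ ∂₃ t)

  expansion : ℕ → List Term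
  expansion zero    = (1 , 0 , 0 , 1 , 0) ∷ []
  expansion (suc n) = concatMap ∂-term (expansion n)

  module ElementaryWeights (𝓡 : ≡-CommutativeSemiring) (u : Type → ≡-CommutativeSemiring.Carrier 𝓡) where
    open SemiringSums 𝓡

    e₀ e₁ e₂ e₃ : Carrier
    e₀ = u (false , false , false)
    e₁ = u (true , false , false) + u (false , true , false) + u (false , false , true)
    e₂ = u (true , true , false) + u (true , false , true) + u (false , true , true)
    e₃ = u (true , true , true)

    ⟦_⟧ : Term → Carrier
    ⟦ c , i , j , k , m ⟧ = c · (e₁ ^ i * e₂ ^ j * e₃ ^ k * e₀ ^ m)

    Φ : ℕ → Carrier
    Φ n = ∑ (byInsertion n) (λ σ → ∏ (range 1 n) (λ v → u (type σ v)))

    Λ : ℕ → Carrier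
    Λ n = ∑ (expansion n) ⟦_⟧

  module DualDerivative (𝓡 : ≡-CommutativeSemiring) (u : Type → ≡-CommutativeSemiring.Carrier 𝓡) where
    open SemiringSums 𝓡
    open DualNumbers 𝓡
    open Derivation 𝓡
    open ElementaryWeights 𝓡 u
    private
      module D = SemiringSums Dual
      module +-Solver = CommutativeMonoidSolver +-commutativeMonoid
      module *-Solver = CommutativeMonoidSolver *-commutativeMonoid
    open ≡-Reasoning

    ũ : Type → Carrier × Carrier
    ũ t = (u t , ∂ u t)

    module Ẽ = ElementaryWeights Dual ũ

    private
      factorʳ : ∀ x y z w → x * w + y * w + z * w ≡ (x + y + z) * w
      factorʳ x y z w = sym (trans (distribʳ w _ _) (cong (_+ z * w) (distribʳ w _ _)))

    ε-e₀ : proj₂ Ẽ.e₀ ≡ 0#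
    ε-e₀ = trans (cong (_* e₃) (trans (+-identityʳ _) (+-identityˡ 0#))) (zeroˡ e₃)

    ε-e₁ : proj₂ Ẽ.e₁ ≡ 3 · (e₀ * e₃)
    ε-e₁ = begin
      ((e₀ + 0#) + 0#) * e₃ + ((0# + e₀) + 0#) * e₃ + ((0# + 0#) + e₀) * e₃ ≡⟨ factorʳ _ _ _ e₃ ⟩
      (((e₀ + 0#) + 0#) + ((0# + e₀) + 0#) + ((0# + 0#) + e₀)) * e₃
        ≡⟨ cong (_* e₃) (+-Solver.solve 1 (λ x → (((x ⊕ id) ⊕ id) ⊕ ((id ⊕ x) ⊕ id)) ⊕ ((id ⊕ id) ⊕ x)
                                               ⊜ x ⊕ (x ⊕ (x ⊕ id))) refl e₀) ⟩
      (3 · e₀) * e₃                                                       ≡⟨ ×-assoc-* 3 e₀ e₃ ⟩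
      3 · (e₀ * e₃)                                                       ∎
      where open +-Solver using (_⊕_; _⊜_; id)

    ε-e₂ : proj₂ Ẽ.e₂ ≡ 2 · (e₁ * e₃)
    ε-e₂ = begin
      ((b + a) + 0#) * e₃ + ((c + 0#) + a) * e₃ + ((0# + c) + b) * e₃    ≡⟨ factorʳ _ _ _ e₃ ⟩
      (((b + a) + 0#) + ((c + 0#) + a) + ((0# + c) + b)) * e₃
        ≡⟨ cong (_* e₃) (+-Solver.solve 3 (λ x y z → (((y ⊕ x) ⊕ id) ⊕ ((z ⊕ id) ⊕ x)) ⊕ ((id ⊕ z) ⊕ y)
                                                   ⊜ ((x ⊕ y) ⊕ z) ⊕ (((x ⊕ y) ⊕ z) ⊕ id)) refl a b c) ⟩
      (2 · e₁) * e₃                                                       ≡⟨ ×-assoc-* 2 e₁ e₃ ⟩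
      2 · (e₁ * e₃)                                                       ∎
      where
      open +-Solver using (_⊕_; _⊜_; id)
      a = u (true , false , false)
      b = u (false , true , false)
      c = u (false , false , true)

    ε-e₃ : proj₂ Ẽ.e₃ ≡ e₂ * e₃
    ε-e₃ = cong (_* e₃) (+-Solver.solve 3 (λ x y z → (z ⊕ y) ⊕ x ⊜ (x ⊕ y) ⊕ z) refl
                           (u (true , true , false)) (u (true , false , true)) (u (false , true , true)))
      where open +-Solver using (_⊕_; _⊜_; id)

    private
      ε-product : ∀ (X Y Z W : Carrier × Carrier) → proj₂ W ≡ 0# →
        proj₂ (X D.* Y D.* Z D.* W) ≡ proj₂ X * proj₁ Y * proj₁ Z * proj₁ W
                                    + proj₁ X * proj₂ Y * proj₁ Z * proj₁ W
                                    + proj₁ X * proj₁ Y * proj₂ Z * proj₁ W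
      ε-product (x , x′) (y , y′) (z , z′) (w , w′) w′≡0 rewrite w′≡0 = begin
        x * y * z * 0# + (x * y * z′ + (x * y′ + x′ * y) * z) * w
          ≡⟨ cong₂ _+_ (zeroʳ _) (trans (distribʳ w _ _) (cong (x * y * z′ * w +_) (cong (_* w) (distribʳ z _ _)))) ⟩
        0# + (x * y * z′ * w + (x * y′ * z + x′ * y * z) * w)
          ≡⟨ trans (+-identityˡ _) (cong (x * y * z′ * w +_) (distribʳ w _ _)) ⟩
        x * y * z′ * w + (x * y′ * z * w + x′ * y * z * w)
          ≡⟨ +-Solver.solve 3 (λ a b c → c ⊕ (b ⊕ a) ⊜ (a ⊕ b) ⊕ c) refl (x′ * y * z * w) (x * y′ * z * w) (x * y * z′ * w) ⟩
        x′ * y * z * w + x * y′ * z * w + x * y * z′ * w ∎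
        where open +-Solver using (_⊕_; _⊜_)

      scalars : ∀ c a b x → c · (a · (b · x)) ≡ (b ℕ.* a ℕ.* c) · x
      scalars c a b x = begin
        c · (a · (b · x))      ≡⟨ cong (c ·_) (×-assocˡ x a b) ⟩
        c · ((a ℕ.* b) · x)    ≡⟨ ×-assocˡ x c (a ℕ.* b) ⟩
        (c ℕ.* (a ℕ.* b)) · x  ≡⟨ cong (_· x) (trans (ℕₚ.*-comm c _) (cong (ℕ._* c) (ℕₚ.*-comm a b))) ⟩
        (b ℕ.* a ℕ.* c) · x    ∎

      pull₃ : ∀ a x y z → (a · x) * y * z ≡ a · (x * y * z)
      pull₃ a x y z = trans (cong (_* z) (×-assoc-* a x y)) (×-assoc-* a (x * y) z)

      pull₄ : ∀ a x y z w → (a · x) * y * z * w ≡ a · (x * y * z * w)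
      pull₄ a x y z w = trans (cong (_* w) (pull₃ a x y z)) (×-assoc-* a (x * y * z) w)

      ε-via-e₁ : ∀ c i j k m → c · ((i · (e₁ ^ (i ∸ 1) * 3 · (e₀ * e₃))) * e₂ ^ j * e₃ ^ k * e₀ ^ m)
                             ≡ ∑ (∂₁ (c , i , j , k , m)) ⟦_⟧
      ε-via-e₁ c zero    j k m = trans (cong (c ·_) (trans (cong (λ v → v * e₃ ^ k * e₀ ^ m) (zeroˡ _))
                                   (trans (cong (_* e₀ ^ m) (zeroˡ _)) (zeroˡ _)))) (·-zeroʳ c)
      ε-via-e₁ c (suc i) j k m = begin
        c · ((suc i · (e₁ ^ i * 3 · (e₀ * e₃))) * B * C * T)
          ≡⟨ cong (c ·_) (pull₄ (suc i) _ B C T) ⟩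
        c · (suc i · ((e₁ ^ i * 3 · (e₀ * e₃)) * B * C * T))
          ≡⟨ cong (λ v → c · (suc i · (v * B * C * T))) (×-comm-* 3 (e₁ ^ i) (e₀ * e₃)) ⟩
        c · (suc i · ((3 · (e₁ ^ i * (e₀ * e₃))) * B * C * T))
          ≡⟨ cong (λ v → c · (suc i · v)) (pull₄ 3 _ B C T) ⟩
        c · (suc i · (3 · ((e₁ ^ i * (e₀ * e₃)) * B * C * T)))
          ≡⟨ scalars c (suc i) 3 _ ⟩
        (3 ℕ.* suc i ℕ.* c) · ((e₁ ^ i * (e₀ * e₃)) * B * C * T)
          ≡⟨ cong ((3 ℕ.* suc i ℕ.* c) ·_) (*-Solver.solve 6 (λ a z t b c′ tm → (((a ⊕ (t ⊕ z)) ⊕ b) ⊕ c′) ⊕ tm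
                                                           ⊜ ((a ⊕ b) ⊕ (z ⊕ c′)) ⊕ (t ⊕ tm)) refl (e₁ ^ i) e₃ e₀ B C T) ⟩
        (3 ℕ.* suc i ℕ.* c) · (e₁ ^ i * B * e₃ ^ suc k * e₀ ^ suc m)
          ≡⟨ sym (+-identityʳ _) ⟩
        ∑ (∂₁ (c , suc i , j , k , m)) ⟦_⟧ ∎
        where
        open *-Solver using (_⊕_; _⊜_)
        B = e₂ ^ j
        C = e₃ ^ k
        T = e₀ ^ m

      ε-via-e₂ : ∀ c i j k m → c · (e₁ ^ i * (j · (e₂ ^ (j ∸ 1) * 2 · (e₁ * e₃))) * e₃ ^ k * e₀ ^ m)
                             ≡ ∑ (∂₂ (c , i , j , k , m)) ⟦_⟧
      ε-via-e₂ c i zero    k m = trans (cong (c ·_) (trans (cong (λ v → v * e₃ ^ k * e₀ ^ m) (zeroʳ _))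
                                   (trans (cong (_* e₀ ^ m) (zeroˡ _)) (zeroˡ _)))) (·-zeroʳ c)
      ε-via-e₂ c i (suc j) k m = begin
        c · (A * (suc j · (e₂ ^ j * 2 · (e₁ * e₃))) * C * T)
          ≡⟨ cong (λ v → c · (v * C * T)) (×-comm-* (suc j) A _) ⟩
        c · ((suc j · (A * (e₂ ^ j * 2 · (e₁ * e₃)))) * C * T)
          ≡⟨ cong (c ·_) (pull₃ (suc j) _ C T) ⟩
        c · (suc j · ((A * (e₂ ^ j * 2 · (e₁ * e₃))) * C * T))
          ≡⟨ cong (λ v → c · (suc j · (v * C * T))) (trans (cong (A *_) (×-comm-* 2 (e₂ ^ j) (e₁ * e₃))) (×-comm-* 2 A _)) ⟩
        c · (suc j · ((2 · (A * (e₂ ^ j * (e₁ * e₃)))) * C * T))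
          ≡⟨ cong (λ v → c · (suc j · v)) (pull₃ 2 _ C T) ⟩
        c · (suc j · (2 · ((A * (e₂ ^ j * (e₁ * e₃))) * C * T)))
          ≡⟨ scalars c (suc j) 2 _ ⟩
        (2 ℕ.* suc j ℕ.* c) · ((A * (e₂ ^ j * (e₁ * e₃))) * C * T)
          ≡⟨ cong ((2 ℕ.* suc j ℕ.* c) ·_) (*-Solver.solve 6 (λ a b f z c′ tm → ((a ⊕ (b ⊕ (f ⊕ z))) ⊕ c′) ⊕ tm
                                                           ⊜ (((f ⊕ a) ⊕ b) ⊕ (z ⊕ c′)) ⊕ tm) refl A (e₂ ^ j) e₁ e₃ C T) ⟩
        (2 ℕ.* suc j ℕ.* c) · (e₁ ^ suc i * e₂ ^ j * e₃ ^ suc k * e₀ ^ m)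
          ≡⟨ sym (+-identityʳ _) ⟩
        ∑ (∂₂ (c , i , suc j , k , m)) ⟦_⟧ ∎
        where
        open *-Solver using (_⊕_; _⊜_)
        A = e₁ ^ i
        C = e₃ ^ k
        T = e₀ ^ m

      ε-via-e₃ : ∀ c i j k m → c · (e₁ ^ i * e₂ ^ j * (k · (e₃ ^ (k ∸ 1) * (e₂ * e₃))) * e₀ ^ m)
                             ≡ ∑ (∂₃ (c , i , j , k , m)) ⟦_⟧
      ε-via-e₃ c i j zero    m = trans (cong (c ·_) (trans (cong (_* e₀ ^ m) (zeroʳ _)) (zeroˡ _))) (·-zeroʳ c)
      ε-via-e₃ c i j (suc k) m = begin
        c · (AB * (suc k · (e₃ ^ k * (e₂ * e₃))) * T)
          ≡⟨ cong (λ v → c · (v * T)) (×-comm-* (suc k) AB _) ⟩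
        c · ((suc k · (AB * (e₃ ^ k * (e₂ * e₃)))) * T)
          ≡⟨ cong (c ·_) (×-assoc-* (suc k) _ T) ⟩
        c · (suc k · (AB * (e₃ ^ k * (e₂ * e₃)) * T))
          ≡⟨ ×-assocˡ _ c (suc k) ⟩
        (c ℕ.* suc k) · (AB * (e₃ ^ k * (e₂ * e₃)) * T)
          ≡⟨ cong₂ _·_ (ℕₚ.*-comm c (suc k))
                   (*-Solver.solve 6 (λ a b f z c′ tm → ((a ⊕ b) ⊕ (c′ ⊕ (f ⊕ z))) ⊕ tm
                                                      ⊜ ((a ⊕ (f ⊕ b)) ⊕ (z ⊕ c′)) ⊕ tm) refl (e₁ ^ i) (e₂ ^ j) e₂ e₃ (e₃ ^ k) T) ⟩
        (suc k ℕ.* c) · (e₁ ^ i * e₂ ^ suc j * e₃ ^ suc k * e₀ ^ m)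
          ≡⟨ sym (+-identityʳ _) ⟩
        ∑ (∂₃ (c , i , j , suc k , m)) ⟦_⟧ ∎
        where
        open *-Solver using (_⊕_; _⊜_)
        AB = e₁ ^ i * e₂ ^ j
        T = e₀ ^ m

      cong₄-* : ∀ {a a′ b b′ c c′ d d′} → a ≡ a′ → b ≡ b′ → c ≡ c′ → d ≡ d′ → a * b * c * d ≡ a′ * b′ * c′ * d′
      cong₄-* refl refl refl refl = refl

      ε-^ : ∀ x k {y} → proj₂ x ≡ y → proj₂ (x D.^ k) ≡ k · (proj₁ x ^ (k ∸ 1) * y)
      ε-^ x k x′≡y = trans (proj₂-^ x k) (cong (λ y → k · (proj₁ x ^ (k ∸ 1) * y)) x′≡y)

    ε-⟦⟧ : ∀ t → proj₂ Ẽ.⟦ t ⟧ ≡ ∑ (∂-term t) ⟦_⟧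
    ε-⟦⟧ t@(c , i , j , k , m) = begin
      proj₂ (c D.· X̃)
        ≡⟨ proj₂-· c X̃ ⟩
      c · proj₂ X̃
        ≡⟨ cong (c ·_) (ε-product (Ẽ.e₁ D.^ i) (Ẽ.e₂ D.^ j) (Ẽ.e₃ D.^ k) (Ẽ.e₀ D.^ m)
                                    (trans (ε-^ Ẽ.e₀ m ε-e₀) (trans (cong (m ·_) (zeroʳ _)) (·-zeroʳ m)))) ⟩
      c · (proj₂ (Ẽ.e₁ D.^ i) * proj₁ (Ẽ.e₂ D.^ j) * proj₁ (Ẽ.e₃ D.^ k) * proj₁ (Ẽ.e₀ D.^ m)
         + proj₁ (Ẽ.e₁ D.^ i) * proj₂ (Ẽ.e₂ D.^ j) * proj₁ (Ẽ.e₃ D.^ k) * proj₁ (Ẽ.e₀ D.^ m)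
         + proj₁ (Ẽ.e₁ D.^ i) * proj₁ (Ẽ.e₂ D.^ j) * proj₂ (Ẽ.e₃ D.^ k) * proj₁ (Ẽ.e₀ D.^ m))
        ≡⟨ cong (c ·_) (cong₂ _+_ (cong₂ _+_
             (cong₄-* (ε-^ Ẽ.e₁ i ε-e₁) (proj₁-^ Ẽ.e₂ j) (proj₁-^ Ẽ.e₃ k) (proj₁-^ Ẽ.e₀ m))
             (cong₄-* (proj₁-^ Ẽ.e₁ i) (ε-^ Ẽ.e₂ j ε-e₂) (proj₁-^ Ẽ.e₃ k) (proj₁-^ Ẽ.e₀ m)))
             (cong₄-* (proj₁-^ Ẽ.e₁ i) (proj₁-^ Ẽ.e₂ j) (ε-^ Ẽ.e₃ k ε-e₃) (proj₁-^ Ẽ.e₀ m))) ⟩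
      c · (T₁ + T₂ + T₃)
        ≡⟨ trans (×-distrib-+ _ _ c) (cong (_+ c · T₃) (×-distrib-+ _ _ c)) ⟩
      c · T₁ + c · T₂ + c · T₃
        ≡⟨ cong₂ _+_ (cong₂ _+_ (ε-via-e₁ c i j k m) (ε-via-e₂ c i j k m)) (ε-via-e₃ c i j k m) ⟩
      ∑ (∂₁ t) ⟦_⟧ + ∑ (∂₂ t) ⟦_⟧ + ∑ (∂₃ t) ⟦_⟧
        ≡⟨ +-assoc _ _ _ ⟩
      ∑ (∂₁ t) ⟦_⟧ + (∑ (∂₂ t) ⟦_⟧ + ∑ (∂₃ t) ⟦_⟧)
        ≡⟨ sym (trans (∑-++ (∂₁ t) _ ⟦_⟧) (cong (∑ (∂₁ t) ⟦_⟧ +_) (∑-++ (∂₂ t) (∂₃ t) ⟦_⟧))) ⟩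
      ∑ (∂-term t) ⟦_⟧ ∎
      where
      X̃ = Ẽ.e₁ D.^ i D.* Ẽ.e₂ D.^ j D.* Ẽ.e₃ D.^ k D.* Ẽ.e₀ D.^ m
      T₁ = (i · (e₁ ^ (i ∸ 1) * 3 · (e₀ * e₃))) * e₂ ^ j * e₃ ^ k * e₀ ^ m
      T₂ = e₁ ^ i * (j · (e₂ ^ (j ∸ 1) * 2 · (e₁ * e₃))) * e₃ ^ k * e₀ ^ m
      T₃ = e₁ ^ i * e₂ ^ j * (k · (e₃ ^ (k ∸ 1) * (e₂ * e₃))) * e₀ ^ m

  Φ≡Λ : ∀ n (𝓡 : ≡-CommutativeSemiring) (u : Type → ≡-CommutativeSemiring.Carrier 𝓡) →
        ElementaryWeights.Φ 𝓡 u (suc n) ≡ ElementaryWeights.Λ 𝓡 u n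
  Φ≡Λ zero 𝓡 u = cong (_+ 0#) (trans (*-Solver.solve 1 (λ x → x ⊕ id ⊜ (((id ⊕ id) ⊕ (x ⊕ id)) ⊕ id)) refl e₃)
                                      (sym (+-identityʳ _)))
    where
    open SemiringSums 𝓡
    open ElementaryWeights 𝓡 u
    module *-Solver = CommutativeMonoidSolver *-commutativeMonoid
    open *-Solver using (_⊕_; _⊜_; id)
  Φ≡Λ (suc n) 𝓡 u = begin
    ∑ (concatMap (λ τ → map (insertPair N τ) gaps) (byInsertion (suc n))) weight
      ≡⟨ ∑-concatMap _ (byInsertion (suc n)) weight ⟩
    ∑ (byInsertion (suc n)) (λ τ → ∑ (map (insertPair N τ) gaps) weight)
      ≡⟨ ∑-cong (byInsertion (suc n)) (λ τ τ∈ → trans (∑-map (insertPair N τ) gaps weight)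
           (InsertionSum.∑-insertions (suc n) τ (byInsertion⇒isStirling (suc n) τ τ∈) 𝓡 u (s≤s z≤n))) ⟩
    ∑ (byInsertion (suc n)) (λ τ → ∑ values (λ v → ∂ u (type τ v) * ∏-except v values (λ w → u (type τ w))))
      ≡⟨ ∑-cong (byInsertion (suc n)) (λ τ _ → sym (proj₂-∏ values (λ v → ũ (type τ v)) (range-unique 1 (suc n)))) ⟩
    ∑ (byInsertion (suc n)) (λ τ → proj₂ (D.∏ values (λ v → ũ (type τ v))))
      ≡⟨ sym (proj₂-∑ (byInsertion (suc n)) _) ⟩
    proj₂ (Ẽ.Φ (suc n))
      ≡⟨ cong proj₂ (Φ≡Λ n Dual ũ) ⟩
    proj₂ (Ẽ.Λ n)
      ≡⟨ proj₂-∑ (expansion n) _ ⟩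
    ∑ (expansion n) (λ t → proj₂ Ẽ.⟦ t ⟧)
      ≡⟨ ∑-cong (expansion n) (λ t _ → ε-⟦⟧ t) ⟩
    ∑ (expansion n) (λ t → ∑ (∂-term t) ⟦_⟧)
      ≡⟨ sym (∑-concatMap ∂-term (expansion n) ⟦_⟧) ⟩
    Λ (suc n) ∎
    where
    open SemiringSums 𝓡
    open DualNumbers 𝓡
    open Leibniz _≡ᵇ_ ≡ᵇ-true⇒≡ ≡ᵇ-refl
    open Keyed _≡ᵇ_ ≡ᵇ-true⇒≡ ≡ᵇ-refl
    open Derivation 𝓡
    open ElementaryWeights 𝓡 u
    open DualDerivative 𝓡 u using (ũ; module Ẽ; ε-⟦⟧)
    module D = SemiringSums Dual
    open ≡-Reasoning
    N = suc (suc n)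
    gaps = seq 0 (suc (2 ℕ.* suc n))
    values = range 1 (suc n)
    weight : List ℕ → Carrier
    weight σ = ∏ (range 1 N) (λ v → u (type σ v))

module StatisticWeights where

  open Preliminaries
  open CommutativeSemirings
  open StirlingWords
  open ValueTypes
  open import Defs hiding (_^_)
  open import Data.Nat using (ℕ)
  open import Data.Bool using (Bool; true; false; not; if_then_else_; _∧_)
  open import Data.List using (List; []; _∷_)
  open import Data.Product using (_,_)
  open import Relation.Binary.PropositionalEquality

  module StatisticWeight (𝓡 : ≡-CommutativeSemiring) (x y z p q r s t : ≡-CommutativeSemiring.Carrier 𝓡) where
    open SemiringSums 𝓡
    open ≡-Reasoning
    private module V = ValueType

    ind : Bool → Carrier → Carrier
    ind b v = if b then v else 1#

    U : Type → Carrier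
    U (l , m , d) = ind l x * ind m y * ind d z * ind (l ∧ m) p * ind (l ∧ d) q * ind (m ∧ d) r
                  * ind (l ∧ (m ∧ d)) s * ind (not l ∧ not m ∧ not d) t

    ^-bcount : ∀ v (f : ℕ → Bool) ws → v ^ bcount f ws ≡ ∏ ws (λ w → ind (f w) v)
    ^-bcount v f []       = refl
    ^-bcount v f (w ∷ ws) with f w
    ... | true  = cong (v *_) (^-bcount v f ws)
    ... | false = trans (^-bcount v f ws) (sym (*-identityˡ _))

    weight : ℕ → List ℕ → Carrier
    weight n σ = x ^ asc n σ * y ^ plat n σ * z ^ des n σ * p ^ lap n σ
               * q ^ eud n σ * r ^ rpd n σ * s ^ apd n σ * t ^ vv n σ

    weight≡∏U : ∀ n σ → IsStirling n σ → weight n σ ≡ ∏ (range 1 n) (λ v → U (type σ v))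
    weight≡∏U n σ S = begin
      weight n σ
        ≡⟨ cong₂ _*_ (cong₂ _*_ (cong₂ _*_ (cong₂ _*_ (cong₂ _*_ (cong₂ _*_ (cong₂ _*_
             (^-bcount x _ vs) (^-bcount y _ vs)) (^-bcount z _ vs)) (^-bcount p _ vs))
             (^-bcount q _ vs)) (^-bcount r _ vs)) (^-bcount s _ vs)) (^-bcount t _ vs) ⟩
      ∏ vs fx * ∏ vs fy * ∏ vs fz * ∏ vs fp * ∏ vs fq * ∏ vs fr * ∏ vs fs * ∏ vs ft
        ≡⟨ sym (trans (∏-distrib-* vs _ ft) (cong (_* ∏ vs ft) (trans (∏-distrib-* vs _ fs) (cong (_* ∏ vs fs)
             (trans (∏-distrib-* vs _ fr) (cong (_* ∏ vs fr) (trans (∏-distrib-* vs _ fq) (cong (_* ∏ vs fq)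
             (trans (∏-distrib-* vs _ fp) (cong (_* ∏ vs fp) (trans (∏-distrib-* vs _ fz) (cong (_* ∏ vs fz)
             (∏-distrib-* vs fx fy))))))))))))) ⟩
      ∏ vs (λ v → fx v * fy v * fz v * fp v * fq v * fr v * fs v * ft v)
        ≡⟨ ∏-cong vs (λ v v∈ → let 1≤v , v≤n = ∈-range⁻ 1 n v∈ in by-type v (IsStirling.occurrences S v 1≤v v≤n)) ⟩
      ∏ vs (λ v → U (type σ v)) ∎
      where
      vs = range 1 n
      fx fy fz fp fq fr fs ft : ℕ → Carrier
      fx v = ind (hasAt ascAt σ v) x
      fy v = ind (hasAt platAt σ v) y
      fz v = ind (hasAt desAt σ v) z
      fp v = ind (hasAt lapAt σ v) p
      fq v = ind (pairTest n eudAt σ v) q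
      fr v = ind (hasAt rpdAt σ v) r
      fs v = ind (hasAt apdAt σ v) s
      ft v = ind (pairTest n vvAt σ v) t
      by-type : ∀ v → Occurrences σ v → fx v * fy v * fz v * fp v * fq v * fr v * fs v * ft v ≡ U (type σ v)
      by-type v O rewrite V.asc≡L σ v O | V.plat≡M σ v O | V.des≡R σ v O | V.lap≡L∧M σ v O | V.eud≡L∧R σ v O n
                        | V.rpd≡M∧R σ v O | V.apd≡L∧M∧R σ v O | V.vv≡none σ v O n = refl

module Enumeration where

  open Preliminaries
  open StirlingWords
  open ValueTypes using (positions≡seq; module ValueType)
  open import Defs
  open import Data.Nat as ℕ using (ℕ; zero; suc; _*_; _∸_; _≡ᵇ_; _<ᵇ_; _<_; _≤_; z≤n; s≤s)
  import Data.Nat.Properties as ℕₚ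
  open import Data.Bool using (Bool; true; false; not; if_then_else_; _∧_)
  open import Data.Bool.ListAction using (all)
  open import Data.List using (List; []; _∷_; map; length; drop)
  open import Data.List.Properties using (length-map)
  open import Data.List.Membership.Propositional using (_∈_)
  open import Data.List.Membership.Propositional.Properties using (∈-map⁺; ∈-map⁻)
  open import Data.List.Membership.Propositional.Properties.WithK using (unique∧set⇒bag)
  open import Data.List.Relation.Unary.Any using (here; there)
  open import Data.List.Relation.Unary.All as All using (All; []; _∷_)
  open import Data.List.Relation.Unary.Unique.Propositional using (Unique; []; _∷_)
  open import Data.List.Relation.Binary.Permutation.Propositional using (_↭_)
  open import Data.List.Relation.Binary.BagAndSetEquality using (∼bag⇒↭)
  open import Data.Product using (_×_; _,_; proj₁; proj₂)
  open import Data.Sum using (_⊎_; inj₁; inj₂)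
  open import Data.Empty using (⊥; ⊥-elim)
  open import Function.Bundles using (mk⇔)
  open import Relation.Nullary using (¬_; yes; no)
  open import Relation.Binary.PropositionalEquality

  ∈-words⁻ : ∀ n L {w} → w ∈ words n L → length w ≡ L × All (λ a → 1 ≤ a × a ≤ n) w
  ∈-words⁻ n zero (here refl) = refl , []
  ∈-words⁻ n (suc L) w∈ with ∈-concatMap⁻′ (λ a → map (a ∷_) (words n L)) (range 1 n) w∈
  ... | a , a∈ , w∈a∷ with ∈-map⁻ (a ∷_) w∈a∷
  ... | w′ , w′∈ , refl = let length≡ , letters = ∈-words⁻ n L w′∈ in cong suc length≡ , ∈-range⁻ 1 n a∈ ∷ letters

  ∈-words⁺ : ∀ n L w → length w ≡ L → All (λ a → 1 ≤ a × a ≤ n) w → w ∈ words n L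
  ∈-words⁺ n zero    []      _        _                   = here refl
  ∈-words⁺ n (suc L) (a ∷ w) length≡ ((1≤a , a≤n) ∷ letters) =
    ∈-concatMap⁺′ (λ a → map (a ∷_) (words n L)) (∈-range⁺ 1 n a 1≤a a≤n)
      (∈-map⁺ (a ∷_) (∈-words⁺ n L w (ℕₚ.suc-injective length≡) letters))

  words-unique : ∀ n L → Unique (words n L)
  words-unique n zero    = [] ∷ []
  words-unique n (suc L) = concatMap-unique _ (range 1 n) (range-unique 1 n)
    (λ a _ → map-unique (a ∷_) (λ _ _ _ _ e → proj₂ (∷-injective e)) (words-unique n L))
    (λ a b _ _ a≢b z∈a∷ z∈b∷ → different-heads a b a≢b z∈a∷ z∈b∷)
    where
    ∷-injective : ∀ {a b : ℕ} {xs ys : List ℕ} → _≡_ {A = List ℕ} (a ∷ xs) (b ∷ ys) → a ≡ b × xs ≡ ys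
    ∷-injective refl = refl , refl
    different-heads : ∀ a b → ¬ a ≡ b → ∀ {z} → z ∈ map (a ∷_) (words n L) → z ∈ map (b ∷_) (words n L) → ⊥
    different-heads a b a≢b z∈a∷ z∈b∷ with ∈-map⁻ (a ∷_) z∈a∷ | ∈-map⁻ (b ∷_) z∈b∷
    ... | _ , _ , refl | _ , _ , e = a≢b (proj₁ (∷-injective e))

  Stirling-unique : ∀ n → Unique (Stirling n)
  Stirling-unique n = bfilter-unique _ (words-unique n (2 * n))

  private
    shift-positions : ∀ (f : ℕ → Bool) a w →
      length (bfilter (λ i → f (at w i)) (seq 0 (length w))) ≡ length (bfilter (λ i → f (at (a ∷ w) i)) (seq 1 (length w)))
    shift-positions f a w = trans (sym (length-map suc (bfilter (λ i → f (at w i)) (seq 0 (length w)))))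
      (cong length (trans (sym (bfilter-map (λ i → f (at (a ∷ w) i)) suc (seq 0 (length w))))
                          (cong (bfilter _) (sym (seq-map-suc 0 (length w))))))

  length-bfilter-by-position : ∀ (f : ℕ → Bool) w →
    length (bfilter f w) ≡ length (bfilter (λ i → f (at w i)) (seq 0 (length w)))
  length-bfilter-by-position f []      = refl
  length-bfilter-by-position f (a ∷ w) with f a
  ... | true  = cong suc (trans (length-bfilter-by-position f w) (shift-positions f a w))
  ... | false = trans (length-bfilter-by-position f w) (shift-positions f a w)

  occ≡length-occPos : ∀ v w → occ v w ≡ length (occPos w v)
  occ≡length-occPos v w = begin
    length (bfilter (λ a → a ≡ᵇ v) w)
      ≡⟨ length-bfilter-by-position (λ a → a ≡ᵇ v) w ⟩
    length (bfilter (λ i → at w i ≡ᵇ v) (seq 0 L))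
      ≡⟨ cong length (bfilter-cong (seq 0 L) (λ i → cong (_≡ᵇ v) (sym (σ[]-suc w i)))) ⟩
    length (bfilter (λ i → σ[ w ] (suc i) ≡ᵇ v) (seq 0 L))
      ≡⟨ sym (length-map suc (bfilter (λ i → σ[ w ] (suc i) ≡ᵇ v) (seq 0 L))) ⟩
    length (map suc (bfilter (λ i → σ[ w ] (suc i) ≡ᵇ v) (seq 0 L)))
      ≡⟨ cong length (sym (bfilter-map (λ i → σ[ w ] i ≡ᵇ v) suc (seq 0 L))) ⟩
    length (bfilter (λ i → σ[ w ] i ≡ᵇ v) (map suc (seq 0 L)))
      ≡⟨ cong (λ ps → length (bfilter (λ i → σ[ w ] i ≡ᵇ v) ps)) (trans (sym (seq-map-suc 0 L)) (sym (positions≡seq w))) ⟩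
    length (occPos w v) ∎
    where
    open ≡-Reasoning
    L = length w

  All-at⁺ : ∀ (P : ℕ → Set) w → (∀ k → k < length w → P (at w k)) → All P w
  All-at⁺ P []      h = []
  All-at⁺ P (a ∷ w) h = h 0 (s≤s z≤n) ∷ All-at⁺ P w (λ k k< → h (suc k) (s≤s k<))

  All-at⁻ : ∀ (P : ℕ → Set) w → All P w → ∀ k → k < length w → P (at w k)
  All-at⁻ P (a ∷ w) (pa ∷ pw) zero    _        = pa
  All-at⁻ P (a ∷ w) (pa ∷ pw) (suc k) (s≤s k<) = All-at⁻ P w pw k k<

  σ[]≡at-pred : ∀ w i → 1 ≤ i → σ[ w ] i ≡ at w (i ∸ 1)
  σ[]≡at-pred w (suc k) _ = σ[]-suc w k

  module _ {n : ℕ} {σ : List ℕ} (S : IsStirling n σ) where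
    open IsStirling S

    private
      L = length σ

    isStirling⇒isMultisetPerm : isMultisetPerm n σ ≡ true
    isStirling⇒isMultisetPerm = all-true⁺ _ (range 1 n) λ v v∈ → let 1≤v , v≤n = ∈-range⁻ 1 n v∈ in
      ≡⇒≡ᵇ-true (trans (occ≡length-occPos v σ) (cong length (ValueType.occPos≡ σ v (occurrences v 1≤v v≤n))))

    private
      stirling-pair : ∀ i j → 1 ≤ i → i ≤ L → 1 ≤ j → i < j → σ[ σ ] j ≡ σ[ σ ] i →
                      ∀ s → suc i ≤ s → s ≤ j ∸ 1 → (at σ (i ∸ 1) <ᵇ at σ (s ∸ 1)) ≡ true
      stirling-pair i j 1≤i i≤L 1≤j i<j σj≡σi s i<s s≤j-1 =
        <⇒<ᵇ-true (subst₂ _<_ (σ[]≡at-pred σ i 1≤i) (σ[]≡at-pred σ s (ℕₚ.≤-trans (s≤s z≤n) i<s))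
          (between s (subst (_< s) i≡fst i<s) (subst (s <_) j≡snd (ℕₚ.≤-trans (s≤s s≤j-1) (ℕₚ.≤-reflexive (ℕₚ.m+[n∸m]≡n {1} {j} 1≤j))))))
        where
        open Occurrences (occurrences (σ[ σ ] i) (positive i 1≤i i≤L) (bounded i))
          using (only; between) renaming (i to fst; j to snd; i<j to fst<snd)
        i≡fst : i ≡ fst
        i≡fst with only i refl | only j σj≡σi
        ... | inj₁ e | _      = e
        ... | inj₂ e | inj₁ e′ = ⊥-elim (ℕₚ.<⇒≱ fst<snd
                                   (ℕₚ.≤-trans (ℕₚ.≤-reflexive (sym e)) (ℕₚ.≤-trans (ℕₚ.<⇒≤ i<j) (ℕₚ.≤-reflexive e′))))
        ... | inj₂ e | inj₂ e′ = ⊥-elim (ℕₚ.<-irrefl (trans e (sym e′)) i<j)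
        j≡snd : j ≡ snd
        j≡snd with only j σj≡σi
        ... | inj₂ e = e
        ... | inj₁ e = ⊥-elim (ℕₚ.<-irrefl (trans i≡fst (sym e)) i<j)

    isStirling⇒stirlingCond : stirlingCond σ ≡ true
    isStirling⇒stirlingCond = all-true⁺ _ (range 1 L) λ i i∈ → all-true⁺ _ (range 1 L) λ j j∈ →
      pair-condition i j (∈-range⁻ 1 L i∈) (∈-range⁻ 1 L j∈)
      where
      pair-condition : ∀ i j → 1 ≤ i × i ≤ L → 1 ≤ j × j ≤ L →
        (if (i <ᵇ j) ∧ (at σ (i ∸ 1) ≡ᵇ at σ (j ∸ 1))
          then all (λ s → at σ (i ∸ 1) <ᵇ at σ (s ∸ 1)) (range (suc i) (j ∸ 1)) else true) ≡ true
      pair-condition i j (1≤i , i≤L) (1≤j , j≤L) with (i <ᵇ j) ∧ (at σ (i ∸ 1) ≡ᵇ at σ (j ∸ 1)) in eq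
      ... | false = refl
      ... | true  = all-true⁺ _ (range (suc i) (j ∸ 1)) λ s s∈ → let i<s , s≤ = ∈-range⁻ (suc i) (j ∸ 1) s∈ in
        stirling-pair i j 1≤i i≤L 1≤j (<ᵇ-true⇒< i j (proj₁ i<j∧equal)) σj≡σi s i<s s≤
        where
        i<j∧equal = ∧-true⁻ (i <ᵇ j) _ eq
        σj≡σi : σ[ σ ] j ≡ σ[ σ ] i
        σj≡σi = trans (σ[]≡at-pred σ j 1≤j) (sym (trans (σ[]≡at-pred σ i 1≤i) (≡ᵇ-true⇒≡ _ _ (proj₂ i<j∧equal))))

    isStirling⇒∈Stirling : σ ∈ Stirling n
    isStirling⇒∈Stirling = ∈-bfilter⁺ _
      (∈-words⁺ n (2 * n) σ length≡ (All-at⁺ _ σ (λ k k< →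
        subst (λ a → 1 ≤ a × a ≤ n) (σ[]-suc σ k) (positive (suc k) (s≤s z≤n) k< , bounded (suc k)))))
      (∧-true⁺ isStirling⇒isMultisetPerm isStirling⇒stirlingCond)

  ∈Stirling⇒isStirling : ∀ n σ → σ ∈ Stirling n → IsStirling n σ
  ∈Stirling⇒isStirling n σ σ∈ = record
    { length≡ = proj₁ word ; bounded = bounded ; positive = positive ; occurrences = occurrences }
    where
    filtered = ∈-bfilter⁻ _ (words n (2 * n)) σ∈
    conditions = ∧-true⁻ (isMultisetPerm n σ) (stirlingCond σ) (proj₂ filtered)
    word = ∈-words⁻ n (2 * n) (proj₁ filtered)
    L = length σ

    letter : ∀ k → k < L → 1 ≤ at σ k × at σ k ≤ n
    letter = All-at⁻ _ σ (proj₂ word)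

    bounded : ∀ k → σ[ σ ] k ≤ n
    bounded zero = z≤n
    bounded (suc k) with k ℕ.<? L
    ... | yes k<L = subst (_≤ n) (sym (σ[]-suc σ k)) (proj₂ (letter k k<L))
    ... | no  k≮L = subst (_≤ n) (sym (σ[]-beyond σ (suc k) (s≤s (ℕₚ.≮⇒≥ k≮L)))) z≤n

    positive : ∀ k → 1 ≤ k → k ≤ L → 1 ≤ σ[ σ ] k
    positive (suc k) _ k<L = subst (1 ≤_) (sym (σ[]-suc σ k)) (proj₁ (letter k k<L))

    occurrences : ∀ v → 1 ≤ v → v ≤ n → Occurrences σ v
    occurrences v 1≤v v≤n = fromPositions (occPos σ v) refl twice
      where
      at-v : ℕ → Bool
      at-v k = σ[ σ ] k ≡ᵇ v
      twice : length (occPos σ v) ≡ 2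
      twice = trans (sym (occ≡length-occPos v σ))
                    (≡ᵇ-true⇒≡ _ 2 (all-true⁻ _ (range 1 n) (proj₁ conditions) v (∈-range⁺ 1 n v 1≤v v≤n)))
      fromPositions : ∀ ps → occPos σ v ≡ ps → length ps ≡ 2 → Occurrences σ v
      fromPositions (p ∷ q ∷ []) occPos≡ _ = record
        { i = p ; j = q ; 1≤i = proj₁ p-range ; i<j = p<q ; j≤length = ℕₚ.≤-pred (proj₂ q-range)
        ; σi≡v = ≡ᵇ-true⇒≡ _ v (proj₂ p∈) ; σj≡v = ≡ᵇ-true⇒≡ _ v (proj₂ q∈) ; only = only ; between = between }
        where
        p∈ = ∈-bfilter⁻ at-v (positions σ) (subst (p ∈_) (sym occPos≡) (here refl))
        q∈ = ∈-bfilter⁻ at-v (positions σ) (subst (q ∈_) (sym occPos≡) (there (here refl)))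
        p-range = ∈-seq⁻ 1 L (subst (p ∈_) (positions≡seq σ) (proj₁ p∈))
        q-range = ∈-seq⁻ 1 L (subst (q ∈_) (positions≡seq σ) (proj₁ q∈))
        p<q : p < q
        p<q = All.lookup (bfilter-seq-sorted at-v 1 L (trans (sym (cong (bfilter at-v) (positions≡seq σ))) occPos≡)) (here refl)
        1≤q = ℕₚ.≤-trans (proj₁ p-range) (ℕₚ.<⇒≤ p<q)

        only : ∀ k → σ[ σ ] k ≡ v → k ≡ p ⊎ k ≡ q
        only zero σ0≡v = ⊥-elim (ℕₚ.<-irrefl σ0≡v 1≤v)
        only (suc k) σk≡v with suc k ℕ.≤? L
        ... | no  k≰L = ⊥-elim (ℕₚ.<-irrefl (trans (sym (σ[]-beyond σ (suc k) (ℕₚ.≰⇒> k≰L))) σk≡v) 1≤v)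
        ... | yes k≤L with subst (suc k ∈_) occPos≡ (∈-bfilter⁺ at-v
                             (subst (suc k ∈_) (sym (positions≡seq σ)) (∈-seq⁺ 1 L (suc k) (s≤s z≤n) (s≤s k≤L)))
                             (≡⇒≡ᵇ-true σk≡v))
        ...   | here k≡p         = inj₁ k≡p
        ...   | there (here k≡q) = inj₂ k≡q

        between : ∀ k → p < k → k < q → v < σ[ σ ] k
        between k p<k k<q =
          subst₂ _<_ (trans (sym (σ[]≡at-pred σ p (proj₁ p-range))) (≡ᵇ-true⇒≡ _ v (proj₂ p∈)))
                     (sym (σ[]≡at-pred σ k (ℕₚ.≤-trans (s≤s z≤n) p<k)))
            (<ᵇ-true⇒< _ _ (all-true⁻ _ (range (suc p) (q ∸ 1)) increasing k
              (∈-range⁺ (suc p) (q ∸ 1) k p<k (ℕₚ.≤-pred (subst (suc k ≤_) (sym 1+[q-1]≡q) k<q)))))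
          where
          1+[q-1]≡q : suc (q ∸ 1) ≡ q
          1+[q-1]≡q = ℕₚ.m+[n∸m]≡n {1} {q} 1≤q
          at-p≡at-q : (at σ (p ∸ 1) ≡ᵇ at σ (q ∸ 1)) ≡ true
          at-p≡at-q = ≡⇒≡ᵇ-true (trans (sym (σ[]≡at-pred σ p (proj₁ p-range)))
                        (trans (≡ᵇ-true⇒≡ _ v (proj₂ p∈)) (sym (trans (sym (σ[]≡at-pred σ q 1≤q)) (≡ᵇ-true⇒≡ _ v (proj₂ q∈))))))
          pair-condition = all-true⁻ _ (range 1 L)
            (all-true⁻ _ (range 1 L) (proj₂ conditions) p (∈-range⁺ 1 L p (proj₁ p-range) (ℕₚ.≤-pred (proj₂ p-range))))
            q (∈-range⁺ 1 L q 1≤q (ℕₚ.≤-pred (proj₂ q-range)))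
          increasing : all (λ s → at σ (p ∸ 1) <ᵇ at σ (s ∸ 1)) (range (suc p) (q ∸ 1)) ≡ true
          increasing = if-true⇒then (∧-true⁺ (<⇒<ᵇ-true p<q) at-p≡at-q) pair-condition

  module RemovePair (n : ℕ) (τ : List ℕ) (g : ℕ) (g≤length : g ≤ length τ)
                    (S : IsStirling (suc n) (insertPair (suc n) τ g)) where
    private
      N = suc n
      σ = insertPair N τ g
      module S = IsStirling S

      σ-shift : ∀ k → σ[ σ ] (shift g k) ≡ σ[ τ ] k
      σ-shift k = insertPair-shift N τ g k g≤length

      length-σ : length σ ≡ suc (suc (length τ))
      length-σ = length-insertPair N τ g g≤length

      σ≢N : ∀ k → ¬ σ[ τ ] k ≡ N
      σ≢N k σk≡N = not-N (Occurrences.only O (shift g k) (trans (σ-shift k) σk≡N))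
        where
        O = S.occurrences N (s≤s z≤n) ℕₚ.≤-refl
        open Occurrences O
        first-is  = only (suc g) (insertPair-first N τ g g≤length)
        second-is = only (suc (suc g)) (insertPair-second N τ g g≤length)
        not-inserted : ∀ {x} → x ≡ suc g ⊎ x ≡ suc (suc g) → ¬ shift g k ≡ x
        not-inserted (inj₁ refl) = shift-≢-first g k
        not-inserted (inj₂ refl) = shift-≢-second g k
        not-N : ¬ (shift g k ≡ i ⊎ shift g k ≡ j)
        not-N (inj₁ sk≡i) with first-is | second-is
        ... | inj₁ e | _      = not-inserted (inj₁ (sym e)) sk≡i
        ... | inj₂ e | inj₁ e′ = not-inserted (inj₂ (sym e′)) sk≡i
        ... | inj₂ e | inj₂ e′ = ℕₚ.<-irrefl (trans e (sym e′)) (ℕₚ.n<1+n (suc g))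
        not-N (inj₂ sk≡j) with first-is | second-is
        ... | _      | inj₂ e′ = not-inserted (inj₂ (sym e′)) sk≡j
        ... | inj₂ e | inj₁ e′ = not-inserted (inj₁ (sym e)) sk≡j
        ... | inj₁ e | inj₁ e′ = ℕₚ.<-irrefl (trans e (sym e′)) (ℕₚ.n<1+n (suc g))

      occurrences : ∀ v → 1 ≤ v → v ≤ n → Occurrences τ v
      occurrences v 1≤v v≤n = record
        { i        = i′
        ; j        = j′
        ; 1≤i      = positive-preimage i′ (subst (1 ≤_) (sym shift-i′) O.1≤i)
        ; i<j      = shift-cancel-< g (subst₂ _<_ (sym shift-i′) (sym shift-j′) O.i<j)
        ; j≤length = j′≤length
        ; σi≡v     = trans (sym (σ-shift i′)) (trans (cong (σ[ σ ]_) shift-i′) O.σi≡v)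
        ; σj≡v     = trans (sym (σ-shift j′)) (trans (cong (σ[ σ ]_) shift-j′) O.σj≡v)
        ; only     = λ k σk≡v → preimage k (O.only (shift g k) (trans (σ-shift k) σk≡v))
        ; between  = λ k i′<k k<j′ → subst (v <_) (σ-shift k)
                       (O.between (shift g k) (subst (_< shift g k) shift-i′ (shift-mono g i′<k))
                                              (subst (shift g k <_) shift-j′ (shift-mono g k<j′)))
        }
        where
        module O = Occurrences (S.occurrences v 1≤v (ℕₚ.m≤n⇒m≤1+n v≤n))
        v≢N : ¬ v ≡ N
        v≢N e = ℕₚ.<-irrefl e (s≤s v≤n)
        not-inserted : ∀ k → σ[ σ ] k ≡ v → ¬ k ≡ suc g × ¬ k ≡ suc (suc g)
        not-inserted k σk≡v = (λ { refl → v≢N (trans (sym σk≡v) (insertPair-first N τ g g≤length)) })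
                            , (λ { refl → v≢N (trans (sym σk≡v) (insertPair-second N τ g g≤length)) })
        i-preimage = shift-surjective g O.i (proj₁ (not-inserted O.i O.σi≡v)) (proj₂ (not-inserted O.i O.σi≡v))
        j-preimage = shift-surjective g O.j (proj₁ (not-inserted O.j O.σj≡v)) (proj₂ (not-inserted O.j O.σj≡v))
        i′ = proj₁ i-preimage
        j′ = proj₁ j-preimage
        shift-i′ : shift g i′ ≡ O.i
        shift-i′ = proj₂ i-preimage
        shift-j′ : shift g j′ ≡ O.j
        shift-j′ = proj₂ j-preimage
        positive-preimage : ∀ k → 1 ≤ shift g k → 1 ≤ k
        positive-preimage zero    h = ⊥-elim (ℕₚ.<-irrefl (sym (shift-below g 0 z≤n)) h)
        positive-preimage (suc k) _ = s≤s z≤n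
        j′≤length : j′ ≤ length τ
        j′≤length with ℕₚ.≤-<-connex j′ g
        ... | inj₁ j′≤g = ℕₚ.≤-trans j′≤g g≤length
        ... | inj₂ g<j′ = ℕₚ.≤-pred (ℕₚ.≤-pred (subst (_≤ suc (suc (length τ))) (trans (sym shift-j′) (shift-above g j′ g<j′))
                                                      (subst (O.j ≤_) length-σ O.j≤length)))
        preimage : ∀ k → shift g k ≡ O.i ⊎ shift g k ≡ O.j → k ≡ i′ ⊎ k ≡ j′
        preimage k (inj₁ e) = inj₁ (shift-injective g (trans e (sym shift-i′)))
        preimage k (inj₂ e) = inj₂ (shift-injective g (trans e (sym shift-j′)))

    isStirling : IsStirling n τ
    isStirling = record
      { length≡     = ℕₚ.suc-injective (ℕₚ.suc-injective (trans (sym length-σ) (trans S.length≡ (sym (2+2*n≡2*[1+n] n)))))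
      ; bounded     = λ k → ℕₚ.≤-pred (ℕₚ.≤∧≢⇒< (subst (_≤ N) (σ-shift k) (S.bounded (shift g k))) (σ≢N k))
      ; positive    = λ k 1≤k k≤ → subst (1 ≤_) (σ-shift k) (S.positive (shift g k) (ℕₚ.≤-trans 1≤k (shift-inflationary g k))
                         (ℕₚ.≤-trans (shift-≤-2+ g k) (subst (suc (suc k) ≤_) (sym length-σ) (s≤s (s≤s k≤)))))
      ; occurrences = occurrences
      }

  removeAt² : List ℕ → ℕ → List ℕ
  removeAt² []      g       = []
  removeAt² (a ∷ w) zero    = drop 1 w
  removeAt² (a ∷ w) (suc g) = a ∷ removeAt² w g

  insertPair-removeAt² : ∀ N w g → at w g ≡ N → at w (suc g) ≡ N → suc (suc g) ≤ length w → insertPair N (removeAt² w g) g ≡ w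
  insertPair-removeAt² N (a ∷ b ∷ w) zero    refl refl _        = refl
  insertPair-removeAt² N (a ∷ w)     (suc g) e₁   e₂   (s≤s g≤) = cong (a ∷_) (insertPair-removeAt² N w g e₁ e₂ g≤)

  length-removeAt² : ∀ w g → suc (suc g) ≤ length w → suc (suc (length (removeAt² w g))) ≡ length w
  length-removeAt² (a ∷ b ∷ w) zero    _        = refl
  length-removeAt² (a ∷ w)     (suc g) (s≤s g≤) = cong suc (length-removeAt² w g g≤)

  isStirling⇒∈byInsertion : ∀ n σ → IsStirling n σ → σ ∈ byInsertion n
  isStirling⇒∈byInsertion zero    []      S = here refl
  isStirling⇒∈byInsertion zero    (a ∷ σ) S with () ← IsStirling.length≡ S
  isStirling⇒∈byInsertion (suc n) σ       S = subst (_∈ byInsertion (suc n)) σ≡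
    (∈-concatMap⁺′ (λ τ′ → map (insertPair N τ′) (seq 0 (suc (2 * n)))) (isStirling⇒∈byInsertion n τ τ-isStirling)
      (∈-map⁺ (insertPair N τ) (∈-seq⁺ 0 (suc (2 * n)) g z≤n (s≤s (subst (g ≤_) (IsStirling.length≡ τ-isStirling) g≤length)))))
    where
    open IsStirling S
    N = suc n
    open Occurrences (occurrences N (s≤s z≤n) ℕₚ.≤-refl)
    -- Nothing exceeds the maximum N, so its two occurrences are adjacent.
    j≡1+i : j ≡ suc i
    j≡1+i with suc i ℕ.≟ j
    ... | yes e   = sym e
    ... | no  i+1≢j = ⊥-elim (ℕₚ.<⇒≱ (between (suc i) ℕₚ.≤-refl (ℕₚ.≤∧≢⇒< i<j i+1≢j)) (bounded (suc i)))
    g = i ∸ 1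
    1+g≡i : suc g ≡ i
    1+g≡i = ℕₚ.m+[n∸m]≡n {1} {i} 1≤i
    at-g : at σ g ≡ N
    at-g = trans (sym (σ[]-suc σ g)) (trans (cong (σ[ σ ]_) 1+g≡i) σi≡v)
    at-1+g : at σ (suc g) ≡ N
    at-1+g = trans (sym (σ[]-suc σ (suc g))) (trans (cong (λ k → σ[ σ ] (suc k)) 1+g≡i) (trans (cong (σ[ σ ]_) (sym j≡1+i)) σj≡v))
    2+g≤length : suc (suc g) ≤ length σ
    2+g≤length = subst (_≤ length σ) (trans j≡1+i (cong suc (sym 1+g≡i))) j≤length
    τ = removeAt² σ g
    σ≡ : insertPair N τ g ≡ σ
    σ≡ = insertPair-removeAt² N σ g at-g at-1+g 2+g≤length
    g≤length : g ≤ length τ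
    g≤length = ℕₚ.≤-pred (ℕₚ.≤-pred (subst (suc (suc g) ≤_) (sym (length-removeAt² σ g 2+g≤length)) 2+g≤length))
    τ-isStirling : IsStirling n τ
    τ-isStirling = RemovePair.isStirling n τ g g≤length (subst (IsStirling N) (sym σ≡) S)

  firstIndexOf : ℕ → List ℕ → ℕ
  firstIndexOf N []      = 0
  firstIndexOf N (a ∷ w) = if a ≡ᵇ N then 0 else suc (firstIndexOf N w)

  removeAll : ℕ → List ℕ → List ℕ
  removeAll N = bfilter (λ a → not (a ≡ᵇ N))

  firstIndexOf-insertPair : ∀ N τ g → All (_< N) τ → g ≤ length τ → firstIndexOf N (insertPair N τ g) ≡ g
  firstIndexOf-insertPair N τ       zero    _          _        rewrite ≡ᵇ-refl N = refl
  firstIndexOf-insertPair N (a ∷ τ) (suc g) (a<N ∷ τ<N) (s≤s g≤) rewrite ≢⇒≡ᵇ-false a N (λ e → ℕₚ.<-irrefl e a<N) =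
    cong suc (firstIndexOf-insertPair N τ g τ<N g≤)

  removeAll-absent : ∀ N τ → All (_< N) τ → removeAll N τ ≡ τ
  removeAll-absent N []      _           = refl
  removeAll-absent N (a ∷ τ) (a<N ∷ τ<N) rewrite ≢⇒≡ᵇ-false a N (λ e → ℕₚ.<-irrefl e a<N) = cong (a ∷_) (removeAll-absent N τ τ<N)

  removeAll-insertPair : ∀ N τ g → All (_< N) τ → removeAll N (insertPair N τ g) ≡ τ
  removeAll-insertPair N τ       zero    τ<N rewrite ≡ᵇ-refl N = removeAll-absent N τ τ<N
  removeAll-insertPair N []      (suc g) _   rewrite ≡ᵇ-refl N = refl
  removeAll-insertPair N (a ∷ τ) (suc g) (a<N ∷ τ<N) rewrite ≢⇒≡ᵇ-false a N (λ e → ℕₚ.<-irrefl e a<N) =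
    cong (a ∷_) (removeAll-insertPair N τ g τ<N)

  isStirling⇒All< : ∀ n τ → IsStirling n τ → All (_< suc n) τ
  isStirling⇒All< n τ S = All-at⁺ _ τ (λ k _ → s≤s (subst (_≤ n) (σ[]-suc τ k) (IsStirling.bounded S (suc k))))

  byInsertion-unique : ∀ n → Unique (byInsertion n)
  byInsertion-unique zero    = [] ∷ []
  byInsertion-unique (suc n) = concatMap-unique _ (byInsertion n) (byInsertion-unique n)
    (λ τ τ∈ → map-unique (insertPair N τ) (λ g g′ g∈ g′∈ e → gap-injective τ τ∈ g g′ g∈ g′∈ e) (seq-unique 0 _))
    disjoint
    where
    N = suc n
    gaps = seq 0 (suc (2 * n))
    smaller : ∀ τ → τ ∈ byInsertion n → All (_< N) τ
    smaller τ τ∈ = isStirling⇒All< n τ (byInsertion⇒isStirling n τ τ∈)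
    gap-injective : ∀ τ → τ ∈ byInsertion n → ∀ g g′ → g ∈ gaps → g′ ∈ gaps →
                    insertPair N τ g ≡ insertPair N τ g′ → g ≡ g′
    gap-injective τ τ∈ g g′ g∈ g′∈ e =
      trans (sym (firstIndexOf-insertPair N τ g (smaller τ τ∈) (in-τ g∈)))
            (trans (cong (firstIndexOf N) e) (firstIndexOf-insertPair N τ g′ (smaller τ τ∈) (in-τ g′∈)))
      where
      in-τ : ∀ {x} → x ∈ gaps → x ≤ length τ
      in-τ x∈ = subst (_ ≤_) (sym (IsStirling.length≡ (byInsertion⇒isStirling n τ τ∈))) (ℕₚ.≤-pred (proj₂ (∈-seq⁻ 0 _ x∈)))
    disjoint : ∀ τ τ′ → τ ∈ byInsertion n → τ′ ∈ byInsertion n → ¬ τ ≡ τ′ →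
               ∀ {σ} → σ ∈ map (insertPair N τ) gaps → σ ∈ map (insertPair N τ′) gaps → ⊥
    disjoint τ τ′ τ∈ τ′∈ τ≢τ′ σ∈ σ∈′
      with ∈-map⁻ (insertPair N τ) {xs = gaps} σ∈ | ∈-map⁻ (insertPair N τ′) {xs = gaps} σ∈′
    ... | g , _ , refl | g′ , _ , e =
      τ≢τ′ (trans (sym (removeAll-insertPair N τ g (smaller τ τ∈)))
                  (trans (cong (removeAll N) e) (removeAll-insertPair N τ′ g′ (smaller τ′ τ′∈))))

  Stirling↭byInsertion : ∀ n → Stirling n ↭ byInsertion n
  Stirling↭byInsertion n = ∼bag⇒↭ (unique∧set⇒bag (Stirling-unique n) (byInsertion-unique n)
    (λ {σ} → mk⇔ (λ σ∈ → isStirling⇒∈byInsertion n σ (∈Stirling⇒isStirling n σ σ∈))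
                 (λ σ∈ → isStirling⇒∈Stirling (byInsertion⇒isStirling n σ σ∈))))

module Coefficients where

  open Preliminaries
  open CommutativeSemirings
  open DerivationPolynomials using (Term; ∂₁; ∂₂; ∂₃; ∂-term; expansion)
  open import Defs using (range; triples; γ; pred?)
  open import Data.Nat using (ℕ; zero; suc; _+_; _*_; _≡ᵇ_; _≤_; z≤n)
  import Data.Nat.Properties as ℕₚ
  open import Data.Nat.Tactic.RingSolver using (solve-∀)
  open import Data.Bool using (Bool; true; false; if_then_else_; _∧_)
  import Data.Bool.Properties as Boolₚ
  open import Data.List using (List; []; _∷_; concatMap)
  open import Data.List.Membership.Propositional using (_∈_)
  open import Data.List.Membership.Propositional.Properties using (∈-++⁻)
  open import Data.List.Relation.Unary.Any using (here)
  open import Data.List.Relation.Unary.Unique.Propositional using (Unique; []; _∷_)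
  import Data.List.Relation.Unary.All as All
  open import Data.Product using (_×_; _,_; proj₁; proj₂)
  open import Data.Sum using (inj₁; inj₂)
  open import Relation.Binary.PropositionalEquality

  Triple : Set
  Triple = ℕ × ℕ × ℕ

  private
    solutionsK : ℕ → ℕ → ℕ → ℕ → List Triple
    solutionsK N i j k = if (i + 2 * j + 3 * k) ≡ᵇ N then (i , j , k) ∷ [] else []

    solutionsJ : ℕ → ℕ → ℕ → List Triple
    solutionsJ N i j = concatMap (solutionsK N i j) (range 0 N)

    solutionsI : ℕ → ℕ → List Triple
    solutionsI N i = concatMap (solutionsJ N i) (range 0 N)

    ∈-solutionsK : ∀ N i j k {t} → t ∈ solutionsK N i j k → t ≡ (i , j , k)
    ∈-solutionsK N i j k t∈ with (i + 2 * j + 3 * k) ≡ᵇ N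
    ∈-solutionsK N i j k (here refl) | true = refl

    ∈-solutionsJ : ∀ N i j {t} → t ∈ solutionsJ N i j → proj₁ t ≡ i × proj₁ (proj₂ t) ≡ j
    ∈-solutionsJ N i j t∈ with ∈-concatMap⁻′ (solutionsK N i j) (range 0 N) t∈
    ... | k , _ , t∈′ with ∈-solutionsK N i j k t∈′
    ... | refl = refl , refl

    ∈-solutionsI : ∀ N i {t} → t ∈ solutionsI N i → proj₁ t ≡ i
    ∈-solutionsI N i t∈ with ∈-concatMap⁻′ (solutionsJ N i) (range 0 N) t∈
    ... | j , _ , t∈′ = proj₁ (∈-solutionsJ N i j t∈′)

    solutionsK-unique : ∀ N i j k → Unique (solutionsK N i j k)
    solutionsK-unique N i j k with (i + 2 * j + 3 * k) ≡ᵇ N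
    ... | true  = All.[] ∷ []
    ... | false = []

  triples-unique : ∀ N → Unique (triples N)
  triples-unique N = concatMap-unique (solutionsI N) (range 0 N) (range-unique 0 N)
    (λ i _ → concatMap-unique (solutionsJ N i) (range 0 N) (range-unique 0 N)
       (λ j _ → concatMap-unique (solutionsK N i j) (range 0 N) (range-unique 0 N) (λ k _ → solutionsK-unique N i j k)
          (λ a b _ _ a≢b t∈a t∈b → a≢b (cong (λ t → proj₂ (proj₂ t)) (trans (sym (∈-solutionsK N i j a t∈a)) (∈-solutionsK N i j b t∈b)))))
       (λ a b _ _ a≢b t∈a t∈b → a≢b (trans (sym (proj₂ (∈-solutionsJ N i a t∈a))) (proj₂ (∈-solutionsJ N i b t∈b)))))
    (λ a b _ _ a≢b t∈a t∈b → a≢b (trans (sym (∈-solutionsI N a t∈a)) (∈-solutionsI N b t∈b)))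

  ∈-triples⁺ : ∀ N i j k → i + 2 * j + 3 * k ≡ N → (i , j , k) ∈ triples N
  ∈-triples⁺ N i j k e =
    ∈-concatMap⁺′ (solutionsI N) (∈-range⁺ 0 N i z≤n i≤N)
      (∈-concatMap⁺′ (solutionsJ N i) (∈-range⁺ 0 N j z≤n j≤N)
        (∈-concatMap⁺′ (solutionsK N i j) (∈-range⁺ 0 N k z≤n k≤N) solution))
    where
    solution : (i , j , k) ∈ solutionsK N i j k
    solution rewrite ≡⇒≡ᵇ-true e = here refl
    i≤N : i ≤ N
    i≤N = subst (i ≤_) e (ℕₚ.≤-trans (ℕₚ.m≤m+n i (2 * j)) (ℕₚ.m≤m+n (i + 2 * j) (3 * k)))
    j≤N : j ≤ N
    j≤N = subst (j ≤_) e (ℕₚ.≤-trans (ℕₚ.≤-trans (ℕₚ.m≤m+n j (j + 0)) (ℕₚ.m≤n+m (2 * j) i)) (ℕₚ.m≤m+n (i + 2 * j) (3 * k)))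
    k≤N : k ≤ N
    k≤N = subst (k ≤_) e (ℕₚ.≤-trans (ℕₚ.m≤m+n k (k + (k + 0))) (ℕₚ.m≤n+m (3 * k) (i + 2 * j)))

  exponents : Term → Triple
  exponents (c , i , j , k , m) = (i , j , k)

  coefficient : Term → ℕ
  coefficient (c , i , j , k , m) = c

  -- Each derivation step raises the total degree by one and the weighted degree i + 2j + 3k by two.
  Degrees : ℕ → Term → Set
  Degrees n (c , i , j , k , m) = i + j + k + m ≡ suc n × i + 2 * j + 3 * k ≡ 2 * suc n + 1

  expansion-degrees : ∀ n t → t ∈ expansion n → Degrees n t
  expansion-degrees zero    t (here refl) = refl , refl
  expansion-degrees (suc n) t t∈ with ∈-concatMap⁻′ ∂-term (expansion n) t∈
  ... | t′ , t′∈ , t∈∂ = step t′ (expansion-degrees n t′ t′∈) t t∈∂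
    where
    weighted-step : ∀ n → 2 + (2 * suc n + 1) ≡ 2 * suc (suc n) + 1
    weighted-step = solve-∀
    step : ∀ t′ → Degrees n t′ → ∀ t → t ∈ ∂-term t′ → Degrees (suc n) t
    step (c , i , j , k , m) (d , w) t t∈ with ∈-++⁻ (∂₁ (c , i , j , k , m)) t∈
    step (c , suc i , j , k , m) (d , w) t t∈ | inj₁ (here refl) =
      trans (degree i j k m) (cong suc d) , trans (weighted i j k) (trans (cong (2 +_) w) (weighted-step n))
      where
      degree : ∀ i j k m → i + j + suc k + suc m ≡ suc (suc i + j + k + m)
      degree = solve-∀
      weighted : ∀ i j k → i + 2 * j + 3 * suc k ≡ 2 + (suc i + 2 * j + 3 * k)
      weighted = solve-∀
    ... | inj₂ t∈′ with ∈-++⁻ (∂₂ (c , i , j , k , m)) t∈′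
    step (c , i , suc j , k , m) (d , w) t t∈ | inj₂ t∈′ | inj₁ (here refl) =
      trans (degree i j k m) (cong suc d) , trans (weighted i j k) (trans (cong (2 +_) w) (weighted-step n))
      where
      degree : ∀ i j k m → suc i + j + suc k + m ≡ suc (i + suc j + k + m)
      degree = solve-∀
      weighted : ∀ i j k → suc i + 2 * j + 3 * suc k ≡ 2 + (i + 2 * suc j + 3 * k)
      weighted = solve-∀
    step (c , i , j , suc k , m) (d , w) t t∈ | inj₂ t∈′ | inj₂ (here refl) =
      trans (degree i j k m) (cong suc d) , trans (weighted i j k) (trans (cong (2 +_) w) (weighted-step n))
      where
      degree : ∀ i j k m → i + suc j + suc k + m ≡ suc (i + j + suc k + m)
      degree = solve-∀
      weighted : ∀ i j k → i + 2 * suc j + 3 * suc k ≡ 2 + (i + 2 * j + 3 * suc k)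
      weighted = solve-∀

  _≡ᵗ_ : Triple → Triple → Bool
  (a , b , c) ≡ᵗ (i , j , k) = (a ≡ᵇ i) ∧ ((b ≡ᵇ j) ∧ (c ≡ᵇ k))

  ≡ᵗ⇒≡ : ∀ e f → (e ≡ᵗ f) ≡ true → e ≡ f
  ≡ᵗ⇒≡ (a , b , c) (i , j , k) eq with a ≡ᵇ i in e₁ | b ≡ᵇ j in e₂ | c ≡ᵇ k in e₃
  ... | true | true | true rewrite ≡ᵇ-true⇒≡ a i e₁ | ≡ᵇ-true⇒≡ b j e₂ | ≡ᵇ-true⇒≡ c k e₃ = refl

  ≡ᵗ-refl : ∀ e → (e ≡ᵗ e) ≡ true
  ≡ᵗ-refl (a , b , c) rewrite ≡ᵇ-refl a | ≡ᵇ-refl b | ≡ᵇ-refl c = refl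

  coefficientIn : List Term → Triple → ℕ
  coefficientIn ts e = ∑ℕ ts (λ t → if exponents t ≡ᵗ e then coefficient t else 0)

  private
    module ℕΣ = SemiringSums ℕ-semiring

    zero-contributions : ∀ ts (contribution : Term → ℕ) → (∀ t → contribution t ≡ 0) → ∑ℕ ts contribution ≡ 0
    zero-contributions ts contribution h = ℕΣ.∑-zero ts contribution (λ t _ → h t)

    scaled-contributions : ∀ ts a e (contribution : Term → ℕ) →
      (∀ t → contribution t ≡ a * (if exponents t ≡ᵗ e then coefficient t else 0)) →
      ∑ℕ ts contribution ≡ a * coefficientIn ts e
    scaled-contributions ts a e contribution h = trans (ℕΣ.∑-cong ts (λ t _ → h t)) (sym (ℕΣ.*-distribˡ-∑ ts a _))

    ∧-false-right : ∀ a b → a ∧ (b ∧ false) ≡ false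
    ∧-false-right a b rewrite Boolₚ.∧-zeroʳ b = Boolₚ.∧-zeroʳ a

  ∂₁-contribution : ∀ ts i j k → ∑ℕ ts (λ t → coefficientIn (∂₁ t) (i , j , k))
                               ≡ pred? (λ k′ → 3 * (i + 1) * coefficientIn ts (suc i , j , k′)) k
  ∂₁-contribution ts i j zero = zero-contributions ts _ none
    where
    none : ∀ t → coefficientIn (∂₁ t) (i , j , 0) ≡ 0
    none (c , zero  , b , d , m) = refl
    none (c , suc a , b , d , m) rewrite ∧-false-right (a ≡ᵇ i) (b ≡ᵇ j) = refl
  ∂₁-contribution ts i j (suc k) = scaled-contributions ts (3 * (i + 1)) (suc i , j , k) _ term
    where
    term : ∀ t → coefficientIn (∂₁ t) (i , j , suc k) ≡ 3 * (i + 1) * (if exponents t ≡ᵗ (suc i , j , k) then coefficient t else 0)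
    term (c , zero  , b , d , m) = sym (ℕₚ.*-zeroʳ (3 * (i + 1)))
    term (c , suc a , b , d , m) with (a ≡ᵇ i) ∧ ((b ≡ᵇ j) ∧ (d ≡ᵇ k)) in eq
    ... | false = sym (ℕₚ.*-zeroʳ (3 * (i + 1)))
    ... | true with ≡ᵇ-true⇒≡ a i (proj₁ (∧-true⁻ (a ≡ᵇ i) _ eq))
    ...   | refl = trans (ℕₚ.+-identityʳ _) (cong (λ a′ → 3 * a′ * c) (ℕₚ.+-comm 1 a))

  ∂₂-contribution : ∀ ts i j k → ∑ℕ ts (λ t → coefficientIn (∂₂ t) (i , j , k))
                               ≡ pred? (λ i′ → pred? (λ k′ → 2 * (j + 1) * coefficientIn ts (i′ , suc j , k′)) k) i
  ∂₂-contribution ts zero j k = zero-contributions ts _ none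
    where
    none : ∀ t → coefficientIn (∂₂ t) (0 , j , k) ≡ 0
    none (c , a , zero  , d , m) = refl
    none (c , a , suc b , d , m) = refl
  ∂₂-contribution ts (suc i) j zero = zero-contributions ts _ none
    where
    none : ∀ t → coefficientIn (∂₂ t) (suc i , j , 0) ≡ 0
    none (c , a , zero  , d , m) = refl
    none (c , a , suc b , d , m) rewrite ∧-false-right (a ≡ᵇ i) (b ≡ᵇ j) = refl
  ∂₂-contribution ts (suc i) j (suc k) = scaled-contributions ts (2 * (j + 1)) (i , suc j , k) _ term
    where
    term : ∀ t → coefficientIn (∂₂ t) (suc i , j , suc k) ≡ 2 * (j + 1) * (if exponents t ≡ᵗ (i , suc j , k) then coefficient t else 0)
    term (c , a , zero  , d , m) rewrite Boolₚ.∧-zeroʳ (a ≡ᵇ i) = sym (ℕₚ.*-zeroʳ (2 * (j + 1)))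
    term (c , a , suc b , d , m) with (a ≡ᵇ i) ∧ ((b ≡ᵇ j) ∧ (d ≡ᵇ k)) in eq
    ... | false = sym (ℕₚ.*-zeroʳ (2 * (j + 1)))
    ... | true with ≡ᵇ-true⇒≡ b j (proj₁ (∧-true⁻ (b ≡ᵇ j) (d ≡ᵇ k) (proj₂ (∧-true⁻ (a ≡ᵇ i) _ eq))))
    ...   | refl = trans (ℕₚ.+-identityʳ _) (cong (λ b′ → 2 * b′ * c) (ℕₚ.+-comm 1 b))

  ∂₃-contribution : ∀ ts i j k → ∑ℕ ts (λ t → coefficientIn (∂₃ t) (i , j , k))
                               ≡ pred? (λ j′ → k * coefficientIn ts (i , j′ , k)) j
  ∂₃-contribution ts i zero k = zero-contributions ts _ none
    where
    none : ∀ t → coefficientIn (∂₃ t) (i , 0 , k) ≡ 0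
    none (c , a , b , zero  , m) = refl
    none (c , a , b , suc d , m) rewrite Boolₚ.∧-zeroʳ (a ≡ᵇ i) = refl
  ∂₃-contribution ts i (suc j) k = scaled-contributions ts k (i , j , k) _ term
    where
    term : ∀ t → coefficientIn (∂₃ t) (i , suc j , k) ≡ k * (if exponents t ≡ᵗ (i , j , k) then coefficient t else 0)
    term (c , a , b , zero  , m) with (a ≡ᵇ i) ∧ ((b ≡ᵇ j) ∧ (0 ≡ᵇ k)) in eq
    ... | false = sym (ℕₚ.*-zeroʳ k)
    ... | true with ≡ᵇ-true⇒≡ 0 k (proj₂ (∧-true⁻ (b ≡ᵇ j) (0 ≡ᵇ k) (proj₂ (∧-true⁻ (a ≡ᵇ i) _ eq))))
    ...   | refl = refl
    term (c , a , b , suc d , m) with (a ≡ᵇ i) ∧ ((b ≡ᵇ j) ∧ (suc d ≡ᵇ k)) in eq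
    ... | false = sym (ℕₚ.*-zeroʳ k)
    ... | true with ≡ᵇ-true⇒≡ (suc d) k (proj₂ (∧-true⁻ (b ≡ᵇ j) (suc d ≡ᵇ k) (proj₂ (∧-true⁻ (a ≡ᵇ i) _ eq))))
    ...   | refl = ℕₚ.+-identityʳ _

  coefficientIn-∂ : ∀ ts e → coefficientIn (concatMap ∂-term ts) e
                           ≡ ∑ℕ ts (λ t → coefficientIn (∂₁ t) e) + ∑ℕ ts (λ t → coefficientIn (∂₂ t) e)
                             + ∑ℕ ts (λ t → coefficientIn (∂₃ t) e)
  coefficientIn-∂ ts e = begin
    ∑ℕ (concatMap ∂-term ts) g
      ≡⟨ ℕΣ.∑-concatMap ∂-term ts g ⟩
    ∑ℕ ts (λ t → ∑ℕ (∂-term t) g)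
      ≡⟨ ℕΣ.∑-cong ts (λ t _ → trans (ℕΣ.∑-++ (∂₁ t) _ g) (cong (∑ℕ (∂₁ t) g +_) (ℕΣ.∑-++ (∂₂ t) (∂₃ t) g))) ⟩
    ∑ℕ ts (λ t → ∑ℕ (∂₁ t) g + (∑ℕ (∂₂ t) g + ∑ℕ (∂₃ t) g))
      ≡⟨ trans (ℕΣ.∑-distrib-+ ts _ _) (cong (∑ℕ ts (λ t → ∑ℕ (∂₁ t) g) +_) (ℕΣ.∑-distrib-+ ts _ _)) ⟩
    ∑ℕ ts (λ t → ∑ℕ (∂₁ t) g) + (∑ℕ ts (λ t → ∑ℕ (∂₂ t) g) + ∑ℕ ts (λ t → ∑ℕ (∂₃ t) g))
      ≡⟨ sym (ℕₚ.+-assoc (∑ℕ ts (λ t → ∑ℕ (∂₁ t) g)) (∑ℕ ts (λ t → ∑ℕ (∂₂ t) g)) (∑ℕ ts (λ t → ∑ℕ (∂₃ t) g))) ⟩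
    ∑ℕ ts (λ t → ∑ℕ (∂₁ t) g) + ∑ℕ ts (λ t → ∑ℕ (∂₂ t) g) + ∑ℕ ts (λ t → ∑ℕ (∂₃ t) g) ∎
    where
    open ≡-Reasoning
    g : Term → ℕ
    g t = if exponents t ≡ᵗ e then coefficient t else 0

  pred?-cong : ∀ {f g : ℕ → ℕ} → (∀ m → f m ≡ g m) → ∀ k → pred? f k ≡ pred? g k
  pred?-cong f≗g zero    = refl
  pred?-cong f≗g (suc k) = f≗g k

  coefficientIn-expansion : ∀ n i j k → coefficientIn (expansion n) (i , j , k) ≡ γ (suc n) i j k
  coefficientIn-expansion zero zero    zero    zero                = refl
  coefficientIn-expansion zero zero    zero    (suc zero)          = refl
  coefficientIn-expansion zero zero    zero    (suc (suc k))       = refl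
  coefficientIn-expansion zero zero    (suc j) k                   = refl
  coefficientIn-expansion zero (suc i) j       k                   = refl
  coefficientIn-expansion (suc n) i j k = begin
    coefficientIn (concatMap ∂-term ts) (i , j , k)
      ≡⟨ coefficientIn-∂ ts (i , j , k) ⟩
    ∑ℕ ts (λ t → coefficientIn (∂₁ t) (i , j , k)) + ∑ℕ ts (λ t → coefficientIn (∂₂ t) (i , j , k))
      + ∑ℕ ts (λ t → coefficientIn (∂₃ t) (i , j , k))
      ≡⟨ cong₂ _+_ (cong₂ _+_ (∂₁-contribution ts i j k) (∂₂-contribution ts i j k)) (∂₃-contribution ts i j k) ⟩
    pred? (λ k′ → 3 * (i + 1) * coefficientIn ts (suc i , j , k′)) k
      + pred? (λ i′ → pred? (λ k′ → 2 * (j + 1) * coefficientIn ts (i′ , suc j , k′)) k) i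
      + pred? (λ j′ → k * coefficientIn ts (i , j′ , k)) j
      ≡⟨ cong₂ _+_ (cong₂ _+_
           (pred?-cong (λ k′ → cong (3 * (i + 1) *_) (coefficientIn-expansion n (suc i) j k′)) k)
           (pred?-cong (λ i′ → pred?-cong (λ k′ → cong (2 * (j + 1) *_) (coefficientIn-expansion n i′ (suc j) k′)) k) i))
           (pred?-cong (λ j′ → cong (k *_) (coefficientIn-expansion n i j′ k)) j) ⟩
    γ (suc (suc n)) i j k ∎
    where
    open ≡-Reasoning
    ts = expansion n

module RationalEvaluation where

  open Preliminaries
  open CommutativeSemirings
  open StirlingWords
  open ValueTypes
  open DerivationPolynomials
  open StatisticWeights
  open Enumeration
  open Coefficients
  open import Defs
  open import Data.Nat using (ℕ; zero; suc; _+_; _*_; _≥_)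
  open import Data.Nat.Tactic.RingSolver using (solve-∀)
  open import Data.Bool using (true; false; if_then_else_)
  open import Data.List using (map)
  open import Data.Product using (_,_; proj₁; proj₂)
  open import Data.Integer as ℤ using (+_)
  import Data.Integer.Properties as ℤₚ
  open import Data.Rational as Q using (ℚ; 1ℚ; NonZero; _÷_; 1/_)
  import Data.Rational.Properties as Qₚ
  import Data.Rational.Unnormalised as ℚᵘ
  import Data.Rational.Unnormalised.Properties as ℚᵘₚ
  open import Algebra.Structures using (IsCommutativeRing)
  import Algebra.Solver.CommutativeMonoid as CommutativeMonoidSolver
  open import Relation.Binary.PropositionalEquality

  ℚ-semiring : ≡-CommutativeSemiring
  ℚ-semiring = record { isCommutativeSemiring = IsCommutativeRing.isCommutativeSemiring Qₚ.+-*-isCommutativeRing }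

  module ℚΣ = SemiringSums ℚ-semiring

  private
    module *-Solver = CommutativeMonoidSolver ℚΣ.*-commutativeMonoid

  ^≡ℚΣ^ : ∀ a k → a ^ k ≡ a ℚΣ.^ k
  ^≡ℚΣ^ a zero    = refl
  ^≡ℚΣ^ a (suc k) = cong (a Q.*_) (^≡ℚΣ^ a k)

  -- ℕ→ℚ normalises through a gcd and does not compute on variables, so compare in ℚᵘ.
  ℕ→ℚ-suc : ∀ m → ℕ→ℚ (suc m) ≡ 1ℚ Q.+ ℕ→ℚ m
  ℕ→ℚ-suc m = Qₚ.toℚᵘ-injective (ℚᵘₚ.≃-trans (Qₚ.toℚᵘ-fromℚᵘ (ℚᵘ.mkℚᵘ (+ suc m) 0))
    (ℚᵘₚ.≃-sym (ℚᵘₚ.≃-trans (Qₚ.toℚᵘ-homo-+ 1ℚ (ℕ→ℚ m))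
      (ℚᵘₚ.≃-trans (ℚᵘₚ.+-congʳ (Q.toℚᵘ 1ℚ) (Qₚ.toℚᵘ-fromℚᵘ (ℚᵘ.mkℚᵘ (+ m) 0)))
        (ℚᵘ.*≡* (cong (λ a → (+ 1 ℤ.+ a) ℤ.* + 1) (ℤₚ.*-identityʳ (+ m))))))))

  ·≡ℕ→ℚ* : ∀ n a → n ℚΣ.· a ≡ ℕ→ℚ n Q.* a
  ·≡ℕ→ℚ* zero    a = sym (Qₚ.*-zeroˡ a)
  ·≡ℕ→ℚ* (suc n) a = begin
    a Q.+ n ℚΣ.· a                ≡⟨ cong₂ Q._+_ (sym (Qₚ.*-identityˡ a)) (·≡ℕ→ℚ* n a) ⟩
    1ℚ Q.* a Q.+ ℕ→ℚ n Q.* a      ≡⟨ sym (Qₚ.*-distribʳ-+ a 1ℚ (ℕ→ℚ n)) ⟩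
    (1ℚ Q.+ ℕ→ℚ n) Q.* a          ≡⟨ cong (Q._* a) (sym (ℕ→ℚ-suc n)) ⟩
    ℕ→ℚ (suc n) Q.* a             ∎
    where open ≡-Reasoning

  module Evaluation (x y z p q r s t : ℚ) .{{_ : NonZero t}} where
    open StatisticWeight ℚ-semiring x y z p q r s t using (U; weight; weight≡∏U)
    open ElementaryWeights ℚ-semiring U using (e₀; e₁; e₂; e₃; ⟦_⟧; Φ; Λ)
    open ℚΣ using (_·_; ∑; ∑-cong; ∑-↭; *-distribˡ-∑; ∑-if-×; module Keyed; ^-distrib-*; ^-homo-*; *-identityʳ; *-identityˡ)
    open *-Solver using (_⊕_; _⊜_; id)
    open ≡-Reasoning

    A B C : ℚ
    A = x Q.+ y Q.+ z
    B = x Q.* y Q.* p Q.+ x Q.* z Q.* q Q.+ y Q.* z Q.* r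
    C = x Q.* y Q.* z Q.* p Q.* q Q.* r Q.* s

    e₀≡t : e₀ ≡ t
    e₀≡t = *-Solver.solve 1 (λ a → ((((((id ⊕ id) ⊕ id) ⊕ id) ⊕ id) ⊕ id) ⊕ id) ⊕ a ⊜ a) refl t

    e₁≡A : e₁ ≡ A
    e₁≡A = cong₂ Q._+_ (cong₂ Q._+_
      (*-Solver.solve 1 (λ a → ((((((a ⊕ id) ⊕ id) ⊕ id) ⊕ id) ⊕ id) ⊕ id) ⊕ id ⊜ a) refl x)
      (*-Solver.solve 1 (λ a → ((((((id ⊕ a) ⊕ id) ⊕ id) ⊕ id) ⊕ id) ⊕ id) ⊕ id ⊜ a) refl y))
      (*-Solver.solve 1 (λ a → ((((((id ⊕ id) ⊕ a) ⊕ id) ⊕ id) ⊕ id) ⊕ id) ⊕ id ⊜ a) refl z)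

    e₂≡B : e₂ ≡ B
    e₂≡B = cong₂ Q._+_ (cong₂ Q._+_
      (*-Solver.solve 3 (λ a b c → ((((((a ⊕ b) ⊕ id) ⊕ c) ⊕ id) ⊕ id) ⊕ id) ⊕ id ⊜ (a ⊕ b) ⊕ c) refl x y p)
      (*-Solver.solve 3 (λ a b c → ((((((a ⊕ id) ⊕ b) ⊕ id) ⊕ c) ⊕ id) ⊕ id) ⊕ id ⊜ (a ⊕ b) ⊕ c) refl x z q))
      (*-Solver.solve 3 (λ a b c → ((((((id ⊕ a) ⊕ b) ⊕ id) ⊕ id) ⊕ c) ⊕ id) ⊕ id ⊜ (a ⊕ b) ⊕ c) refl y z r)

    e₃≡C : e₃ ≡ C
    e₃≡C = *-identityʳ C

    scaled : Triple → ℚ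
    scaled (i , j , k) = (A ÷ t) ℚΣ.^ i Q.* (B ÷ t) ℚΣ.^ j Q.* (C ÷ t) ℚΣ.^ k

    private
      t^k*t⁻ᵏ≡1 : ∀ k → t ℚΣ.^ k Q.* (1/ t) ℚΣ.^ k ≡ 1ℚ
      t^k*t⁻ᵏ≡1 k = trans (sym (^-distrib-* t (1/ t) k)) (trans (cong (ℚΣ._^ k) (Qₚ.*-inverseʳ t)) (^-one k))
        where
        ^-one : ∀ k → 1ℚ ℚΣ.^ k ≡ 1ℚ
        ^-one zero    = refl
        ^-one (suc k) = trans (*-identityˡ _) (^-one k)

    monomial≡ : ∀ i j k m N → i + j + k + m ≡ N →
                A ℚΣ.^ i Q.* B ℚΣ.^ j Q.* C ℚΣ.^ k Q.* t ℚΣ.^ m ≡ t ℚΣ.^ N Q.* scaled (i , j , k)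
    monomial≡ i j k m N degree = begin
      Aⁱ Q.* Bʲ Q.* Cᵏ Q.* tᵐ
        ≡⟨ sym (trans (cong (Aⁱ Q.* Bʲ Q.* Cᵏ Q.* tᵐ Q.*_) (trans (cong₂ Q._*_ (t^k*t⁻ᵏ≡1 i) (cong₂ Q._*_ (t^k*t⁻ᵏ≡1 j) (t^k*t⁻ᵏ≡1 k)))
                                                         (trans (*-identityˡ _) (*-identityˡ _))))
                      (*-identityʳ _)) ⟩
      Aⁱ Q.* Bʲ Q.* Cᵏ Q.* tᵐ Q.* ((t ℚΣ.^ i Q.* uⁱ) Q.* ((t ℚΣ.^ j Q.* uʲ) Q.* (t ℚΣ.^ k Q.* uᵏ)))
        ≡⟨ *-Solver.solve 10 (λ a b c tm ti ui tj uj tk uk →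
             (((a ⊕ b) ⊕ c) ⊕ tm) ⊕ ((ti ⊕ ui) ⊕ ((tj ⊕ uj) ⊕ (tk ⊕ uk)))
             ⊜ (tm ⊕ (ti ⊕ (tj ⊕ tk))) ⊕ (((a ⊕ ui) ⊕ (b ⊕ uj)) ⊕ (c ⊕ uk)))
             refl Aⁱ Bʲ Cᵏ tᵐ (t ℚΣ.^ i) uⁱ (t ℚΣ.^ j) uʲ (t ℚΣ.^ k) uᵏ ⟩
      (tᵐ Q.* (t ℚΣ.^ i Q.* (t ℚΣ.^ j Q.* t ℚΣ.^ k))) Q.* ((Aⁱ Q.* uⁱ) Q.* (Bʲ Q.* uʲ) Q.* (Cᵏ Q.* uᵏ))
        ≡⟨ cong₂ Q._*_ t^N (sym (cong₂ Q._*_ (cong₂ Q._*_ (^-distrib-* A (1/ t) i) (^-distrib-* B (1/ t) j)) (^-distrib-* C (1/ t) k))) ⟩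
      t ℚΣ.^ N Q.* scaled (i , j , k) ∎
      where
      Aⁱ = A ℚΣ.^ i
      Bʲ = B ℚΣ.^ j
      Cᵏ = C ℚΣ.^ k
      tᵐ = t ℚΣ.^ m
      uⁱ = (1/ t) ℚΣ.^ i
      uʲ = (1/ t) ℚΣ.^ j
      uᵏ = (1/ t) ℚΣ.^ k
      t^N : tᵐ Q.* (t ℚΣ.^ i Q.* (t ℚΣ.^ j Q.* t ℚΣ.^ k)) ≡ t ℚΣ.^ N
      t^N = trans (sym (trans (^-homo-* t m (i + (j + k)))
                         (cong (tᵐ Q.*_) (trans (^-homo-* t i (j + k)) (cong (t ℚΣ.^ i Q.*_) (^-homo-* t j k))))))
                  (cong (t ℚΣ.^_) (trans (reorder i j k m) degree))
        where
        reorder : ∀ i j k m → m + (i + (j + k)) ≡ i + j + k + m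
        reorder = solve-∀

    Qpoly≡Φ : ∀ n → Qpoly n x y z p q r s t ≡ Φ n
    Qpoly≡Φ n = trans (∑-↭ _ (Stirling↭byInsertion n))
      (∑-cong (byInsertion n) (λ σ σ∈ → trans (Defs-weight≡weight σ) (weight≡∏U n σ (byInsertion⇒isStirling n σ σ∈))))
      where
      Defs-weight≡weight : ∀ σ → x ^ asc n σ Q.* y ^ plat n σ Q.* z ^ des n σ Q.* p ^ lap n σ
                                 Q.* q ^ eud n σ Q.* r ^ rpd n σ Q.* s ^ apd n σ Q.* t ^ vv n σ ≡ weight n σ
      Defs-weight≡weight σ rewrite ^≡ℚΣ^ x (asc n σ) | ^≡ℚΣ^ y (plat n σ) | ^≡ℚΣ^ z (des n σ) | ^≡ℚΣ^ p (lap n σ)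
                                 | ^≡ℚΣ^ q (eud n σ) | ^≡ℚΣ^ r (rpd n σ) | ^≡ℚΣ^ s (apd n σ) | ^≡ℚΣ^ t (vv n σ) = refl

    γ-term : ℕ → Triple → ℚ
    γ-term N (i , j , k) = ℕ→ℚ (γ N i j k) Q.* (A ÷ t) ℚΣ.^ i Q.* (B ÷ t) ℚΣ.^ j Q.* (C ÷ t) ℚΣ.^ k

    Λ≡γ-expansion : ∀ n → Λ n ≡ t ℚΣ.^ suc n Q.* ∑ (triples (2 * suc n + 1)) (γ-term (suc n))
    Λ≡γ-expansion n = begin
      ∑ ts ⟦_⟧
        ≡⟨ ∑-cong ts (λ { (c , i , j , k , m) τ∈ → term≡ c i j k m (proj₁ (expansion-degrees n _ τ∈)) }) ⟩
      ∑ ts (λ τ → coefficient τ · V (exponents τ))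
        ≡⟨ ∑-groupBy ts T exponents _ (triples-unique (2 * N + 1))
                     (λ { (c , i , j , k , m) τ∈ → ∈-triples⁺ (2 * N + 1) i j k (proj₂ (expansion-degrees n _ τ∈)) }) ⟩
      ∑ T (λ e → ∑ ts (λ τ → if exponents τ ≡ᵗ e then coefficient τ · V (exponents τ) else 0ℚ))
        ≡⟨ ∑-cong T (λ e _ → ∑-cong ts (λ τ _ → at-exponents e τ)) ⟩
      ∑ T (λ e → ∑ ts (λ τ → if exponents τ ≡ᵗ e then coefficient τ · V e else 0ℚ))
        ≡⟨ ∑-cong T (λ e _ → ∑-if-× ts (λ τ → exponents τ ≡ᵗ e) coefficient (V e)) ⟩
      ∑ T (λ e → coefficientIn ts e · V e)
        ≡⟨ ∑-cong T (λ { (i , j , k) _ → coefficient·V≡ i j k }) ⟩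
      ∑ T (λ e → t ℚΣ.^ N Q.* γ-term N e)
        ≡⟨ sym (*-distribˡ-∑ T (t ℚΣ.^ N) (γ-term N)) ⟩
      t ℚΣ.^ N Q.* ∑ T (γ-term N) ∎
      where
      open Keyed _≡ᵗ_ ≡ᵗ⇒≡ ≡ᵗ-refl using (∑-groupBy)
      N = suc n
      ts = expansion n
      T = triples (2 * N + 1)
      0ℚ = ℚ-semiring .≡-CommutativeSemiring.0#
      V : Triple → ℚ
      V e = t ℚΣ.^ N Q.* scaled e
      term≡ : ∀ c i j k m → i + j + k + m ≡ N → ⟦ c , i , j , k , m ⟧ ≡ c · V (i , j , k)
      term≡ c i j k m degree = cong (c ·_) (trans
        (cong₂ Q._*_ (cong₂ Q._*_ (cong₂ Q._*_ (cong (ℚΣ._^ i) e₁≡A) (cong (ℚΣ._^ j) e₂≡B)) (cong (ℚΣ._^ k) e₃≡C)) (cong (ℚΣ._^ m) e₀≡t))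
        (monomial≡ i j k m N degree))
      at-exponents : ∀ e τ → (if exponents τ ≡ᵗ e then coefficient τ · V (exponents τ) else 0ℚ)
                           ≡ (if exponents τ ≡ᵗ e then coefficient τ · V e else 0ℚ)
      at-exponents e τ with exponents τ ≡ᵗ e in eq
      ... | true  = cong (λ e′ → coefficient τ · V e′) (≡ᵗ⇒≡ (exponents τ) e eq)
      ... | false = refl
      coefficient·V≡ : ∀ i j k → coefficientIn ts (i , j , k) · V (i , j , k) ≡ t ℚΣ.^ N Q.* γ-term N (i , j , k)
      coefficient·V≡ i j k = begin
        coefficientIn ts (i , j , k) · V (i , j , k)
          ≡⟨ cong (_· V (i , j , k)) (coefficientIn-expansion n i j k) ⟩
        γ N i j k · V (i , j , k)
          ≡⟨ ·≡ℕ→ℚ* (γ N i j k) _ ⟩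
        ℕ→ℚ (γ N i j k) Q.* (t ℚΣ.^ N Q.* (a Q.* b Q.* c))
          ≡⟨ *-Solver.solve 5 (λ g tn a b c → g ⊕ (tn ⊕ ((a ⊕ b) ⊕ c)) ⊜ tn ⊕ (((g ⊕ a) ⊕ b) ⊕ c)) refl
                              (ℕ→ℚ (γ N i j k)) (t ℚΣ.^ N) a b c ⟩
        t ℚΣ.^ N Q.* γ-term N (i , j , k) ∎
        where
        a = (A ÷ t) ℚΣ.^ i
        b = (B ÷ t) ℚΣ.^ j
        c = (C ÷ t) ℚΣ.^ k

    γ-term≡ : ∀ N i j k → ℕ→ℚ (γ N i j k) Q.* (A ÷ t) ^ i Q.* (B ÷ t) ^ j Q.* (C ÷ t) ^ k ≡ γ-term N (i , j , k)
    γ-term≡ N i j k rewrite ^≡ℚΣ^ (A ÷ t) i | ^≡ℚΣ^ (B ÷ t) j | ^≡ℚΣ^ (C ÷ t) k = refl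

open import Defs
open import Data.Nat using (ℕ; _≥_; _+_; _*_)
open import Data.Product using (_×_; _,_)
open import Data.List using (map)
open import Data.Rational using (ℚ; NonZero; _÷_)
open import Relation.Binary.PropositionalEquality using (_≡_)
import Data.Rational as Q
open import Data.Nat using (suc)
open import Relation.Binary.PropositionalEquality using (sym; cong₂; module ≡-Reasoning)
open StatisticWeights using (module StatisticWeight)
open DerivationPolynomials using (module ElementaryWeights; Φ≡Λ)
open RationalEvaluation

theorem4 : (n : ℕ) → n ≥ 1 →
    (x y z p q r s t : ℚ) → .{{_ : NonZero t}} →
    Qpoly n x y z p q r s t
      ≡ t ^ n Q.* ℚsum (map (λ { (i , j , k) →
            ℕ→ℚ (γ n i j k)
              Q.* ((x Q.+ y Q.+ z) ÷ t) ^ i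
              Q.* ((x Q.* y Q.* p Q.+ x Q.* z Q.* q Q.+ y Q.* z Q.* r) ÷ t) ^ j
              Q.* ((x Q.* y Q.* z Q.* p Q.* q Q.* r Q.* s) ÷ t) ^ k })
          (triples (2 * n + 1)))
theorem4 (suc n) _ x y z p q r s t = begin
  Qpoly (suc n) x y z p q r s t                           ≡⟨ Qpoly≡Φ (suc n) ⟩
  Φ (suc n)                                               ≡⟨ Φ≡Λ n ℚ-semiring U ⟩
  Λ n                                                     ≡⟨ Λ≡γ-expansion n ⟩
  t ℚΣ.^ suc n Q.* ℚΣ.∑ triples′ (γ-term (suc n))
    ≡⟨ cong₂ Q._*_ (sym (^≡ℚΣ^ t (suc n))) (ℚΣ.∑-cong triples′ λ { (i , j , k) _ → sym (γ-term≡ (suc n) i j k) }) ⟩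
  _ ∎
  where
  open Evaluation x y z p q r s t
  open StatisticWeight ℚ-semiring x y z p q r s t using (U)
  open ElementaryWeights ℚ-semiring U using (Φ; Λ)
  open ≡-Reasoning
  triples′ = triples (2 * suc n + 1)
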